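{- Let $\mathbf{m}\in\mathbb{N}^t$ have entries, after permuting, $\mathbf{m}=(e_1,\dots,e_k,o_1,\dots,o_\ell)$ with $e_1\ge\cdots\ge e_k$ even, $o_1\ge\cdots\ge o_\ell$ odd, $k,\ell\ge1$, $k+\ell=t$. Let $\mathbf{m}_e$ be obtained from $\mathbf{m}$ by subtracting $1$ from every even entry, and $\mathbf{m}_o$ by subtracting $1$ from every odd entry. (i) If all entries of $\mathbf{m}$ are at least $2$, then \[ N(CB(\mathbf{m}))=\Big(\prod_{j=1}^k e_j\Big)F(\mathbf{m}_e)+\Big(\prod_{j=1}^\ell o_j\Big)F(\mathbf{m}_o). \] (ii) If $0\le p<\ell$ with $o_1,\dots,o_p>1$ and $o_{p+1}=\cdots=o_\ell=1$, then \[ N(CB(\mathbf{m}))=\Big(\prod_{j=1}^k e_j\Big)F(\mathbf{m}_e)+\Big(\prod_{j=1}^\ell o_j\Big)N\Big(\big(\textstyle\bigvee_{j=1}^k C_{e_j}\big)\vee\big(\bigvee_{j=1}^p C_{o_j-1}\big)\Big). \]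
   Context: For $\mathbf{m}\in\mathbb{N}^t$, $CB(\mathbf{m})$ is the graph consisting of two distinct vertices joined by $t$ internally vertex-disjoint paths of lengths $m_1,\dots,m_t$. For a vector $\mathbf{x}$ of positive integers all of the same parity, sorted as $x_1\ge\cdots\ge x_s$, $F(\mathbf{x})=\sum_{j=0}^{x_s}\binom{x_s}{j}\prod_{i=1}^{s-1}\binom{x_i}{\frac12(x_i-x_s)+j}$ (inputs are first sorted into nonincreasing order). $C_m$ is the cycle with $m$ edges ($C_2$ being two vertices joined by two parallel edges), and $\bigvee$ denotes a wedge, i.e., a graph obtained by successively identifying one vertex of each graph with a vertex of the previous ones. For a finite connected graph $G=(V,E)$, possibly with parallel edges, $N(G)$ denotes the number of functions $f:V\to\mathbb{Z}$, modulo adding a common constant, such that $|f(u)-f(v)|\le1$ for every edge $uv$ and the edges with $|f(u)-f(v)|=1$ form a connected spanning subgraph; for simple $G$ this equals the number of facets of the symmetric edge polytope $P_G=\operatorname{conv}\{\pm(e_i-e_j):\{i,j\}\in E\}$ (and a $C_2$ counts as a single edge, $N(C_2)=2$). -}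

module Defs where

open import Data.Nat using (ℕ; zero; suc; _+_; _*_; _∸_; _≤_; _<_; ⌊_/2⌋)
open import Data.Nat.Properties using (≤-decTotalOrder)
open import Data.Nat.Divisibility using (_∣_; _∣?_)
open import Data.Nat.Combinatorics using (_C_)
open import Data.Integer as ℤ using (ℤ; ∣_∣) renaming (_-_ to _-ℤ_)
open import Data.Fin using (Fin; zero; suc; inject₁; _↑ˡ_; _↑ʳ_; fromℕ)
open import Data.Product using (Σ; _×_; _,_; ∃)
open import Data.Sum using (_⊎_)
open import Data.List using (List; []; _∷_; _++_; map; foldr; length; tabulate; upTo)
open import Data.Nat.ListAction using (sum; product)
open import Data.List.Membership.Propositional using (_∈_)
open import Data.List.Relation.Unary.Unique.Propositional using (Unique)
open import Data.Vec using (Vec; lookup)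
open import Data.Bool using (if_then_else_)
open import Relation.Nullary using (does)
open import Relation.Binary.PropositionalEquality using (_≡_)
open import Relation.Binary.Construct.Closure.ReflexiveTransitive using (Star)
import Data.List.Sort.InsertionSort as SortM
open SortM ≤-decTotalOrder using (sort)

record Graph : Set where
  constructor graph
  field
    n     : ℕ
    edges : List (Fin (suc n) × Fin (suc n))
open Graph public

-- Admissible functions f : V → ℤ, normalised by f(vertex 0) = 0
-- (one representative per class modulo adding a common constant).
module _ (G : Graph) where
  private V = Fin (suc (n G))

  Tight : Vec ℤ (suc (n G)) → V → V → Set
  Tight f u v = ((u , v) ∈ edges G ⊎ (v , u) ∈ edges G)
                × ∣ lookup f u -ℤ lookup f v ∣ ≡ 1

  Admissible : Vec ℤ (suc (n G)) → Set
  Admissible f = (lookup f zero ≡ ℤ.0ℤ)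
               × (∀ u v → (u , v) ∈ edges G → ∣ lookup f u -ℤ lookup f v ∣ ≤ 1)
               × (∀ v → Star (Tight f) zero v)

HasCount : ∀ {k} → (Vec ℤ k → Set) → ℕ → Set
HasCount {k} P c = Σ (List (Vec ℤ k)) λ xs →
  Unique xs × length xs ≡ c × (∀ f → f ∈ xs → P f) × (∀ f → P f → f ∈ xs)

N≡ : Graph → ℕ → Set
N≡ G c = HasCount (Admissible G) c

-- CB(m): vertices 0 and 1 are the two ends, joined by paths of length m_i

Edges : ℕ → Set
Edges k = List (Fin k × Fin k)

-- path of length k+1 from vertex 0 to vertex 1 through new vertices 2..k+1
pathE : (k : ℕ) → Edges (2 + k)
pathE zero    = (zero , suc zero) ∷ []
pathE (suc k) = (zero , suc (suc zero))
              ∷ tabulate (λ (i : Fin k) → (suc (suc (inject₁ i)) , suc (suc (suc i))))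
              ++ ((suc (suc (fromℕ k)) , suc zero) ∷ [])

glue2 : ∀ a b → Edges (2 + a) → Edges (2 + b) → Edges (2 + a + b)
glue2 a b E₁ E₂ = map (λ { (u , v) → (l u , l v) }) E₁ ++ map (λ { (u , v) → (r u , r v) }) E₂
  where
  l : Fin (2 + a) → Fin (2 + a + b)
  l i = i ↑ˡ b
  r : Fin (2 + b) → Fin (2 + a + b)
  r zero          = zero
  r (suc zero)    = suc zero
  r (suc (suc j)) = (2 + a) ↑ʳ j

cbSize : List ℕ → ℕ
cbSize []       = 0
cbSize (m ∷ ms) = (m ∸ 1) + cbSize ms

cbEdges : (ms : List ℕ) → Edges (2 + cbSize ms)
cbEdges []       = []
cbEdges (m ∷ ms) = glue2 (m ∸ 1) (cbSize ms) (pathE (m ∸ 1)) (cbEdges ms)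

CB : List ℕ → Graph
CB ms = graph (suc (cbSize ms)) (cbEdges ms)

-- cycle of length k+1 through vertex 0 and new vertices 1..k
cycE : (k : ℕ) → Edges (suc k)
cycE k = tabulate (λ (i : Fin k) → (inject₁ i , suc i)) ++ ((fromℕ k , zero) ∷ [])

glue1 : ∀ a b → Edges (suc a) → Edges (suc b) → Edges (suc a + b)
glue1 a b E₁ E₂ = map (λ { (u , v) → (l u , l v) }) E₁ ++ map (λ { (u , v) → (r u , r v) }) E₂
  where
  l : Fin (suc a) → Fin (suc a + b)
  l i = i ↑ˡ b
  r : Fin (suc b) → Fin (suc a + b)
  r zero    = zero
  r (suc j) = (suc a) ↑ʳ j

wedgeSize : List ℕ → ℕ
wedgeSize []       = 0
wedgeSize (c ∷ cs) = (c ∸ 1) + wedgeSize cs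

wedgeEdges : (cs : List ℕ) → Edges (suc (wedgeSize cs))
wedgeEdges []       = []
wedgeEdges (c ∷ cs) = glue1 (c ∸ 1) (wedgeSize cs) (cycE (c ∸ 1)) (wedgeEdges cs)

-- ⋁_{c ∈ cs} C_c  (each c ≥ 2; C_2 is a double edge)
WedgeC : List ℕ → Graph
WedgeC cs = graph (wedgeSize cs) (wedgeEdges cs)

Even : ℕ → Set
Even x = 2 ∣ x

Odd : ℕ → Set
Odd x = 2 ∣ suc x

decEven : List ℕ → List ℕ
decEven = map (λ x → if does (2 ∣? x) then x ∸ 1 else x)

decOdd : List ℕ → List ℕ
decOdd = map (λ x → if does (2 ∣? x) then x else x ∸ 1)

sumTo : ℕ → (ℕ → ℕ) → ℕ
sumTo s f = sum (map f (upTo (suc s)))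

-- F for a list whose minimum is xs and whose remaining entries are xs'
F′ : ℕ → List ℕ → ℕ
F′ xs others = sumTo xs λ j → (xs C j) * product (map (λ xi → xi C (⌊ (xi ∸ xs) /2⌋ + j)) others)

-- F(x): sort (ascending, so the head is x_s = min), then apply the formula
F : List ℕ → ℕ
F x with sort x
... | []           = 1
... | (xs ∷ rest)  = F′ xs rest

{-# OPTIONS --safe #-}
-- Normalise f(0) = 0 and sort the admissible f by d = f(1). On a path of length k between the two
-- terminals, f is a walk from 0 to d with steps in {-1, 0, 1}; its tight edges span the path when no
-- step is 0, split it into the two terminal components when exactly one step is 0, and strand an inner
-- vertex otherwise. The tight graph of CB(m) is connected iff some path spans and every other path spans
-- or splits, so for fixed d the count is ∏ (cᵢ + sᵢ) − ∏ sᵢ with cᵢ = C(mᵢ, (mᵢ + d)/2) and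
-- sᵢ = mᵢ C(mᵢ − 1, (mᵢ − 1 + d)/2). A ±1 walk only reaches d of the parity of its length, so for odd d
-- the even paths contribute eⱼ C(eⱼ − 1, …), the odd ones C(oⱼ, …) and ∏ sᵢ = 0; summing over d gives
-- (∏ eⱼ) F(mₑ), and even d give (∏ oⱼ) F(mₒ) likewise. If some oⱼ = 1 then mₒ contains 0, only d = 0
-- survives, and the remaining product of central binomials C(c, c/2) is N of the wedge of even cycles.
module Submission where

module Counting where

  open import Data.Nat using (ℕ; _+_; _*_)
  open import Data.List using (List; []; _∷_; _++_; map; length; cartesianProduct)
  open import Data.List.Properties using (length-map; length-++)
  open import Data.List.Membership.Propositional using (_∈_)
  open import Data.List.Membership.Propositional.Properties
  open import Data.List.Relation.Unary.Unique.Propositional using (Unique)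
  open import Data.List.Relation.Unary.Unique.Propositional.Properties as UP
  open import Data.List.Relation.Unary.All as All using (All; []; _∷_)
  import Data.List.Relation.Unary.All.Properties as AllP
  open import Data.List.Relation.Unary.AllPairs using ([]; _∷_)
  open import Data.List.Relation.Unary.Any using (here; there)
  open import Data.Product using (Σ; _×_; _,_; ∃; proj₁; proj₂)
  open import Data.Sum using (_⊎_; inj₁; inj₂)
  open import Data.Empty using (⊥; ⊥-elim)
  open import Relation.Nullary using (¬_)
  open import Relation.Binary.PropositionalEquality

  HasCountIn : (A : Set) → (A → Set) → ℕ → Set
  HasCountIn A P c = Σ (List A) λ xs →
    Unique xs × length xs ≡ c × (∀ f → f ∈ xs → P f) × (∀ f → P f → f ∈ xs)

  module _ {A : Set} where
    count-resp : ∀ {P Q : A → Set} {c} → (∀ f → P f → Q f) → (∀ f → Q f → P f) → HasCountIn A P c → HasCountIn A Q c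
    count-resp pq qp (xs , u , l , s , c) = xs , u , l , (λ f m → pq f (s f m)) , (λ f q → c f (qp f q))

    count-≡ : ∀ {P : A → Set} {c c'} → c ≡ c' → HasCountIn A P c → HasCountIn A P c'
    count-≡ refl h = h

    count-none : ∀ {P : A → Set} → (∀ f → ¬ P f) → HasCountIn A P 0
    count-none np = [] , [] , refl , (λ f ()) , (λ f p → ⊥-elim (np f p))

    count-singleton : (a : A) → HasCountIn A (λ f → f ≡ a) 1
    count-singleton a = a ∷ [] , [] ∷ [] , refl , (λ { f (here e) → e }) , (λ f e → here e)

    count-⊎ : ∀ {P Q : A → Set} {n m} → HasCountIn A P n → HasCountIn A Q m → (∀ f → P f → Q f → ⊥) →
               HasCountIn A (λ f → P f ⊎ Q f) (n + m)
    count-⊎ {n = n} {m} (xs , ux , lx , sx , cx) (ys , uy , ly , sy , cy) dis =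
      xs ++ ys ,
      UP.++⁺ ux uy (λ {f} (a , b) → dis f (sx f a) (sy f b)) ,
      trans (length-++ xs) (cong₂ _+_ lx ly) ,
      (λ f m → Data.Sum.map (sx f) (sy f) (∈-++⁻ xs m)) ,
      (λ { f (inj₁ p) → ∈-++⁺ˡ (cx f p) ; f (inj₂ q) → ∈-++⁺ʳ xs (cy f q) })

  map⁺-injectiveOn : ∀ {A B : Set} (g : A → B) {xs : List A} → Unique xs →
         (∀ {x y} → x ∈ xs → y ∈ xs → g x ≡ g y → x ≡ y) → Unique (map g xs)
  map⁺-injectiveOn g {[]} [] inj = []
  map⁺-injectiveOn g {x ∷ xs} (a ∷ u) inj =
    AllP.map⁺ (All.tabulate (λ {y} y∈ e → All.lookup a y∈ (inj (here refl) (there y∈) e))) ∷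
    map⁺-injectiveOn g u (λ p q e → inj (there p) (there q) e)

  count-image : ∀ {A B : Set} {P : A → Set} {Q : B → Set} {n} (g : A → B) →
             (∀ {x y} → P x → P y → g x ≡ g y → x ≡ y) →
             (∀ x → P x → Q (g x)) → (∀ z → Q z → ∃ λ x → P x × z ≡ g x) →
             HasCountIn A P n → HasCountIn B Q n
  count-image {Q = Q} g inj pq qp (xs , u , l , s , c) =
    map g xs , map⁺-injectiveOn g u (λ a b e → inj (s _ a) (s _ b) e) , trans (length-map g xs) l ,
    (λ z m → let (x , x∈ , e) = ∈-map⁻ g m in subst Q (sym e) (pq x (s x x∈))) ,
    (λ z q → let (x , p , e) = qp z q in subst (_∈ map g xs) (sym e) (∈-map⁺ g (c x p)))

  length-cartesianProduct : ∀ {A B : Set} (xs : List A) (ys : List B) → length (cartesianProduct xs ys) ≡ length xs * length ys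
  length-cartesianProduct [] ys = refl
  length-cartesianProduct (x ∷ xs) ys = trans (length-++ (map (x ,_) ys)) (cong₂ _+_ (length-map _ ys) (length-cartesianProduct xs ys))

  count-× : ∀ {A B : Set} {P : A → Set} {Q : B → Set} {n m} →
            HasCountIn A P n → HasCountIn B Q m → HasCountIn (A × B) (λ z → P (proj₁ z) × Q (proj₂ z)) (n * m)
  count-× (xs , ux , lx , sx , cx) (ys , uy , ly , sy , cy) =
    cartesianProduct xs ys , UP.cartesianProduct⁺ ux uy ,
    trans (length-cartesianProduct xs ys) (cong₂ _*_ lx ly) ,
    (λ { (a , b) m → let (p , q) = ∈-cartesianProduct⁻ xs ys m in sx a p , sy b q }) ,
    (λ { (a , b) (p , q) → ∈-cartesianProduct⁺ (cx a p) (cy b q) })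

  sumOver : ∀ {I : Set} → (I → ℕ) → List I → ℕ
  sumOver c [] = 0
  sumOver c (i ∷ is) = c i + sumOver c is

  module _ {A I : Set} where
    count-⋃ : (P : I → A → Set) (c : I → ℕ) (is : List I) → Unique is →
                  (∀ i → HasCountIn A (P i) (c i)) →
                  (∀ i j f → P i f → P j f → i ≡ j) →
                  HasCountIn A (λ f → ∃ λ i → i ∈ is × P i f) (sumOver c is)
    count-⋃ P c [] u h dis = count-none (λ { f (i , () , _) })
    count-⋃ P c (i ∷ is) (a ∷ u) h dis =
      count-resp (λ { f (inj₁ p) → i , here refl , p ; f (inj₂ (j , m , p)) → j , there m , p })
             (λ { f (j , here refl , p) → inj₁ p ; f (j , there m , p) → inj₂ (j , m , p) })
             (count-⊎ (h i) (count-⋃ P c is u h dis)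
               (λ f p (j , m , q) → All.lookup a m (dis i j f p q)))

module Tightness where

  open import Defs
  open import Data.Nat using (ℕ; zero; suc; _+_; _≤_; _<_; z≤n; s≤s)
  open import Data.Integer using (ℤ; ∣_∣) renaming (_-_ to _-ℤ_)
  open import Data.Integer.Properties using (∣i-j∣≡∣j-i∣; ∣i∣≡0⇒i≡0; i-j≡0⇒i≡j; i≡j⇒i-j≡0)
  open import Data.Fin using (Fin; zero; suc)
  open import Data.Vec using (Vec; lookup)
  open import Data.Bool using (Bool; true; false)
  open import Data.List.Membership.Propositional using (_∈_)
  open import Data.Product using (Σ; _×_; _,_; ∃)
  open import Data.Sum using (_⊎_; inj₁; inj₂)
  open import Data.Empty using (⊥)
  open import Relation.Binary.PropositionalEquality
  open import Relation.Binary.Construct.Closure.ReflexiveTransitive using (Star; ε; _◅_)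

  V : Graph → Set
  V G = Fin (suc (n G))

  dist : ℤ → ℤ → ℕ
  dist a b = ∣ a -ℤ b ∣

  dist-sym : ∀ a b → dist a b ≡ dist b a
  dist-sym a b = ∣i-j∣≡∣j-i∣ a b

  dist≡0⇒≡ : ∀ a b → dist a b ≡ 0 → a ≡ b
  dist≡0⇒≡ a b e = i-j≡0⇒i≡j a b (∣i∣≡0⇒i≡0 e)

  dist-refl : ∀ a → dist a a ≡ 0
  dist-refl a = cong ∣_∣ (i≡j⇒i-j≡0 {a} refl)

  ≤1⇒0⊎1 : ∀ {k} → k ≤ 1 → k ≡ 0 ⊎ k ≡ 1
  ≤1⇒0⊎1 z≤n = inj₁ refl
  ≤1⇒0⊎1 (s≤s z≤n) = inj₂ refl

  module _ (G : Graph) (f : Vec ℤ (suc (n G))) where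
    Lipschitz : Set
    Lipschitz = ∀ u v → (u , v) ∈ edges G → dist (lookup f u) (lookup f v) ≤ 1

    TightClosed : (V G → Bool) → Set
    TightClosed S = ∀ u v → Tight G f u v → S u ≡ true → S v ≡ true

    tightClosed-star : ∀ {S} → TightClosed S → ∀ {x y} → S x ≡ true → Star (Tight G f) x y → S y ≡ true
    tightClosed-star cl sx ε = sx
    tightClosed-star cl sx (t ◅ st) = tightClosed-star cl (cl _ _ t sx) st

    tight-sym : ∀ {u v} → Tight G f u v → Tight G f v u
    tight-sym {u} {v} (inj₁ e , d) = inj₂ e , trans (dist-sym (lookup f v) (lookup f u)) d
    tight-sym {u} {v} (inj₂ e , d) = inj₁ e , trans (dist-sym (lookup f v) (lookup f u)) d

    Connected : Set
    Connected = ∀ v → Star (Tight G f) zero v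

    Disconnected : Set
    Disconnected = Σ (V G → Bool) λ S → S zero ≡ true × TightClosed S × ∃ λ v → S v ≡ false

    connected⇒¬disconnected : Connected → Disconnected → ⊥
    connected⇒¬disconnected sc (S , s0 , cl , v , sv) with trans (sym (tightClosed-star cl s0 (sc v))) sv
    ... | ()

  -- The states of a Lipschitz f on a piece with terminals 0 and 1 besides Connected: two tight components,
  -- one per terminal (Split), or some vertex reaching neither terminal (Stranded).
  module _ {a : ℕ} (E : Edges (2 + a)) (f : Vec ℤ (2 + a)) where
    private G = graph (suc a) E
    one : Fin (2 + a)
    one = suc zero

    Split : Set
    Split = (∀ v → Star (Tight G f) zero v ⊎ Star (Tight G f) one v) ×
         Σ (V G → Bool) λ S → S zero ≡ true × S one ≡ false × TightClosed G f S

    Stranded : Set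
    Stranded = Σ (V G → Bool) λ S → S zero ≡ true × S one ≡ true × TightClosed G f S × ∃ λ v → S v ≡ false

    connected⇒¬split : Connected G f → Split → ⊥
    connected⇒¬split sc (_ , S , s0 , s1 , cl) with trans (sym (tightClosed-star G f cl s0 (sc one))) s1
    ... | ()

    connected⇒¬stranded : Connected G f → Stranded → ⊥
    connected⇒¬stranded sc (S , s0 , s1 , cl , v , sv) with trans (sym (tightClosed-star G f cl s0 (sc v))) sv
    ... | ()

    split⇒¬stranded : Split → Stranded → ⊥
    split⇒¬stranded (r , _) (S , s0 , s1 , cl , v , sv) with r v
    ... | inj₁ st with trans (sym (tightClosed-star G f cl s0 st)) sv
    ... | ()
    split⇒¬stranded (r , _) (S , s0 , s1 , cl , v , sv) | inj₂ st with trans (sym (tightClosed-star G f cl s1 st)) sv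
    ... | ()

  -- An enumeration w 0, …, w L of the vertices of a path or cycle along its edges; it returns to its start
  -- (cycle) or ends at position L (path).
  record Traversal (G : Graph) : Set where
    field
      L : ℕ
      w : ℕ → V G
      pos : V G → ℕ
      e⇒ : ∀ {u v} → (u , v) ∈ edges G → ∃ λ q → q < L × u ≡ w q × v ≡ w (suc q)
      ⇒e : ∀ q → q < L → (w q , w (suc q)) ∈ edges G
      wpos : ∀ v → w (pos v) ≡ v
      posle : ∀ v → pos v ≤ L
      posw : ∀ p → p < L → pos (w p) ≡ p
      posL : pos (w L) ≡ 0 ⊎ pos (w L) ≡ L

module TraversalSteps where

  open import Defs
  open Tightness
  open import Data.Nat as ℕ using (ℕ; zero; suc; _+_; _≤_; _<_; z≤n; s≤s; _≤?_)
  open import Data.Nat.Properties as NP using (≤-reflexive; ≤-refl; ≤-trans; n≤1+n; ≤-pred; ≤∧≢⇒<; <-irrefl; ≤-<-trans; <-≤-trans; m≤n⇒m≤1+n; +-suc)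
  open import Data.Integer using (ℤ) renaming (_-_ to _-ℤ_)
  import Data.Integer.Properties as ZP
  open import Data.Fin using (zero; suc)
  open import Data.Vec using (Vec; lookup)
  open import Data.Bool using (Bool; true; false; not)
  open import Data.Product using (_×_; _,_; ∃; ∃₂)
  open import Data.Sum using (_⊎_; inj₁; inj₂)
  open import Data.Empty using (⊥; ⊥-elim)
  open import Relation.Nullary using (¬_; Dec; yes; no; does)
  open import Relation.Binary.PropositionalEquality
  open import Relation.Binary.Construct.Closure.ReflexiveTransitive using (Star; ε; _◅_; _◅◅_)


  does-≤?⇒≤ : ∀ {m k} → does (m ≤? k) ≡ true → m ≤ k
  does-≤?⇒≤ {m} {k} e = NP.≤ᵇ⇒≤ m k (subst Data.Bool.T (sym e) _)
  does-≤?⇒≰ : ∀ {m k} → does (m ≤? k) ≡ false → ¬ (m ≤ k)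
  does-≤?⇒≰ {m} {k} e le = subst Data.Bool.T e (NP.≤⇒≤ᵇ le)
  ≤⇒does-≤? : ∀ {m k} → m ≤ k → does (m ≤? k) ≡ true
  ≤⇒does-≤? {m} {k} p with m ℕ.≤ᵇ k in eq
  ... | true = refl
  ... | false = ⊥-elim (does-≤?⇒≰ {m} {k} eq p)
  ≰⇒does-≤? : ∀ {m k} → ¬ m ≤ k → does (m ≤? k) ≡ false
  ≰⇒does-≤? {m} {k} p with m ℕ.≤ᵇ k in eq
  ... | true = ⊥-elim (p (does-≤?⇒≤ {m} {k} eq))
  ... | false = refl

  between? : ℕ → ℕ → ℕ → Bool
  between? a b x = does (suc a ≤? x) Data.Bool.∧ does (x ≤? b)

  between?-true : ∀ a b x → between? a b x ≡ true → a < x × x ≤ b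
  between?-true a b x e with suc a ℕ.≤ᵇ x in e1 | x ℕ.≤ᵇ b in e2
  ... | true | true = does-≤?⇒≤ {suc a} {x} e1 , does-≤?⇒≤ {x} {b} e2
  between?-false : ∀ a b x → between? a b x ≡ false → ¬ (a < x × x ≤ b)
  between?-false a b x e (p , q) with suc a ℕ.≤ᵇ x in e1 | x ℕ.≤ᵇ b in e2
  ... | true | false = does-≤?⇒≰ {x} {b} e2 q
  ... | false | _ = does-≤?⇒≰ {suc a} {x} e1 p
  between?-intro : ∀ a b x → a < x → x ≤ b → between? a b x ≡ true
  between?-intro a b x p q rewrite ≤⇒does-≤? {suc a} {x} p | ≤⇒does-≤? {x} {b} q = refl

  not≡true⇒≡false : ∀ {b} → not b ≡ true → b ≡ false
  not≡true⇒≡false {false} _ = refl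
  not≡false⇒≡true : ∀ {b} → not b ≡ false → b ≡ true
  not≡false⇒≡true {true} _ = refl
  ≡false⇒not≡true : ∀ {b} → b ≡ false → not b ≡ true
  ≡false⇒not≡true refl = refl

  none-one-or-two : ∀ {Z : ℕ → Set} (L : ℕ) → (∀ p → Dec (Z p)) →
    (∀ p → p < L → ¬ Z p) ⊎
    (∃ λ a → a < L × Z a × (∀ p → p < L → p ≢ a → ¬ Z p)) ⊎
    (∃₂ λ a b → a < b × b < L × Z a × Z b)
  none-one-or-two zero d = inj₁ (λ p ())
  none-one-or-two {Z} (suc L) d with none-one-or-two {Z} L d | d L
  ... | inj₁ nz | no nzL = inj₁ (λ p p<L → case p p<L)
    where case : ∀ p → p < suc L → ¬ Z p
          case p p<L with p ℕ.≟ L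
          ... | yes refl = nzL
          ... | no ne = nz p (≤∧≢⇒< (≤-pred p<L) ne)
  ... | inj₁ nz | yes zL = inj₂ (inj₁ (L , ≤-refl , zL , λ p p<L ne → nz p (≤∧≢⇒< (≤-pred p<L) ne)))
  ... | inj₂ (inj₁ (a , a<L , za , oth)) | no nzL = inj₂ (inj₁ (a , m≤n⇒m≤1+n a<L , za , case))
    where case : ∀ p → p < suc L → p ≢ a → ¬ Z p
          case p p<L ne with p ℕ.≟ L
          ... | yes refl = nzL
          ... | no ne' = oth p (≤∧≢⇒< (≤-pred p<L) ne') ne
  ... | inj₂ (inj₁ (a , a<L , za , oth)) | yes zL = inj₂ (inj₂ (a , L , a<L , ≤-refl , za , zL))
  ... | inj₂ (inj₂ (a , b , a<b , b<L , za , zb)) | _ = inj₂ (inj₂ (a , b , a<b , m≤n⇒m≤1+n b<L , za , zb))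

  module Steps (G : Graph) (W : Traversal G) (f : Vec ℤ (suc (n G))) where
    open Traversal W
    T = Tight G f

    val : ℕ → ℤ
    val p = lookup f (w p)

    TightStep : ℕ → Set
    TightStep q = dist (val q) (val (suc q)) ≡ 1

    FlatStep : ℕ → Set
    FlatStep q = val q ≡ val (suc q)

    tightStep⇒¬flat : ∀ {q} → TightStep q → FlatStep q → ⊥
    tightStep⇒¬flat {q} t z with trans (sym (cong (λ x → dist x (val (suc q))) z)) t
    ... | e rewrite dist-refl (val (suc q)) with e
    ... | ()

    tightStep⇒tight : ∀ q → q < L → TightStep q → T (w q) (w (suc q))
    tightStep⇒tight q q<L t = inj₁ (⇒e q q<L) , t

    tight⇒tightStep : ∀ {u v} → T u v → ∃ λ q → q < L × TightStep q ×
              ((u ≡ w q × v ≡ w (suc q)) ⊎ (u ≡ w (suc q) × v ≡ w q))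
    tight⇒tightStep (inj₁ e , d) with e⇒ e
    ... | q , q<L , refl , refl = q , q<L , d , inj₁ (refl , refl)
    tight⇒tightStep {u} {v} (inj₂ e , d) with e⇒ e
    ... | q , q<L , refl , refl = q , q<L , trans (dist-sym (val q) (val (suc q))) d , inj₂ (refl , refl)

    lipschitz⇒steps : Lipschitz G f → ∀ q → q < L → dist (val q) (val (suc q)) ≤ 1
    lipschitz⇒steps ok q q<L = ok _ _ (⇒e q q<L)

    steps⇒lipschitz : (∀ q → q < L → dist (val q) (val (suc q)) ≤ 1) → Lipschitz G f
    steps⇒lipschitz h u v e with e⇒ e
    ... | q , q<L , refl , refl = h q q<L

    ¬flat⇒tightStep : Lipschitz G f → ∀ q → q < L → ¬ FlatStep q → TightStep q
    ¬flat⇒tightStep ok q q<L nz with ≤1⇒0⊎1 (lipschitz⇒steps ok q q<L)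
    ... | inj₁ d0 = ⊥-elim (nz (dist≡0⇒≡ _ _ d0))
    ... | inj₂ d1 = d1

    NoFlat : Set
    NoFlat = ∀ p → p < L → TightStep p

    OneFlat : Set
    OneFlat = ∃ λ a → a < L × FlatStep a × (∀ p → p < L → p ≢ a → TightStep p)

    TwoFlats : Set
    TwoFlats = ∃₂ λ a b → a < b × b < L × FlatStep a × FlatStep b

    flat-trichotomy : Lipschitz G f → NoFlat ⊎ OneFlat ⊎ TwoFlats
    flat-trichotomy ok with none-one-or-two {FlatStep} L (λ p → val p ZP.≟ val (suc p))
    ... | inj₁ nz = inj₁ (λ p p<L → ¬flat⇒tightStep ok p p<L (nz p p<L))
    ... | inj₂ (inj₁ (a , a<L , za , oth)) = inj₂ (inj₁ (a , a<L , za , λ p p<L ne → ¬flat⇒tightStep ok p p<L (oth p p<L ne)))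
    ... | inj₂ (inj₂ t) = inj₂ (inj₂ t)

    reach-forward : ∀ a → a ≤ L → (∀ p → p < a → TightStep p) → Star T (w 0) (w a)
    reach-forward zero _ h = ε
    reach-forward (suc a) le h = reach-forward a (≤-trans (n≤1+n a) le) (λ p p<a → h p (m≤n⇒m≤1+n p<a))
                           ◅◅ (tightStep⇒tight a le (h a ≤-refl) ◅ ε)

    reach-backward′ : ∀ k a → a + k ≡ L → (∀ p → a ≤ p → p < L → TightStep p) → Star T (w L) (w a)
    reach-backward′ zero a e h rewrite NP.+-identityʳ a | e = ε
    reach-backward′ (suc k) a e h =
      reach-backward′ k (suc a) (trans (sym (+-suc a k)) e) (λ p a<p p<L → h p (≤-trans (n≤1+n a) a<p) p<L)
      ◅◅ (tight-sym G f (tightStep⇒tight a a<L (h a ≤-refl a<L)) ◅ ε)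
      where a<L : a < L
            a<L = subst (a <_) e (NP.≤-trans (s≤s (NP.m≤m+n a k)) (≤-reflexive (sym (+-suc a k))))

    reach-backward : ∀ a → a ≤ L → (∀ p → a ≤ p → p < L → TightStep p) → Star T (w L) (w a)
    reach-backward a a≤L h = reach-backward′ (L ℕ.∸ a) a (NP.m+[n∸m]≡n a≤L) h

    noFlat⇒reach : NoFlat → ∀ v → Star T (w 0) v
    noFlat⇒reach nz v = subst (Star T (w 0)) (wpos v) (reach-forward (pos v) (posle v) (λ p p<a → nz p (<-≤-trans p<a (posle v))))

    oneFlat⇒reach : OneFlat → ∀ v → Star T (w 0) v ⊎ Star T (w L) v
    oneFlat⇒reach (a , a<L , za , oth) v with pos v ≤? a
    ... | yes pv≤a = inj₁ (subst (Star T (w 0)) (wpos v)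
            (reach-forward (pos v) (posle v) (λ p p<pv → oth p (<-≤-trans p<pv (posle v)) (λ e → <-irrefl e (<-≤-trans p<pv pv≤a)))))
    ... | no pv>a = inj₂ (subst (Star T (w L)) (wpos v)
            (reach-backward (pos v) (posle v) (λ p pv≤p p<L → oth p p<L (λ e → pv>a (≤-trans pv≤p (≤-reflexive e))))))

    -- A single flat step on a path cuts it in two: the positions up to it form a tight-closed set.
    module _ (posLL : pos (w L) ≡ L) (a : ℕ) (a<L : a < L) (za : FlatStep a) where
      prefixSet : V G → Bool
      prefixSet v = does (pos v ≤? a)

      prefixSet-closed : TightClosed G f prefixSet
      prefixSet-closed u v t su with tight⇒tightStep t
      ... | q , q<L , tq , inj₁ (refl , refl) with does-≤?⇒≤ {pos (w q)} su
      ... | pu≤a rewrite posw q q<L with q ℕ.≟ a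
      ... | yes refl = ⊥-elim (tightStep⇒¬flat tq za)
      ... | no ne = ≤⇒does-≤? (≤-trans (≤-reflexive (posw (suc q) sq<L)) q<a)
        where q<a = ≤∧≢⇒< pu≤a ne
              sq<L = ≤-<-trans q<a a<L
      prefixSet-closed u v t su | q , q<L , tq , inj₂ (refl , refl) with does-≤?⇒≤ {pos (w (suc q))} su
      ... | pu≤a with suc q ℕ.≟ L
      ... | yes e = ⊥-elim (<-irrefl refl (≤-<-trans (≤-trans (≤-reflexive (trans (sym posLL) (cong (λ x → pos (w x)) (sym e)))) pu≤a) a<L))
      ... | no ne = ≤⇒does-≤? (≤-trans (≤-reflexive (posw q q<L)) (≤-trans (n≤1+n q) (≤-trans (≤-reflexive (sym (posw (suc q) (≤∧≢⇒< q<L ne)))) pu≤a)))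

      prefixSet-start : prefixSet (w 0) ≡ true
      prefixSet-start = ≤⇒does-≤? (≤-trans (≤-reflexive (posw 0 (≤-<-trans z≤n a<L))) z≤n)

      prefixSet-end : prefixSet (w L) ≡ false
      prefixSet-end = ≰⇒does-≤? (λ le → <-irrefl refl (≤-<-trans (≤-trans (≤-reflexive (sym posLL)) le) a<L))

    -- Two flat steps cut off the positions strictly between them.
    module _ (a b : ℕ) (a<b : a < b) (b<L : b < L) (za : FlatStep a) (zb : FlatStep b) where
      gapSet : V G → Bool
      gapSet v = not (between? a b (pos v))

      private
        notIn : ∀ {x} → gapSet x ≡ true → ¬ (a < pos x × pos x ≤ b)
        notIn {x} e = between?-false a b (pos x) (not≡true⇒≡false e)
        isIn : ∀ {x} → a < pos x → pos x ≤ b → gapSet x ≡ false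
        isIn {x} p q rewrite between?-intro a b (pos x) p q = refl
        posL-out : ¬ (a < pos (w L) × pos (w L) ≤ b)
        posL-out (p , q) with posL
        ... | inj₁ e = NP.n≮0 (subst (a <_) e p)
        ... | inj₂ e = NP.<⇒≱ b<L (≤-trans (≤-reflexive (sym e)) q)

      gapSet-closed : TightClosed G f gapSet
      gapSet-closed u v t su with gapSet v in eq
      ... | true = refl
      ... | false with between?-true a b (pos v) (not≡false⇒≡true eq)
      ... | inv with tight⇒tightStep t
      gapSet-closed u v t su | false | (a<pv , pv≤b) | q , q<L , tq , inj₁ (refl , refl) with suc q ℕ.≟ L
      ... | yes e = ⊥-elim (posL-out (subst (λ x → a < pos (w x) × pos (w x) ≤ b) e (a<pv , pv≤b)))
      ... | no ne with posw (suc q) (≤∧≢⇒< q<L ne)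
      ... | ps rewrite ps with q ℕ.≟ a
      ... | yes refl = ⊥-elim (tightStep⇒¬flat tq za)
      ... | no ne' = ⊥-elim (notIn {w q} su (subst (λ x → a < x × x ≤ b) (sym (posw q q<L)) (≤∧≢⇒< (≤-pred a<pv) (λ e → ne' (sym e)) , ≤-trans (n≤1+n q) pv≤b)))
      gapSet-closed u v t su | false | (a<pv , pv≤b) | q , q<L , tq , inj₂ (refl , refl) rewrite posw q q<L with q ℕ.≟ b
      ... | yes refl = ⊥-elim (tightStep⇒¬flat tq zb)
      ... | no ne = ⊥-elim (notIn {w (suc q)} su (subst (λ x → a < x × x ≤ b) (sym (posw (suc q) (≤-<-trans sq≤b b<L))) (NP.m<n⇒m<1+n a<pv , sq≤b)))
        where sq≤b = ≤∧≢⇒< pv≤b ne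

      gapSet-start : gapSet (w 0) ≡ true
      gapSet-start = ≡false⇒not≡true (In?-false' )
        where In?-false' : between? a b (pos (w 0)) ≡ false
              In?-false' with between? a b (pos (w 0)) in eq
              ... | false = refl
              ... | true with between?-true a b (pos (w 0)) eq
              ... | (p , _) rewrite posw 0 (≤-<-trans z≤n b<L) with p
              ... | ()

      gapSet-end : gapSet (w L) ≡ true
      gapSet-end = ≡false⇒not≡true In?-false'
        where In?-false' : between? a b (pos (w L)) ≡ false
              In?-false' with between? a b (pos (w L)) in eq
              ... | false = refl
              ... | true = ⊥-elim (posL-out (between?-true a b (pos (w L)) eq))

      gapSet-misses : gapSet (w (suc a)) ≡ false
      gapSet-misses = isIn {w (suc a)} (subst (a <_) (sym ps) ≤-refl) (subst (_≤ b) (sym ps) a<b)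
        where ps = posw (suc a) (≤-<-trans a<b b<L)

module PieceStates where

  open import Defs
  open Tightness
  open TraversalSteps
  open import Data.Nat using (ℕ; zero; suc; _+_)
  open import Data.Integer using (ℤ)
  open import Data.Fin using (zero; suc)
  open import Data.Vec using (Vec)
  open import Data.Bool using (true; false)
  open import Data.Product using (_,_)
  open import Data.Sum using (_⊎_; inj₁; inj₂)
  open import Data.Empty using (⊥-elim)
  open import Relation.Binary.PropositionalEquality
  open import Relation.Binary.Construct.Closure.ReflexiveTransitive using (Star)

  module PathStates {a : ℕ} (E : Edges (2 + a)) (W : Traversal (graph (suc a) E))
    (w0 : Traversal.w W 0 ≡ zero) (wL : Traversal.w W (Traversal.L W) ≡ suc zero)
    (posLL : Traversal.pos W (Traversal.w W (Traversal.L W)) ≡ Traversal.L W)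
    (f : Vec ℤ (2 + a)) where
    open Traversal W
    open Steps (graph (suc a) E) W f
    G = graph (suc a) E

    noFlat⇒connected : NoFlat → Connected G f
    noFlat⇒connected nz v = subst (λ x → Star T x v) w0 (noFlat⇒reach nz v)

    oneFlat⇒split : OneFlat → Split E f
    oneFlat⇒split oz@(x , x<L , zx , _) =
      (λ v → Data.Sum.map (subst (λ y → Star T y v) w0) (subst (λ y → Star T y v) wL) (oneFlat⇒reach oz v)) ,
      prefixSet posLL x x<L zx ,
      subst (λ y → prefixSet posLL x x<L zx y ≡ true) w0 (prefixSet-start posLL x x<L zx) ,
      subst (λ y → prefixSet posLL x x<L zx y ≡ false) wL (prefixSet-end posLL x x<L zx) ,
      prefixSet-closed posLL x x<L zx

    twoFlats⇒stranded : TwoFlats → Stranded E f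
    twoFlats⇒stranded (x , y , x<y , y<L , zx , zy) =
      S , subst (λ v → S v ≡ true) w0 (gapSet-start x y x<y y<L zx zy) ,
      subst (λ v → S v ≡ true) wL (gapSet-end x y x<y y<L zx zy) ,
      gapSet-closed x y x<y y<L zx zy , _ , gapSet-misses x y x<y y<L zx zy
      where S = gapSet x y x<y y<L zx zy

    trichotomy : Lipschitz G f → Connected G f ⊎ Split E f ⊎ Stranded E f
    trichotomy ok with flat-trichotomy ok
    ... | inj₁ z = inj₁ (noFlat⇒connected z)
    ... | inj₂ (inj₁ z) = inj₂ (inj₁ (oneFlat⇒split z))
    ... | inj₂ (inj₂ z) = inj₂ (inj₂ (twoFlats⇒stranded z))

    connected⇒noFlat : Lipschitz G f → Connected G f → NoFlat
    connected⇒noFlat ok sc with flat-trichotomy ok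
    ... | inj₁ z = z
    ... | inj₂ (inj₁ z) = ⊥-elim (connected⇒¬split E f sc (oneFlat⇒split z))
    ... | inj₂ (inj₂ z) = ⊥-elim (connected⇒¬stranded E f sc (twoFlats⇒stranded z))

    split⇒oneFlat : Lipschitz G f → Split E f → OneFlat
    split⇒oneFlat ok sd with flat-trichotomy ok
    ... | inj₁ z = ⊥-elim (connected⇒¬split E f (noFlat⇒connected z) sd)
    ... | inj₂ (inj₁ z) = z
    ... | inj₂ (inj₂ z) = ⊥-elim (split⇒¬stranded E f sd (twoFlats⇒stranded z))

  module CycleStates (G : Graph) (W : Traversal G)
    (w0 : Traversal.w W 0 ≡ zero) (wL : Traversal.w W (Traversal.L W) ≡ zero)
    (f : Vec ℤ (suc (n G))) where
    open Traversal W
    open Steps G W f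

    fewFlats⇒connected : NoFlat ⊎ OneFlat → Connected G f
    fewFlats⇒connected (inj₁ nz) v = subst (λ x → Star T x v) w0 (noFlat⇒reach nz v)
    fewFlats⇒connected (inj₂ oz) v with oneFlat⇒reach oz v
    ... | inj₁ s = subst (λ x → Star T x v) w0 s
    ... | inj₂ s = subst (λ x → Star T x v) wL s

    twoFlats⇒disconnected : TwoFlats → Disconnected G f
    twoFlats⇒disconnected (x , y , x<y , y<L , zx , zy) =
      S , subst (λ v → S v ≡ true) w0 (gapSet-start x y x<y y<L zx zy) ,
      gapSet-closed x y x<y y<L zx zy , _ , gapSet-misses x y x<y y<L zx zy
      where S = gapSet x y x<y y<L zx zy

    dichotomy : Lipschitz G f → Connected G f ⊎ Disconnected G f
    dichotomy ok with flat-trichotomy ok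
    ... | inj₁ z = inj₁ (fewFlats⇒connected (inj₁ z))
    ... | inj₂ (inj₁ z) = inj₁ (fewFlats⇒connected (inj₂ z))
    ... | inj₂ (inj₂ z) = inj₂ (twoFlats⇒disconnected z)

    connected⇒fewFlats : Lipschitz G f → Connected G f → NoFlat ⊎ OneFlat
    connected⇒fewFlats ok sc with flat-trichotomy ok
    ... | inj₁ z = inj₁ z
    ... | inj₂ (inj₁ z) = inj₂ z
    ... | inj₂ (inj₂ z) = ⊥-elim (connected⇒¬disconnected G f sc (twoFlats⇒disconnected z))

module Gluings where

  open import Defs
  open Tightness
  open import Data.Nat using (ℕ; zero; suc; _≤_)
  open import Data.Integer using (ℤ)
  open import Data.Fin using (Fin; zero; suc)
  open import Data.Vec using (Vec; lookup; tabulate)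
  open import Data.Vec.Properties using (lookup∘tabulate; tabulate∘lookup; tabulate-cong)
  open import Data.Bool using (Bool; true)
  open import Data.List.Membership.Propositional using (_∈_)
  open import Data.Product using (_×_; _,_; ∃; ∃₂)
  open import Data.Sum using (_⊎_; inj₁; inj₂)
  open import Relation.Binary.PropositionalEquality
  open import Relation.Binary.Construct.Closure.ReflexiveTransitive using (Star; gmap)

  vec-ext : ∀ {A : Set} {k} (f g : Vec A k) → (∀ i → lookup f i ≡ lookup g i) → f ≡ g
  vec-ext f g h = trans (sym (tabulate∘lookup f)) (trans (tabulate-cong h) (tabulate∘lookup g))

  record Gluing (N A B : ℕ) (E : Edges (suc N)) (E1 : Edges (suc A)) (E2 : Edges (suc B)) : Set where
    field
      l : Fin (suc A) → Fin (suc N)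
      r : Fin (suc B) → Fin (suc N)
      mem⇒ : ∀ {x y} → (x , y) ∈ E →
        (∃₂ λ u v → (u , v) ∈ E1 × x ≡ l u × y ≡ l v) ⊎ (∃₂ λ u v → (u , v) ∈ E2 × x ≡ r u × y ≡ r v)
      ⇒mem1 : ∀ {u v} → (u , v) ∈ E1 → (l u , l v) ∈ E
      ⇒mem2 : ∀ {u v} → (u , v) ∈ E2 → (r u , r v) ∈ E
      cover : ∀ x → (∃ λ u → x ≡ l u) ⊎ (∃ λ u → x ≡ r u)
      l0 : l zero ≡ zero
      r0 : r zero ≡ zero

  module GluingTheory {N A B : ℕ} {E : Edges (suc N)} {E1 : Edges (suc A)} {E2 : Edges (suc B)}
                    (GB : Gluing N A B E E1 E2) where
    open Gluing GB
    G = graph N E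
    Gˡ = graph A E1
    Gʳ = graph B E2

    restrictˡ : Vec ℤ (suc N) → Vec ℤ (suc A)
    restrictˡ f = tabulate (λ u → lookup f (l u))
    restrictʳ : Vec ℤ (suc N) → Vec ℤ (suc B)
    restrictʳ f = tabulate (λ u → lookup f (r u))

    restrict-injective : ∀ f f' → restrictˡ f ≡ restrictˡ f' → restrictʳ f ≡ restrictʳ f' → f ≡ f'
    restrict-injective f f' e1 e2 = vec-ext f f' h
      where h : ∀ x → lookup f x ≡ lookup f' x
            h x with cover x
            ... | inj₁ (u , refl) = trans (sym (lookup∘tabulate (λ u → lookup f (l u)) u))
                                     (trans (cong (λ v → lookup v u) e1) (lookup∘tabulate (λ u → lookup f' (l u)) u))
            ... | inj₂ (u , refl) = trans (sym (lookup∘tabulate (λ u → lookup f (r u)) u))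
                                     (trans (cong (λ v → lookup v u) e2) (lookup∘tabulate (λ u → lookup f' (r u)) u))

    module _ (f : Vec ℤ (suc N)) where
      private
        f1 = restrictˡ f
        f2 = restrictʳ f
        lk1 : ∀ u → lookup f1 u ≡ lookup f (l u)
        lk1 u = lookup∘tabulate (λ u → lookup f (l u)) u
        lk2 : ∀ u → lookup f2 u ≡ lookup f (r u)
        lk2 u = lookup∘tabulate (λ u → lookup f (r u)) u

      tightˡ : ∀ {u v} → Tight Gˡ f1 u v → Tight G f (l u) (l v)
      tightˡ (inj₁ e , d) = inj₁ (⇒mem1 e) , trans (sym (cong₂ dist (lk1 _) (lk1 _))) d
      tightˡ (inj₂ e , d) = inj₂ (⇒mem1 e) , trans (sym (cong₂ dist (lk1 _) (lk1 _))) d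

      tightʳ : ∀ {u v} → Tight Gʳ f2 u v → Tight G f (r u) (r v)
      tightʳ (inj₁ e , d) = inj₁ (⇒mem2 e) , trans (sym (cong₂ dist (lk2 _) (lk2 _))) d
      tightʳ (inj₂ e , d) = inj₂ (⇒mem2 e) , trans (sym (cong₂ dist (lk2 _) (lk2 _))) d

      reachˡ : ∀ {u v} → Star (Tight Gˡ f1) u v → Star (Tight G f) (l u) (l v)
      reachˡ = gmap l tightˡ
      reachʳ : ∀ {u v} → Star (Tight Gʳ f2) u v → Star (Tight G f) (r u) (r v)
      reachʳ = gmap r tightʳ

      tight-cases : ∀ {x y} → Tight G f x y →
        (∃₂ λ u v → x ≡ l u × y ≡ l v × Tight Gˡ f1 u v) ⊎ (∃₂ λ u v → x ≡ r u × y ≡ r v × Tight Gʳ f2 u v)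
      tight-cases (inj₁ e , d) with mem⇒ e
      ... | inj₁ (u , v , e1 , refl , refl) = inj₁ (u , v , refl , refl , inj₁ e1 , trans (cong₂ dist (lk1 u) (lk1 v)) d)
      ... | inj₂ (u , v , e2 , refl , refl) = inj₂ (u , v , refl , refl , inj₁ e2 , trans (cong₂ dist (lk2 u) (lk2 v)) d)
      tight-cases (inj₂ e , d) with mem⇒ e
      ... | inj₁ (v , u , e1 , refl , refl) = inj₁ (u , v , refl , refl , inj₂ e1 , trans (cong₂ dist (lk1 u) (lk1 v)) d)
      ... | inj₂ (v , u , e2 , refl , refl) = inj₂ (u , v , refl , refl , inj₂ e2 , trans (cong₂ dist (lk2 u) (lk2 v)) d)

      lipschitz-restrict : Lipschitz G f → Lipschitz Gˡ f1 × Lipschitz Gʳ f2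
      lipschitz-restrict ok = (λ u v e → subst (_≤ 1) (sym (cong₂ dist (lk1 u) (lk1 v))) (ok _ _ (⇒mem1 e))) ,
               (λ u v e → subst (_≤ 1) (sym (cong₂ dist (lk2 u) (lk2 v))) (ok _ _ (⇒mem2 e)))

      lipschitz-glue : Lipschitz Gˡ f1 → Lipschitz Gʳ f2 → Lipschitz G f
      lipschitz-glue o1 o2 x y e with mem⇒ e
      ... | inj₁ (u , v , e1 , refl , refl) = subst (_≤ 1) (cong₂ dist (lk1 u) (lk1 v)) (o1 u v e1)
      ... | inj₂ (u , v , e2 , refl , refl) = subst (_≤ 1) (cong₂ dist (lk2 u) (lk2 v)) (o2 u v e2)

      tightClosed-glue : ∀ (S : Fin (suc N) → Bool) S1 S2 → (∀ u → S (l u) ≡ S1 u) → (∀ u → S (r u) ≡ S2 u) →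
                   TightClosed Gˡ f1 S1 → TightClosed Gʳ f2 S2 → TightClosed G f S
      tightClosed-glue S S1 S2 h1 h2 c1 c2 x y t sx with tight-cases t
      ... | inj₁ (u , v , refl , refl , t1) = trans (h1 v) (c1 u v t1 (trans (sym (h1 u)) sx))
      ... | inj₂ (u , v , refl , refl , t2) = trans (h2 v) (c2 u v t2 (trans (sym (h2 u)) sx))

      tightClosed-full : ∀ {M} {H : Edges (suc M)} (h : Vec ℤ (suc M)) → TightClosed (graph M H) h (λ _ → true)
      tightClosed-full h _ _ _ _ = refl

      connected-glue : Connected Gˡ f1 → Connected Gʳ f2 → Connected G f
      connected-glue s1 s2 x with cover x
      ... | inj₁ (u , refl) = subst (λ z → Star (Tight G f) z (l u)) l0 (reachˡ (s1 u))
      ... | inj₂ (u , refl) = subst (λ z → Star (Tight G f) z (r u)) r0 (reachʳ (s2 u))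


module GluedStates where

  open import Defs
  open Tightness
  open Gluings
  open import Data.Nat using (ℕ; zero; suc; _+_)
  open import Data.Integer using (ℤ)
  open import Data.Fin using (Fin; zero; suc)
  open import Data.Vec using (Vec)
  open import Data.Bool using (Bool; true)
  open import Data.Product using (Σ; _×_; _,_; proj₁; proj₂)
  open import Data.Sum using (_⊎_; inj₁; inj₂)
  open import Data.Empty using (⊥-elim)
  open import Relation.Binary.PropositionalEquality
  open import Relation.Binary.Construct.Closure.ReflexiveTransitive using (Star; _◅◅_)

  module TwoTerminalGlue {N A B : ℕ} {E : Edges (2 + N)} {E1 : Edges (2 + A)} {E2 : Edges (2 + B)}
    (GB : Gluing (suc N) (suc A) (suc B) E E1 E2)
    (inl-one : Gluing.l GB (suc zero) ≡ suc zero) (inr-one : Gluing.r GB (suc zero) ≡ suc zero)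
    (glueSets : ∀ (S1 : Fin (2 + A) → Bool) (S2 : Fin (2 + B) → Bool) → S1 zero ≡ S2 zero → S1 (suc zero) ≡ S2 (suc zero) →
             Σ (Fin (2 + N) → Bool) λ S → (∀ u → S (Gluing.l GB u) ≡ S1 u) × (∀ u → S (Gluing.r GB u) ≡ S2 u))
    (f : Vec ℤ (2 + N)) where
    open Gluing GB
    open GluingTheory GB
    f1 = restrictˡ f
    f2 = restrictʳ f
    TT = Tight G f

    connected-split-glue : Connected Gˡ f1 → Split E2 f2 → Connected G f
    connected-split-glue s1 (d2 , _) x with cover x
    ... | inj₁ (u , refl) = subst (λ z → Star TT z (l u)) l0 (reachˡ f (s1 u))
    ... | inj₂ (u , refl) with d2 u
    ... | inj₁ st = subst (λ z → Star TT z (r u)) r0 (reachʳ f st)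
    ... | inj₂ st = subst (λ z → Star TT z (suc zero)) l0 (subst (Star TT (l zero)) inl-one (reachˡ f (s1 (suc zero))))
                    ◅◅ subst (λ z → Star TT z (r u)) inr-one (reachʳ f st)

    split-connected-glue : Split E1 f1 → Connected Gʳ f2 → Connected G f
    split-connected-glue (d1 , _) s2 x with cover x
    ... | inj₂ (u , refl) = subst (λ z → Star TT z (r u)) r0 (reachʳ f (s2 u))
    ... | inj₁ (u , refl) with d1 u
    ... | inj₁ st = subst (λ z → Star TT z (l u)) l0 (reachˡ f st)
    ... | inj₂ st = subst (λ z → Star TT z (suc zero)) r0 (subst (Star TT (r zero)) inr-one (reachʳ f (s2 (suc zero))))
                    ◅◅ subst (λ z → Star TT z (l u)) inl-one (reachˡ f st)

    split-glue : Split E1 f1 → Split E2 f2 → Split E f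
    split-glue (d1 , S1 , a0 , a1 , c1) (d2 , S2 , b0 , b1 , c2) =
      reach , S , trans (cong S (sym l0)) (trans (h1 zero) a0) , trans (cong S (sym inl-one)) (trans (h1 (suc zero)) a1) ,
      tightClosed-glue f S S1 S2 h1 h2 c1 c2
      where
      SS = glueSets S1 S2 (trans a0 (sym b0)) (trans a1 (sym b1))
      S = proj₁ SS
      h1 = proj₁ (proj₂ SS)
      h2 = proj₂ (proj₂ SS)
      reach : ∀ x → Star TT zero x ⊎ Star TT (suc zero) x
      reach x with cover x
      ... | inj₁ (u , refl) = Data.Sum.map (λ st → subst (λ z → Star TT z (l u)) l0 (reachˡ f st))
                                           (λ st → subst (λ z → Star TT z (l u)) inl-one (reachˡ f st)) (d1 u)
      ... | inj₂ (u , refl) = Data.Sum.map (λ st → subst (λ z → Star TT z (r u)) r0 (reachʳ f st))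
                                           (λ st → subst (λ z → Star TT z (r u)) inr-one (reachʳ f st)) (d2 u)

    strandedˡ : Stranded E1 f1 → Stranded E f
    strandedˡ (S1 , a0 , a1 , c1 , v , sv) =
      S , trans (cong S (sym l0)) (trans (h1 zero) a0) , trans (cong S (sym inl-one)) (trans (h1 (suc zero)) a1) ,
      tightClosed-glue f S S1 (λ _ → true) h1 h2 c1 (tightClosed-full f f2) , l v , trans (h1 v) sv
      where
      SS = glueSets S1 (λ _ → true) a0 a1
      S = proj₁ SS
      h1 = proj₁ (proj₂ SS)
      h2 = proj₂ (proj₂ SS)

    strandedʳ : Stranded E2 f2 → Stranded E f
    strandedʳ (S2 , a0 , a1 , c2 , v , sv) =
      S , trans (cong S (sym r0)) (trans (h2 zero) a0) , trans (cong S (sym inr-one)) (trans (h2 (suc zero)) a1) ,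
      tightClosed-glue f S (λ _ → true) S2 h1 h2 (tightClosed-full f f1) c2 , r v , trans (h2 v) sv
      where
      SS = glueSets (λ _ → true) S2 (sym a0) (sym a1)
      S = proj₁ SS
      h1 = proj₁ (proj₂ SS)
      h2 = proj₂ (proj₂ SS)

    Trichotomy : ∀ {M} (H : Edges (2 + M)) → Vec ℤ (2 + M) → Set
    Trichotomy {M} H h = Connected (graph (suc M) H) h ⊎ Split H h ⊎ Stranded H h

    trichotomy-glue : Trichotomy E1 f1 → Trichotomy E2 f2 → Trichotomy E f
    trichotomy-glue (inj₁ a) (inj₁ b) = inj₁ (connected-glue f a b)
    trichotomy-glue (inj₁ a) (inj₂ (inj₁ b)) = inj₁ (connected-split-glue a b)
    trichotomy-glue (inj₂ (inj₁ a)) (inj₁ b) = inj₁ (split-connected-glue a b)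
    trichotomy-glue (inj₂ (inj₁ a)) (inj₂ (inj₁ b)) = inj₂ (inj₁ (split-glue a b))
    trichotomy-glue (inj₂ (inj₂ a)) _ = inj₂ (inj₂ (strandedˡ a))
    trichotomy-glue (inj₁ _) (inj₂ (inj₂ b)) = inj₂ (inj₂ (strandedʳ b))
    trichotomy-glue (inj₂ (inj₁ _)) (inj₂ (inj₂ b)) = inj₂ (inj₂ (strandedʳ b))

    ConnectedCases : Set
    ConnectedCases = (Connected Gˡ f1 × Connected Gʳ f2) ⊎ (Connected Gˡ f1 × Split E2 f2) ⊎ (Split E1 f1 × Connected Gʳ f2)

    connectedCases⇒connected : ConnectedCases → Connected G f
    connectedCases⇒connected (inj₁ (a , b)) = connected-glue f a b
    connectedCases⇒connected (inj₂ (inj₁ (a , b))) = connected-split-glue a b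
    connectedCases⇒connected (inj₂ (inj₂ (a , b))) = split-connected-glue a b

    connected-cases : Trichotomy E1 f1 → Trichotomy E2 f2 → Connected G f → ConnectedCases
    connected-cases (inj₁ a) (inj₁ b) s = inj₁ (a , b)
    connected-cases (inj₁ a) (inj₂ (inj₁ b)) s = inj₂ (inj₁ (a , b))
    connected-cases (inj₂ (inj₁ a)) (inj₁ b) s = inj₂ (inj₂ (a , b))
    connected-cases (inj₂ (inj₁ a)) (inj₂ (inj₁ b)) s = ⊥-elim (connected⇒¬split E f s (split-glue a b))
    connected-cases (inj₂ (inj₂ a)) _ s = ⊥-elim (connected⇒¬stranded E f s (strandedˡ a))
    connected-cases (inj₁ _) (inj₂ (inj₂ b)) s = ⊥-elim (connected⇒¬stranded E f s (strandedʳ b))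
    connected-cases (inj₂ (inj₁ _)) (inj₂ (inj₂ b)) s = ⊥-elim (connected⇒¬stranded E f s (strandedʳ b))

    split⇒split×split : Trichotomy E1 f1 → Trichotomy E2 f2 → Split E f → Split E1 f1 × Split E2 f2
    split⇒split×split (inj₂ (inj₁ a)) (inj₂ (inj₁ b)) s = a , b
    split⇒split×split (inj₁ a) (inj₁ b) s = ⊥-elim (connected⇒¬split E f (connected-glue f a b) s)
    split⇒split×split (inj₁ a) (inj₂ (inj₁ b)) s = ⊥-elim (connected⇒¬split E f (connected-split-glue a b) s)
    split⇒split×split (inj₂ (inj₁ a)) (inj₁ b) s = ⊥-elim (connected⇒¬split E f (split-connected-glue a b) s)
    split⇒split×split (inj₂ (inj₂ a)) _ s = ⊥-elim (split⇒¬stranded E f s (strandedˡ a))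
    split⇒split×split (inj₁ _) (inj₂ (inj₂ b)) s = ⊥-elim (split⇒¬stranded E f s (strandedʳ b))
    split⇒split×split (inj₂ (inj₁ _)) (inj₂ (inj₂ b)) s = ⊥-elim (split⇒¬stranded E f s (strandedʳ b))

  module OneRootGlue {N A B : ℕ} {E : Edges (suc N)} {E1 : Edges (suc A)} {E2 : Edges (suc B)}
    (GB : Gluing N A B E E1 E2)
    (glueSets : ∀ (S1 : Fin (suc A) → Bool) (S2 : Fin (suc B) → Bool) → S1 zero ≡ S2 zero →
             Σ (Fin (suc N) → Bool) λ S → (∀ u → S (Gluing.l GB u) ≡ S1 u) × (∀ u → S (Gluing.r GB u) ≡ S2 u))
    (f : Vec ℤ (suc N)) where
    open Gluing GB
    open GluingTheory GB
    f1 = restrictˡ f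
    f2 = restrictʳ f

    disconnectedˡ : Disconnected Gˡ f1 → Disconnected G f
    disconnectedˡ (S1 , a0 , c1 , v , sv) =
      S , trans (cong S (sym l0)) (trans (h1 zero) a0) ,
      tightClosed-glue f S S1 (λ _ → true) h1 h2 c1 (tightClosed-full f f2) , l v , trans (h1 v) sv
      where
      SS = glueSets S1 (λ _ → true) a0
      S = proj₁ SS
      h1 = proj₁ (proj₂ SS)
      h2 = proj₂ (proj₂ SS)

    disconnectedʳ : Disconnected Gʳ f2 → Disconnected G f
    disconnectedʳ (S2 , a0 , c2 , v , sv) =
      S , trans (cong S (sym r0)) (trans (h2 zero) a0) ,
      tightClosed-glue f S (λ _ → true) S2 h1 h2 (tightClosed-full f f1) c2 , r v , trans (h2 v) sv
      where
      SS = glueSets (λ _ → true) S2 (sym a0)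
      S = proj₁ SS
      h1 = proj₁ (proj₂ SS)
      h2 = proj₂ (proj₂ SS)

    Dichotomy : ∀ {M} (H : Edges (suc M)) → Vec ℤ (suc M) → Set
    Dichotomy {M} H h = Connected (graph M H) h ⊎ Disconnected (graph M H) h

    dichotomy-glue : Dichotomy E1 f1 → Dichotomy E2 f2 → Dichotomy E f
    dichotomy-glue (inj₁ a) (inj₁ b) = inj₁ (connected-glue f a b)
    dichotomy-glue (inj₂ a) _ = inj₂ (disconnectedˡ a)
    dichotomy-glue (inj₁ _) (inj₂ b) = inj₂ (disconnectedʳ b)

    connected-parts : Dichotomy E1 f1 → Dichotomy E2 f2 → Connected G f → Connected Gˡ f1 × Connected Gʳ f2
    connected-parts (inj₁ a) (inj₁ b) s = a , b
    connected-parts (inj₂ a) _ s = ⊥-elim (connected⇒¬disconnected G f s (disconnectedˡ a))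
    connected-parts (inj₁ _) (inj₂ b) s = ⊥-elim (connected⇒¬disconnected G f s (disconnectedʳ b))

module GraphGluings where

  open import Defs
  open Tightness
  open Gluings
  open import Data.Nat using (ℕ; zero; suc; _+_)
  open import Data.Integer using (ℤ)
  open import Data.Fin using (Fin; zero; suc; _↑ˡ_; _↑ʳ_; splitAt)
  open import Data.Fin.Properties using (splitAt-↑ˡ; splitAt-↑ʳ; splitAt⁻¹-↑ˡ; splitAt⁻¹-↑ʳ)
  open import Data.Vec using (Vec; lookup; _∷_; _++_)
  open import Data.Vec.Properties using (lookup-++ˡ; lookup-++ʳ)
  open import Data.Bool using (Bool)
  open import Data.List using (List; []; _∷_; map) renaming (_++_ to _++L_)
  open import Data.List.Membership.Propositional using (_∈_)
  open import Data.List.Membership.Propositional.Properties using (∈-++⁻; ∈-++⁺ˡ; ∈-++⁺ʳ; ∈-map⁻; ∈-map⁺)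
  open import Data.Product using (Σ; _×_; _,_; ∃; ∃₂)
  open import Data.Sum using (_⊎_; inj₁; inj₂; [_,_]′)
  open import Relation.Binary.PropositionalEquality

  both : ∀ {X Y : Set} → (X → Y) → X × X → Y × Y
  both g (u , v) = g u , g v

  headOr : ∀ {X : Set} → X → List X → X
  headOr d [] = d
  headOr d (x ∷ _) = x


  module Glue₂ (a b : ℕ) where
    inl₂ : Fin (2 + a) → Fin (2 + a + b)
    inl₂ i = i ↑ˡ b
    inr₂ : Fin (2 + b) → Fin (2 + a + b)
    inr₂ zero = zero
    inr₂ (suc zero) = suc zero
    inr₂ (suc (suc j)) = (2 + a) ↑ʳ j

    glue2' : Edges (2 + a) → Edges (2 + b) → Edges (2 + a + b)
    glue2' E1 E2 = map (both inl₂) E1 ++L map (both inr₂) E2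

    glue-single : ∀ u v → glue2 a b [] ((u , v) ∷ []) ≡ both inr₂ (u , v) ∷ []
    glue-single zero zero = refl
    glue-single zero (suc zero) = refl
    glue-single zero (suc (suc j)) = refl
    glue-single (suc zero) zero = refl
    glue-single (suc zero) (suc zero) = refl
    glue-single (suc zero) (suc (suc j)) = refl
    glue-single (suc (suc i)) zero = refl
    glue-single (suc (suc i)) (suc zero) = refl
    glue-single (suc (suc i)) (suc (suc j)) = refl

    glue2≡ : ∀ E1 E2 → glue2 a b E1 E2 ≡ glue2' E1 E2
    glue2≡ ((u , v) ∷ E1) E2 = cong (_ ∷_) (glue2≡ E1 E2)
    glue2≡ [] [] = refl
    glue2≡ [] ((u , v) ∷ E2) = cong₂ _∷_ (cong (headOr (both inr₂ (u , v))) (glue-single u v)) (glue2≡ [] E2)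


    module _ (E1 : Edges (2 + a)) (E2 : Edges (2 + b)) where
      gluing : Gluing (suc (a + b)) (suc a) (suc b) (glue2 a b E1 E2) E1 E2
      gluing = record
        { l = inl₂ ; r = inr₂
        ; mem⇒ = mem⇒
        ; ⇒mem1 = λ {u} {v} e → subst ((inl₂ u , inl₂ v) ∈_) (sym (glue2≡ E1 E2)) (∈-++⁺ˡ (∈-map⁺ (both inl₂) e))
        ; ⇒mem2 = λ {u} {v} e → subst ((inr₂ u , inr₂ v) ∈_) (sym (glue2≡ E1 E2)) (∈-++⁺ʳ (map (both inl₂) E1) (∈-map⁺ (both inr₂) e))
        ; cover = cover
        ; l0 = refl ; r0 = refl }
        where
        mem⇒ : ∀ {x y} → (x , y) ∈ glue2 a b E1 E2 →
          (∃₂ λ u v → (u , v) ∈ E1 × x ≡ inl₂ u × y ≡ inl₂ v) ⊎ (∃₂ λ u v → (u , v) ∈ E2 × x ≡ inr₂ u × y ≡ inr₂ v)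
        mem⇒ m with ∈-++⁻ (map (both inl₂) E1) (subst (_ ∈_) (glue2≡ E1 E2) m)
        ... | inj₁ m1 with ∈-map⁻ (both inl₂) m1
        ... | (u , v) , e , refl = inj₁ (u , v , e , refl , refl)
        mem⇒ m | inj₂ m2 with ∈-map⁻ (both inr₂) m2
        ... | (u , v) , e , refl = inj₂ (u , v , e , refl , refl)
        cover : ∀ x → (∃ λ u → x ≡ inl₂ u) ⊎ (∃ λ u → x ≡ inr₂ u)
        cover zero = inj₁ (zero , refl)
        cover (suc zero) = inj₁ (suc zero , refl)
        cover (suc (suc j)) with splitAt (2 + a) (suc (suc j)) in eq
        ... | inj₁ i = inj₁ (i , sym (splitAt⁻¹-↑ˡ eq))
        ... | inj₂ i = inj₂ (suc (suc i) , sym (splitAt⁻¹-↑ʳ eq))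

    glueSets : ∀ (S1 : Fin (2 + a) → Bool) (S2 : Fin (2 + b) → Bool) → S1 zero ≡ S2 zero → S1 (suc zero) ≡ S2 (suc zero) →
            Σ (Fin (2 + a + b) → Bool) λ S → (∀ u → S (inl₂ u) ≡ S1 u) × (∀ u → S (inr₂ u) ≡ S2 u)
    glueSets S1 S2 e0 e1 = S , h1 , h2
      where
      S : Fin (2 + a + b) → Bool
      S x = [ S1 , (λ i → S2 (suc (suc i))) ]′ (splitAt (2 + a) x)
      h1 : ∀ u → S (inl₂ u) ≡ S1 u
      h1 u rewrite splitAt-↑ˡ (2 + a) u b = refl
      h2 : ∀ u → S (inr₂ u) ≡ S2 u
      h2 zero = e0
      h2 (suc zero) = e1
      h2 (suc (suc i)) rewrite splitAt-↑ʳ (2 + a) b i = refl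

    combine : Vec ℤ (2 + a) → Vec ℤ (2 + b) → Vec ℤ (2 + a + b)
    combine (x0 ∷ x1 ∷ t1) (y0 ∷ y1 ∷ t2) = x0 ∷ x1 ∷ (t1 ++ t2)

    combine-inl : ∀ f1 f2 u → lookup (combine f1 f2) (inl₂ u) ≡ lookup f1 u
    combine-inl (x0 ∷ x1 ∷ t1) (y0 ∷ y1 ∷ t2) zero = refl
    combine-inl (x0 ∷ x1 ∷ t1) (y0 ∷ y1 ∷ t2) (suc zero) = refl
    combine-inl (x0 ∷ x1 ∷ t1) (y0 ∷ y1 ∷ t2) (suc (suc i)) = lookup-++ˡ t1 t2 i

    combine-inr : ∀ f1 f2 → lookup f1 zero ≡ lookup f2 zero → lookup f1 (suc zero) ≡ lookup f2 (suc zero) →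
             ∀ u → lookup (combine f1 f2) (inr₂ u) ≡ lookup f2 u
    combine-inr (x0 ∷ x1 ∷ t1) (y0 ∷ y1 ∷ t2) e0 e1 zero = e0
    combine-inr (x0 ∷ x1 ∷ t1) (y0 ∷ y1 ∷ t2) e0 e1 (suc zero) = e1
    combine-inr (x0 ∷ x1 ∷ t1) (y0 ∷ y1 ∷ t2) e0 e1 (suc (suc i)) = lookup-++ʳ t1 t2 i


  module Glue₁ (a b : ℕ) where
    inl₁ : Fin (suc a) → Fin (suc a + b)
    inl₁ i = i ↑ˡ b
    inr₁ : Fin (suc b) → Fin (suc a + b)
    inr₁ zero = zero
    inr₁ (suc j) = (suc a) ↑ʳ j

    glue1' : Edges (suc a) → Edges (suc b) → Edges (suc a + b)
    glue1' E1 E2 = map (both inl₁) E1 ++L map (both inr₁) E2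

    glue-single : ∀ u v → glue1 a b [] ((u , v) ∷ []) ≡ both inr₁ (u , v) ∷ []
    glue-single zero zero = refl
    glue-single zero (suc j) = refl
    glue-single (suc i) zero = refl
    glue-single (suc i) (suc j) = refl

    glue1≡ : ∀ E1 E2 → glue1 a b E1 E2 ≡ glue1' E1 E2
    glue1≡ ((u , v) ∷ E1) E2 = cong (_ ∷_) (glue1≡ E1 E2)
    glue1≡ [] [] = refl
    glue1≡ [] ((u , v) ∷ E2) = cong₂ _∷_ (cong (headOr (both inr₁ (u , v))) (glue-single u v)) (glue1≡ [] E2)

    module _ (E1 : Edges (suc a)) (E2 : Edges (suc b)) where
      gluing : Gluing (a + b) a b (glue1 a b E1 E2) E1 E2
      gluing = record
        { l = inl₁ ; r = inr₁
        ; mem⇒ = mem⇒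
        ; ⇒mem1 = λ {u} {v} e → subst ((inl₁ u , inl₁ v) ∈_) (sym (glue1≡ E1 E2)) (∈-++⁺ˡ (∈-map⁺ (both inl₁) e))
        ; ⇒mem2 = λ {u} {v} e → subst ((inr₁ u , inr₁ v) ∈_) (sym (glue1≡ E1 E2)) (∈-++⁺ʳ (map (both inl₁) E1) (∈-map⁺ (both inr₁) e))
        ; cover = cover
        ; l0 = refl ; r0 = refl }
        where
        mem⇒ : ∀ {x y} → (x , y) ∈ glue1 a b E1 E2 →
          (∃₂ λ u v → (u , v) ∈ E1 × x ≡ inl₁ u × y ≡ inl₁ v) ⊎ (∃₂ λ u v → (u , v) ∈ E2 × x ≡ inr₁ u × y ≡ inr₁ v)
        mem⇒ m with ∈-++⁻ (map (both inl₁) E1) (subst (_ ∈_) (glue1≡ E1 E2) m)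
        ... | inj₁ m1 with ∈-map⁻ (both inl₁) m1
        ... | (u , v) , e , refl = inj₁ (u , v , e , refl , refl)
        mem⇒ m | inj₂ m2 with ∈-map⁻ (both inr₁) m2
        ... | (u , v) , e , refl = inj₂ (u , v , e , refl , refl)
        cover : ∀ x → (∃ λ u → x ≡ inl₁ u) ⊎ (∃ λ u → x ≡ inr₁ u)
        cover zero = inj₁ (zero , refl)
        cover (suc j) with splitAt (suc a) (suc j) in eq
        ... | inj₁ i = inj₁ (i , sym (splitAt⁻¹-↑ˡ eq))
        ... | inj₂ i = inj₂ (suc i , sym (splitAt⁻¹-↑ʳ eq))

    glueSets : ∀ (S1 : Fin (suc a) → Bool) (S2 : Fin (suc b) → Bool) → S1 zero ≡ S2 zero →
            Σ (Fin (suc a + b) → Bool) λ S → (∀ u → S (inl₁ u) ≡ S1 u) × (∀ u → S (inr₁ u) ≡ S2 u)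
    glueSets S1 S2 e0 = S , h1 , h2
      where
      S : Fin (suc a + b) → Bool
      S x = [ S1 , (λ i → S2 (suc i)) ]′ (splitAt (suc a) x)
      h1 : ∀ u → S (inl₁ u) ≡ S1 u
      h1 u rewrite splitAt-↑ˡ (suc a) u b = refl
      h2 : ∀ u → S (inr₁ u) ≡ S2 u
      h2 zero = e0
      h2 (suc i) rewrite splitAt-↑ʳ (suc a) b i = refl

    combine : Vec ℤ (suc a) → Vec ℤ (suc b) → Vec ℤ (suc a + b)
    combine (x0 ∷ t1) (y0 ∷ t2) = x0 ∷ (t1 ++ t2)

    combine-inl : ∀ f1 f2 u → lookup (combine f1 f2) (inl₁ u) ≡ lookup f1 u
    combine-inl (x0 ∷ t1) (y0 ∷ t2) zero = refl
    combine-inl (x0 ∷ t1) (y0 ∷ t2) (suc i) = lookup-++ˡ t1 t2 i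

    combine-inr : ∀ f1 f2 → lookup f1 zero ≡ lookup f2 zero → ∀ u → lookup (combine f1 f2) (inr₁ u) ≡ lookup f2 u
    combine-inr (x0 ∷ t1) (y0 ∷ t2) e0 zero = e0
    combine-inr (x0 ∷ t1) (y0 ∷ t2) e0 (suc i) = lookup-++ʳ t1 t2 i

module PathCycleTraversals where

  open import Defs
  open Tightness
  open import Data.Nat as ℕ using (ℕ; zero; suc; _+_; _≤_; _<_; z≤n; s≤s; _<?_)
  open import Data.Nat.Properties as NP using (≤-refl; ≤-pred; ≤∧≢⇒<; <⇒≤)
  open import Data.Fin using (Fin; zero; suc; toℕ; fromℕ<; fromℕ; inject₁)
  open import Data.Fin.Properties using (toℕ-injective; toℕ-fromℕ<; toℕ-inject₁; toℕ-fromℕ; toℕ<n)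
  open import Data.List using (tabulate) renaming (_++_ to _++L_)
  open import Data.List.Membership.Propositional using (_∈_)
  open import Data.List.Membership.Propositional.Properties using (∈-++⁻; ∈-++⁺ˡ; ∈-++⁺ʳ; ∈-tabulate⁻; ∈-tabulate⁺)
  open import Data.List.Relation.Unary.Any using (here; there)
  open import Data.Product using (_×_; _,_; ∃)
  open import Data.Sum using (inj₁; inj₂)
  open import Data.Empty using (⊥-elim)
  open import Relation.Nullary using (yes; no)
  open import Relation.Binary.PropositionalEquality


  skipVertex : ∀ {k} → Fin (2 + k) → Fin (3 + k)
  skipVertex zero = zero
  skipVertex (suc zero) = suc zero
  skipVertex (suc (suc j)) = suc (suc (suc j))

  innerVertex : (k : ℕ) → ℕ → Fin (2 + k)
  innerVertex zero p = suc zero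
  innerVertex (suc k) zero = suc (suc zero)
  innerVertex (suc k) (suc p) = skipVertex (innerVertex k p)

  innerVertex-< : ∀ k p → p < k → ∃ λ j → innerVertex k p ≡ suc (suc j) × toℕ j ≡ p
  innerVertex-< (suc k) zero _ = zero , refl , refl
  innerVertex-< (suc k) (suc p) (s≤s lt) with innerVertex-< k p lt
  ... | j , e , t rewrite e = suc j , refl , cong suc t

  innerVertex-≥ : ∀ k p → k ≤ p → innerVertex k p ≡ suc zero
  innerVertex-≥ zero p _ = refl
  innerVertex-≥ (suc k) (suc p) (s≤s le) rewrite innerVertex-≥ k p le = refl

  pathVertex : (k : ℕ) → ℕ → Fin (2 + k)
  pathVertex k zero = zero
  pathVertex k (suc p) = innerVertex k p

  pathPos : (k : ℕ) → Fin (2 + k) → ℕ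
  pathPos k zero = 0
  pathPos k (suc zero) = suc k
  pathPos k (suc (suc j)) = suc (toℕ j)

  pathVertex-inner : ∀ k (j : Fin k) → pathVertex k (suc (toℕ j)) ≡ suc (suc j)
  pathVertex-inner k j with innerVertex-< k (toℕ j) (toℕ<n j)
  ... | j' , e , t = trans e (cong (λ x → suc (suc x)) (toℕ-injective t))

  pathVertex-at : ∀ k (j : Fin k) t → toℕ j ≡ t → pathVertex k (suc t) ≡ suc (suc j)
  pathVertex-at k j t refl = pathVertex-inner k j

  pathE⇒step : ∀ k {u v} → (u , v) ∈ pathE k → ∃ λ q → q < suc k × u ≡ pathVertex k q × v ≡ pathVertex k (suc q)
  pathE⇒step zero (here refl) = 0 , s≤s z≤n , refl , refl
  pathE⇒step (suc k) (here refl) = 0 , s≤s z≤n , refl , refl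
  pathE⇒step (suc k) (there m) with ∈-++⁻ (tabulate (λ (i : Fin k) → (suc (suc (inject₁ i)) , suc (suc (suc i))))) m
  ... | inj₁ m1 with ∈-tabulate⁻ m1
  ... | i , refl = suc (toℕ i) , s≤s (s≤s (<⇒≤ (toℕ<n i))) ,
         sym (pathVertex-at (suc k) (inject₁ i) (toℕ i) (toℕ-inject₁ i)) , sym (pathVertex-at (suc k) (suc i) (suc (toℕ i)) refl)
  pathE⇒step (suc k) (there m) | inj₂ (here refl) =
    suc k , ≤-refl , sym (pathVertex-at (suc k) (fromℕ k) k (toℕ-fromℕ k)) , sym (innerVertex-≥ (suc k) (suc k) ≤-refl)

  step⇒pathE : ∀ k q → q < suc k → (pathVertex k q , pathVertex k (suc q)) ∈ pathE k
  step⇒pathE zero zero _ = here refl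
  step⇒pathE zero (suc q) (s≤s ())
  step⇒pathE (suc k) zero _ = here refl
  step⇒pathE (suc k) (suc q) (s≤s lt) with q ℕ.≟ k
  ... | yes refl = there (∈-++⁺ʳ (tabulate (λ (i : Fin q) → (suc (suc (inject₁ i)) , suc (suc (suc i)))))
                     (here (cong₂ _,_ (pathVertex-at (suc q) (fromℕ q) q (toℕ-fromℕ q)) (innerVertex-≥ (suc q) (suc q) ≤-refl))))
  ... | no ne = subst (_∈ pathE (suc k))
                  (cong₂ _,_ (sym (pathVertex-at (suc k) (inject₁ i) q (trans (toℕ-inject₁ i) (toℕ-fromℕ< q<k))))
                             (sym (pathVertex-at (suc k) (suc i) (suc q) (cong suc (toℕ-fromℕ< q<k)))))
                  (there (∈-++⁺ˡ (∈-tabulate⁺ {f = λ (i : Fin k) → (suc (suc (inject₁ i)) , suc (suc (suc i)))} i)))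
    where q<k = ≤∧≢⇒< (≤-pred lt) ne
          i = fromℕ< q<k

  pathTraversal : (k : ℕ) → Traversal (graph (suc k) (pathE k))
  pathTraversal k = record
    { L = suc k ; w = pathVertex k ; pos = pathPos k
    ; e⇒ = pathE⇒step k ; ⇒e = step⇒pathE k
    ; wpos = wpos ; posle = posle ; posw = posw ; posL = inj₂ (cong (pathPos k) (innerVertex-≥ k k ≤-refl)) }
    where
    wpos : ∀ v → pathVertex k (pathPos k v) ≡ v
    wpos zero = refl
    wpos (suc zero) = innerVertex-≥ k k ≤-refl
    wpos (suc (suc j)) = pathVertex-inner k j
    posle : ∀ v → pathPos k v ≤ suc k
    posle zero = z≤n
    posle (suc zero) = ≤-refl
    posle (suc (suc j)) = s≤s (<⇒≤ (toℕ<n j))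
    posw : ∀ p → p < suc k → pathPos k (pathVertex k p) ≡ p
    posw zero _ = refl
    posw (suc p) (s≤s lt) with innerVertex-< k p lt
    ... | j , e , t rewrite e = cong suc t


  cycleVertex : (k : ℕ) → ℕ → Fin (suc k)
  cycleVertex k p with p <? suc k
  ... | yes lt = fromℕ< lt
  ... | no _ = zero

  cycleVertex-< : ∀ k p → p < suc k → toℕ (cycleVertex k p) ≡ p
  cycleVertex-< k p lt with p <? suc k
  ... | yes lt' = toℕ-fromℕ< lt'
  ... | no nlt = ⊥-elim (nlt lt)

  cycleVertex-at : ∀ k (j : Fin (suc k)) t → toℕ j ≡ t → cycleVertex k t ≡ j
  cycleVertex-at k j t e = toℕ-injective (trans (cycleVertex-< k t (subst (_< suc k) e (toℕ<n j))) (sym e))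

  cycleVertex-end : ∀ k → cycleVertex k (suc k) ≡ zero
  cycleVertex-end k with suc k <? suc k
  ... | yes lt = ⊥-elim (NP.<-irrefl refl lt)
  ... | no _ = refl

  cycE⇒step : ∀ k {u v} → (u , v) ∈ cycE k → ∃ λ q → q < suc k × u ≡ cycleVertex k q × v ≡ cycleVertex k (suc q)
  cycE⇒step k m with ∈-++⁻ (tabulate (λ (i : Fin k) → (inject₁ i , suc i))) m
  ... | inj₁ m1 with ∈-tabulate⁻ m1
  ... | i , refl = toℕ i , NP.m≤n⇒m≤1+n (toℕ<n i) ,
         sym (cycleVertex-at k (inject₁ i) (toℕ i) (toℕ-inject₁ i)) , sym (cycleVertex-at k (suc i) (suc (toℕ i)) refl)
  cycE⇒step k m | inj₂ (here refl) = k , ≤-refl , sym (cycleVertex-at k (fromℕ k) k (toℕ-fromℕ k)) , sym (cycleVertex-end k)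

  step⇒cycE : ∀ k q → q < suc k → (cycleVertex k q , cycleVertex k (suc q)) ∈ cycE k
  step⇒cycE k q lt with q ℕ.≟ k
  ... | yes refl = ∈-++⁺ʳ (tabulate (λ (i : Fin q) → (inject₁ i , suc i)))
                     (here (cong₂ _,_ (cycleVertex-at q (fromℕ q) q (toℕ-fromℕ q)) (cycleVertex-end q)))
  ... | no ne = subst (_∈ cycE k)
                  (cong₂ _,_ (sym (cycleVertex-at k (inject₁ i) q (trans (toℕ-inject₁ i) (toℕ-fromℕ< q<k))))
                             (sym (cycleVertex-at k (suc i) (suc q) (cong suc (toℕ-fromℕ< q<k)))))
                  (∈-++⁺ˡ (∈-tabulate⁺ {f = λ (i : Fin k) → (inject₁ i , suc i)} i))
    where q<k = ≤∧≢⇒< (≤-pred lt) ne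
          i = fromℕ< q<k

  cycleTraversal : (k : ℕ) → Traversal (graph k (cycE k))
  cycleTraversal k = record
    { L = suc k ; w = cycleVertex k ; pos = toℕ
    ; e⇒ = cycE⇒step k ; ⇒e = step⇒cycE k
    ; wpos = λ v → cycleVertex-at k v (toℕ v) refl
    ; posle = λ v → NP.m≤n⇒m≤1+n (≤-pred (toℕ<n v))
    ; posw = cycleVertex-< k
    ; posL = inj₁ (cong toℕ (cycleVertex-end k)) }

  cycleVertex-start : ∀ k → cycleVertex k 0 ≡ zero
  cycleVertex-start k = cycleVertex-at k zero 0 refl

module WalkCounting where

  open import Defs
  open Counting
  open Tightness
  open import Data.Nat as ℕ using (ℕ; zero; suc)
  open import Data.Integer using (ℤ; ∣_∣; +_; -[1+_]; 0ℤ; 1ℤ; -1ℤ; _+_; _-_; -_)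
  import Data.Integer.Properties as ZP
  open import Data.Integer.Solver using (module +-*-Solver)
  open import Data.Fin using (zero; suc)
  open import Data.Vec using (Vec; []; _∷_)
  open import Data.Vec.Properties using (∷-injective; ∷-injectiveʳ)
  open import Data.Bool using (if_then_else_)
  open import Data.Product using (_×_; _,_; ∃; proj₁)
  open import Data.Sum using (_⊎_; inj₁; inj₂)
  open import Relation.Nullary using (yes; no; does)
  open import Relation.Binary.PropositionalEquality

  module Solved where
    open +-*-Solver
    sub-suc : ∀ a b → b - (a + 1ℤ) ≡ (b - a) - 1ℤ
    sub-suc = solve 2 (λ a b → b :- (a :+ con 1ℤ) := (b :- a) :- con 1ℤ) refl
    sub-pred : ∀ a b → b - (a - 1ℤ) ≡ (b - a) + 1ℤ
    sub-pred = solve 2 (λ a b → b :- (a :- con 1ℤ) := (b :- a) :+ con 1ℤ) refl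
    sub-sub-cancel : ∀ a y → y ≡ a - (a - y)
    sub-sub-cancel = solve 2 (λ a y → y := a :- (a :- y)) refl
    sub-suc-self : ∀ a → a - (a + 1ℤ) ≡ -1ℤ
    sub-suc-self = solve 1 (λ a → a :- (a :+ con 1ℤ) := con -1ℤ) refl
    sub-pred-self : ∀ a → a - (a - 1ℤ) ≡ 1ℤ
    sub-pred-self = solve 1 (λ a → a :- (a :- con 1ℤ) := con 1ℤ) refl
    add-sub-cancel : ∀ a x → x ≡ (a + x) - a
    add-sub-cancel = solve 2 (λ a x → x := (a :+ x) :- a) refl

  +-cancelˡ : ∀ a x y → a + x ≡ a + y → x ≡ y
  +-cancelˡ a x y e = trans (Solved.add-sub-cancel a x) (trans (cong (_- a) e) (sym (Solved.add-sub-cancel a y)))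

  ∣i∣≡1⇒±1 : ∀ z → ∣ z ∣ ≡ 1 → z ≡ 1ℤ ⊎ z ≡ -1ℤ
  ∣i∣≡1⇒±1 (+ 1) refl = inj₁ refl
  ∣i∣≡1⇒±1 -[1+ 0 ] refl = inj₂ refl

  dist≡1⇒±1 : ∀ a y → dist a y ≡ 1 → y ≡ a + 1ℤ ⊎ y ≡ a - 1ℤ
  dist≡1⇒±1 a y d with ∣i∣≡1⇒±1 (a - y) d
  ... | inj₁ e = inj₂ (trans (Solved.sub-sub-cancel a y) (cong (λ t → a - t) e))
  ... | inj₂ e = inj₁ (trans (Solved.sub-sub-cancel a y) (cong (λ t → a - t) e))

  dist-suc : ∀ a → dist a (a + 1ℤ) ≡ 1
  dist-suc a = cong ∣_∣ (Solved.sub-suc-self a)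
  dist-pred : ∀ a → dist a (a - 1ℤ) ≡ 1
  dist-pred a = cong ∣_∣ (Solved.sub-pred-self a)

  suc≢pred : ∀ a → a + 1ℤ ≢ a - 1ℤ
  suc≢pred a e with +-cancelˡ a 1ℤ -1ℤ e
  ... | ()
  ≢suc : ∀ a → a ≢ a + 1ℤ
  ≢suc a e with +-cancelˡ a 0ℤ 1ℤ (trans (ZP.+-identityʳ a) e)
  ... | ()
  ≢pred : ∀ a → a ≢ a - 1ℤ
  ≢pred a e with +-cancelˡ a 0ℤ -1ℤ (trans (ZP.+-identityʳ a) e)
  ... | ()

  -- signWalks n d counts steps in {±1}ⁿ with sum d; lazyWalks n d counts steps in {-1,0,1}ⁿ with sum d
  -- and exactly one 0.
  signWalks : ℕ → ℤ → ℕ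
  signWalks zero d = if does (d ZP.≟ 0ℤ) then 1 else 0
  signWalks (suc n) d = signWalks n (d - 1ℤ) ℕ.+ signWalks n (d + 1ℤ)

  lazyWalks : ℕ → ℤ → ℕ
  lazyWalks zero d = 0
  lazyWalks (suc n) d = (lazyWalks n (d - 1ℤ) ℕ.+ lazyWalks n (d + 1ℤ)) ℕ.+ signWalks n d

  count-emptyWalk : ∀ c b → HasCountIn (Vec ℤ 0) (λ _ → c ≡ b) (signWalks 0 (b - c))
  count-emptyWalk c b with (b - c) ZP.≟ 0ℤ
  ... | yes e = count-resp (λ { [] refl → sym (ZP.i-j≡0⇒i≡j b c e) }) (λ { [] _ → refl }) (count-singleton [])
  ... | no ne = count-none (λ _ e → ne (ZP.i≡j⇒i-j≡0 (sym e)))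

  SignWalk : ∀ {k} → ℤ → Vec ℤ k → ℤ → Set
  SignWalk a [] b = dist a b ≡ 1
  SignWalk a (y ∷ ys) b = dist a y ≡ 1 × SignWalk y ys b

  LazyWalk : ∀ {k} → ℤ → Vec ℤ k → ℤ → Set
  LazyWalk a [] b = a ≡ b
  LazyWalk a (y ∷ ys) b = (dist a y ≡ 1 × LazyWalk y ys b) ⊎ (a ≡ y × SignWalk y ys b)

  count-cons : ∀ {k} (y : ℤ) {P : Vec ℤ k → Set} {n} → HasCountIn (Vec ℤ k) P n →
            HasCountIn (Vec ℤ (suc k)) (λ z → ∃ λ ys → P ys × z ≡ y ∷ ys) n
  count-cons y h = count-image (y ∷_) (λ _ _ e → ∷-injectiveʳ e) (λ x p → x , p , refl) (λ z q → q) h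

  count-signWalks : ∀ k a b → HasCountIn (Vec ℤ k) (λ x → SignWalk a x b) (signWalks (suc k) (b - a))
  count-signWalks zero a b =
    count-≡ (cong₂ ℕ._+_ (cong (signWalks 0) (Solved.sub-suc a b)) (cong (signWalks 0) (Solved.sub-pred a b)))
    (count-resp (λ { [] (inj₁ e) → subst (λ z → dist a z ≡ 1) e (dist-suc a) ; [] (inj₂ e) → subst (λ z → dist a z ≡ 1) e (dist-pred a) })
            (λ { [] d → Data.Sum.map sym sym (dist≡1⇒±1 a b d) })
       (count-⊎ (count-emptyWalk (a + 1ℤ) b) (count-emptyWalk (a - 1ℤ) b) (λ _ e1 e2 → suc≢pred a (trans e1 (sym e2)))))
  count-signWalks (suc k) a b =
    count-≡ (cong₂ ℕ._+_ (cong (signWalks (suc k)) (Solved.sub-suc a b)) (cong (signWalks (suc k)) (Solved.sub-pred a b)))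
    (count-resp fwd bwd
       (count-⊎ (count-cons (a + 1ℤ) (count-signWalks k (a + 1ℤ) b)) (count-cons (a - 1ℤ) (count-signWalks k (a - 1ℤ) b))
          (λ { _ (ys , _ , refl) (ys' , _ , e) → suc≢pred a (proj₁ (∷-inj e)) })))
    where
    ∷-inj = ∷-injective
    fwd : ∀ z → _ → SignWalk a z b
    fwd _ (inj₁ (ys , w , refl)) = dist-suc a , w
    fwd _ (inj₂ (ys , w , refl)) = dist-pred a , w
    bwd : ∀ z → SignWalk a z b → _
    bwd (y ∷ ys) (d , w) with dist≡1⇒±1 a y d
    ... | inj₁ refl = inj₁ (ys , w , refl)
    ... | inj₂ refl = inj₂ (ys , w , refl)

  count-lazyWalks : ∀ k a b → HasCountIn (Vec ℤ k) (λ x → LazyWalk a x b) (lazyWalks (suc k) (b - a))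
  count-lazyWalks zero a b = count-resp (λ { [] e → e }) (λ { [] e → e }) (count-emptyWalk a b)
  count-lazyWalks (suc k) a b =
    count-≡ (cong₂ ℕ._+_ (cong₂ ℕ._+_ (cong (lazyWalks (suc k)) (Solved.sub-suc a b)) (cong (lazyWalks (suc k)) (Solved.sub-pred a b)))
                        refl)
    (count-resp fwd bwd
       (count-⊎
         (count-⊎ (count-cons (a + 1ℤ) (count-lazyWalks k (a + 1ℤ) b)) (count-cons (a - 1ℤ) (count-lazyWalks k (a - 1ℤ) b))
            (λ { _ (ys , _ , refl) (ys' , _ , e) → suc≢pred a (proj₁ (∷-injective e)) }))
         (count-cons a (count-signWalks k a b))
         (λ { _ (inj₁ (ys , _ , refl)) (ys' , _ , e) → ≢suc a (sym (proj₁ (∷-injective e)))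
            ; _ (inj₂ (ys , _ , refl)) (ys' , _ , e) → ≢pred a (sym (proj₁ (∷-injective e))) })))
    where
    fwd : ∀ z → _ → LazyWalk a z b
    fwd _ (inj₁ (inj₁ (ys , w , refl))) = inj₁ (dist-suc a , w)
    fwd _ (inj₁ (inj₂ (ys , w , refl))) = inj₁ (dist-pred a , w)
    fwd _ (inj₂ (ys , w , refl)) = inj₂ (refl , w)
    bwd : ∀ z → LazyWalk a z b → _
    bwd (y ∷ ys) (inj₁ (d , w)) with dist≡1⇒±1 a y d
    ... | inj₁ refl = inj₁ (inj₁ (ys , w , refl))
    ... | inj₂ refl = inj₁ (inj₂ (ys , w , refl))
    bwd (y ∷ ys) (inj₂ (refl , w)) = inj₂ (ys , w , refl)

module PieceCounting where

  open import Defs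
  open Counting
  open Tightness
  open TraversalSteps
  open PieceStates
  open PathCycleTraversals
  open WalkCounting
  open import Data.Nat as ℕ using (ℕ; zero; suc; _≤_; _<_; z≤n; s≤s)
  open import Data.Nat.Properties as NP using (≤-refl; ≤-pred; ≤∧≢⇒<; <⇒≤)
  open import Data.Integer using (ℤ; +_; 0ℤ; _+_)
  import Data.Integer.Properties as ZP
  open import Data.Fin using (Fin; zero; suc; toℕ)
  open import Data.Vec using (Vec; []; _∷_; lookup)
  open import Data.Vec.Properties using (∷-injectiveʳ)
  open import Data.Product using (_×_; _,_; ∃)
  open import Data.Sum using (_⊎_; inj₁; inj₂)
  open import Data.Empty using (⊥; ⊥-elim)
  open import Relation.Nullary using (yes; no)
  open import Relation.Binary.PropositionalEquality

  trail : ∀ {k} → ℤ → Vec ℤ k → ℤ → ℕ → ℤ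
  trail a x b zero = a
  trail a [] b (suc p) = b
  trail a (y ∷ ys) b (suc p) = trail y ys b p

  trail-inner : ∀ {k} a (x : Vec ℤ k) b (j : Fin k) → trail a x b (suc (toℕ j)) ≡ lookup x j
  trail-inner a (y ∷ ys) b zero = refl
  trail-inner a (y ∷ ys) b (suc j) = trail-inner y ys b j

  trail-end : ∀ {k} a (x : Vec ℤ k) b → trail a x b (suc k) ≡ b
  trail-end a [] b = refl
  trail-end a (y ∷ ys) b = trail-end y ys b

  module _ {k : ℕ} (a : ℤ) (x : Vec ℤ k) (b : ℤ) where
    SignTrail : Set
    SignTrail = ∀ p → p < suc k → dist (trail a x b p) (trail a x b (suc p)) ≡ 1
    LazyTrail : Set
    LazyTrail = ∃ λ c → c < suc k × trail a x b c ≡ trail a x b (suc c) ×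
                    (∀ p → p < suc k → p ≢ c → dist (trail a x b p) (trail a x b (suc p)) ≡ 1)

  signWalk⇒trail : ∀ {k} a (x : Vec ℤ k) b → SignWalk a x b → SignTrail a x b
  signWalk⇒trail a [] b w zero _ = w
  signWalk⇒trail a [] b w (suc p) (s≤s ())
  signWalk⇒trail a (y ∷ ys) b (d , w) zero _ = d
  signWalk⇒trail a (y ∷ ys) b (d , w) (suc p) (s≤s lt) = signWalk⇒trail y ys b w p lt

  trail⇒signWalk : ∀ {k} a (x : Vec ℤ k) b → SignTrail a x b → SignWalk a x b
  trail⇒signWalk a [] b h = h 0 (s≤s z≤n)
  trail⇒signWalk a (y ∷ ys) b h = h 0 (s≤s z≤n) , trail⇒signWalk y ys b (λ p lt → h (suc p) (s≤s lt))

  lazyWalk⇒trail : ∀ {k} a (x : Vec ℤ k) b → LazyWalk a x b → LazyTrail a x b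
  lazyWalk⇒trail a [] b e = 0 , s≤s z≤n , e , λ { zero _ ne → ⊥-elim (ne refl) ; (suc p) (s≤s ()) _ }
  lazyWalk⇒trail a (y ∷ ys) b (inj₁ (d , w)) with lazyWalk⇒trail y ys b w
  ... | c , c<L , zc , oth = suc c , s≤s c<L , zc , λ { zero _ _ → d ; (suc p) (s≤s lt) ne → oth p lt (λ e → ne (cong suc e)) }
  lazyWalk⇒trail a (y ∷ ys) b (inj₂ (e , w)) =
    0 , s≤s z≤n , e , λ { zero _ ne → ⊥-elim (ne refl) ; (suc p) (s≤s lt) _ → signWalk⇒trail y ys b w p lt }

  trail⇒lazyWalk : ∀ {k} a (x : Vec ℤ k) b → LazyTrail a x b → LazyWalk a x b
  trail⇒lazyWalk a [] b (zero , _ , e , _) = e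
  trail⇒lazyWalk a [] b (suc c , s≤s () , _)
  trail⇒lazyWalk a (y ∷ ys) b (zero , _ , e , oth) = inj₂ (e , trail⇒signWalk y ys b (λ p lt → oth (suc p) (s≤s lt) (λ ())))
  trail⇒lazyWalk a (y ∷ ys) b (suc c , s≤s c<L , e , oth) =
    inj₁ (oth 0 (s≤s z≤n) (λ ()) , trail⇒lazyWalk y ys b (c , c<L , e , λ p lt ne → oth (suc p) (s≤s lt) (λ e' → ne (NP.suc-injective e'))))

  signTrail⇒¬lazyTrail : ∀ {k} a (x : Vec ℤ k) b → SignTrail a x b → LazyTrail a x b → ⊥
  signTrail⇒¬lazyTrail a x b nz (c , c<L , zc , _) with trans (sym (cong (λ t → dist t (trail a x b (suc c))) zc)) (nz c c<L)
  ... | e rewrite dist-refl (trail a x b (suc c)) with e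
  ... | ()

  pathValue-trail : ∀ k f0 f1 (x : Vec ℤ k) p → p ≤ suc k → lookup (f0 ∷ f1 ∷ x) (pathVertex k p) ≡ trail f0 x f1 p
  pathValue-trail k f0 f1 x zero _ = refl
  pathValue-trail k f0 f1 x (suc p) (s≤s le) with p ℕ.<? k
  ... | yes lt with innerVertex-< k p lt
  ... | j , e , t rewrite e = sym (trans (cong (λ q → trail f0 x f1 (suc q)) (sym t)) (trail-inner f0 x f1 j))
  pathValue-trail k f0 f1 x (suc p) (s≤s le) | no nlt rewrite innerVertex-≥ k p (NP.≮⇒≥ nlt) | NP.≤-antisym le (NP.≮⇒≥ nlt) = sym (trail-end f0 x f1)

  module PathCounts (k : ℕ) where
    G = graph (suc k) (pathE k)
    W = pathTraversal k
    wL : pathVertex k (suc k) ≡ suc zero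
    wL = innerVertex-≥ k k ≤-refl
    posLL : pathPos k (pathVertex k (suc k)) ≡ suc k
    posLL = cong (pathPos k) wL

    module _ (f0 f1 : ℤ) (x : Vec ℤ k) where
      private
        f = f0 ∷ f1 ∷ x
      open Steps G W f
      noFlat⇒signTrail : NoFlat → SignTrail f0 x f1
      noFlat⇒signTrail nz p lt = subst₂ (λ s t → dist s t ≡ 1) (pathValue-trail k f0 f1 x p (<⇒≤ lt)) (pathValue-trail k f0 f1 x (suc p) lt) (nz p lt)
      signTrail⇒noFlat : SignTrail f0 x f1 → NoFlat
      signTrail⇒noFlat nz p lt = subst₂ (λ s t → dist s t ≡ 1) (sym (pathValue-trail k f0 f1 x p (<⇒≤ lt))) (sym (pathValue-trail k f0 f1 x (suc p) lt)) (nz p lt)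
      oneFlat⇒lazyTrail : OneFlat → LazyTrail f0 x f1
      oneFlat⇒lazyTrail (c , c<L , zc , oth) = c , c<L , subst₂ _≡_ (pathValue-trail k f0 f1 x c (<⇒≤ c<L)) (pathValue-trail k f0 f1 x (suc c) c<L) zc ,
        λ p lt ne → subst₂ (λ s t → dist s t ≡ 1) (pathValue-trail k f0 f1 x p (<⇒≤ lt)) (pathValue-trail k f0 f1 x (suc p) lt) (oth p lt ne)
      lazyTrail⇒oneFlat : LazyTrail f0 x f1 → OneFlat
      lazyTrail⇒oneFlat (c , c<L , zc , oth) = c , c<L , subst₂ _≡_ (sym (pathValue-trail k f0 f1 x c (<⇒≤ c<L))) (sym (pathValue-trail k f0 f1 x (suc c) c<L)) zc ,
        λ p lt ne → subst₂ (λ s t → dist s t ≡ 1) (sym (pathValue-trail k f0 f1 x p (<⇒≤ lt))) (sym (pathValue-trail k f0 f1 x (suc p) lt)) (oth p lt ne)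
      noFlat⇒lipschitz : NoFlat → Lipschitz G f
      noFlat⇒lipschitz nz = steps⇒lipschitz (λ q lt → NP.≤-reflexive (nz q lt))
      oneFlat⇒lipschitz : OneFlat → Lipschitz G f
      oneFlat⇒lipschitz (c , c<L , zc , oth) = steps⇒lipschitz h
        where h : ∀ q → q < suc k → dist (val q) (val (suc q)) ≤ 1
              h q lt with q ℕ.≟ c
              ... | yes refl = NP.≤-trans (NP.≤-reflexive (trans (cong (λ t → dist t (val (suc q))) zc) (dist-refl (val (suc q))))) z≤n
              ... | no ne = NP.≤-reflexive (oth q lt ne)

    count-path-connected : ∀ d → HasCountIn (Vec ℤ (suc (suc k))) (λ f → lookup f zero ≡ 0ℤ × lookup f (suc zero) ≡ d × Lipschitz G f × Connected G f) (signWalks (suc k) d)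
    count-path-connected d = count-≡ (cong (signWalks (suc k)) (ZP.+-identityʳ d))
      (count-image (λ x → 0ℤ ∷ d ∷ x) (λ _ _ e → ∷-injectiveʳ (∷-injectiveʳ e)) fwd bwd (count-signWalks k 0ℤ d))
      where
      fwd : ∀ x → SignWalk 0ℤ x d → _
      fwd x w = refl , refl , noFlat⇒lipschitz 0ℤ d x nz , PathStates.noFlat⇒connected (pathE k) W refl wL posLL (0ℤ ∷ d ∷ x) nz
        where nz = signTrail⇒noFlat 0ℤ d x (signWalk⇒trail 0ℤ x d w)
      bwd : ∀ f → _ → ∃ λ x → SignWalk 0ℤ x d × f ≡ 0ℤ ∷ d ∷ x
      bwd (.0ℤ ∷ .d ∷ x) (refl , refl , ok , sc) =
        x , trail⇒signWalk 0ℤ x d (noFlat⇒signTrail 0ℤ d x (PathStates.connected⇒noFlat (pathE k) W refl wL posLL (0ℤ ∷ d ∷ x) ok sc)) , refl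

    count-path-split : ∀ d → HasCountIn (Vec ℤ (suc (suc k))) (λ f → lookup f zero ≡ 0ℤ × lookup f (suc zero) ≡ d × Lipschitz G f × Split (pathE k) f) (lazyWalks (suc k) d)
    count-path-split d = count-≡ (cong (lazyWalks (suc k)) (ZP.+-identityʳ d))
      (count-image (λ x → 0ℤ ∷ d ∷ x) (λ _ _ e → ∷-injectiveʳ (∷-injectiveʳ e)) fwd bwd (count-lazyWalks k 0ℤ d))
      where
      fwd : ∀ x → LazyWalk 0ℤ x d → _
      fwd x w = refl , refl , oneFlat⇒lipschitz 0ℤ d x oz , PathStates.oneFlat⇒split (pathE k) W refl wL posLL (0ℤ ∷ d ∷ x) oz
        where oz = lazyTrail⇒oneFlat 0ℤ d x (lazyWalk⇒trail 0ℤ x d w)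
      bwd : ∀ f → _ → ∃ λ x → LazyWalk 0ℤ x d × f ≡ 0ℤ ∷ d ∷ x
      bwd (.0ℤ ∷ .d ∷ x) (refl , refl , ok , sd) =
        x , trail⇒lazyWalk 0ℤ x d (oneFlat⇒lazyTrail 0ℤ d x (PathStates.split⇒oneFlat (pathE k) W refl wL posLL (0ℤ ∷ d ∷ x) ok sd)) , refl

    path-trichotomy : ∀ f → Lipschitz G f → Connected G f ⊎ Split (pathE k) f ⊎ Stranded (pathE k) f
    path-trichotomy f ok = PathStates.trichotomy (pathE k) W refl wL posLL f ok

  toℕ≡suc⇒ : ∀ {n} (i : Fin (suc n)) p → toℕ i ≡ suc p → ∃ λ j → i ≡ suc j × toℕ j ≡ p
  toℕ≡suc⇒ (suc j) p e = j , refl , NP.suc-injective e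

  cycleValue-trail : ∀ k f0 (x : Vec ℤ k) p → p ≤ suc k → lookup (f0 ∷ x) (cycleVertex k p) ≡ trail f0 x f0 p
  cycleValue-trail k f0 x zero _ rewrite cycleVertex-start k = refl
  cycleValue-trail k f0 x (suc p) le with p ℕ.≟ k
  ... | no ne with toℕ≡suc⇒ (cycleVertex k (suc p)) p (cycleVertex-< k (suc p) (s≤s (≤∧≢⇒< (≤-pred le) ne)))
  ... | j , e , t rewrite e = sym (trans (cong (λ q → trail f0 x f0 (suc q)) (sym t)) (trail-inner f0 x f0 j))
  cycleValue-trail k f0 x (suc p) le | yes refl rewrite cycleVertex-end p = sym (trail-end f0 x f0)

  module CycleCounts (k : ℕ) where
    G = graph k (cycE k)
    W = cycleTraversal k

    module _ (f0 : ℤ) (x : Vec ℤ k) where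
      private
        f = f0 ∷ x
      open Steps G W f
      noFlat⇒signTrail : NoFlat → SignTrail f0 x f0
      noFlat⇒signTrail nz p lt = subst₂ (λ s t → dist s t ≡ 1) (cycleValue-trail k f0 x p (<⇒≤ lt)) (cycleValue-trail k f0 x (suc p) lt) (nz p lt)
      signTrail⇒noFlat : SignTrail f0 x f0 → NoFlat
      signTrail⇒noFlat nz p lt = subst₂ (λ s t → dist s t ≡ 1) (sym (cycleValue-trail k f0 x p (<⇒≤ lt))) (sym (cycleValue-trail k f0 x (suc p) lt)) (nz p lt)
      oneFlat⇒lazyTrail : OneFlat → LazyTrail f0 x f0
      oneFlat⇒lazyTrail (c , c<L , zc , oth) = c , c<L , subst₂ _≡_ (cycleValue-trail k f0 x c (<⇒≤ c<L)) (cycleValue-trail k f0 x (suc c) c<L) zc ,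
        λ p lt ne → subst₂ (λ s t → dist s t ≡ 1) (cycleValue-trail k f0 x p (<⇒≤ lt)) (cycleValue-trail k f0 x (suc p) lt) (oth p lt ne)
      lazyTrail⇒oneFlat : LazyTrail f0 x f0 → OneFlat
      lazyTrail⇒oneFlat (c , c<L , zc , oth) = c , c<L , subst₂ _≡_ (sym (cycleValue-trail k f0 x c (<⇒≤ c<L))) (sym (cycleValue-trail k f0 x (suc c) c<L)) zc ,
        λ p lt ne → subst₂ (λ s t → dist s t ≡ 1) (sym (cycleValue-trail k f0 x p (<⇒≤ lt))) (sym (cycleValue-trail k f0 x (suc p) lt)) (oth p lt ne)
      noFlat⇒lipschitz : NoFlat → Lipschitz G f
      noFlat⇒lipschitz nz = steps⇒lipschitz (λ q lt → NP.≤-reflexive (nz q lt))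
      oneFlat⇒lipschitz : OneFlat → Lipschitz G f
      oneFlat⇒lipschitz (c , c<L , zc , oth) = steps⇒lipschitz h
        where h : ∀ q → q < suc k → dist (val q) (val (suc q)) ≤ 1
              h q lt with q ℕ.≟ c
              ... | yes refl = NP.≤-trans (NP.≤-reflexive (trans (cong (λ t → dist t (val (suc q))) zc) (dist-refl (val (suc q))))) z≤n
              ... | no ne = NP.≤-reflexive (oth q lt ne)

    count-cycle : HasCountIn (Vec ℤ (suc k)) (λ f → lookup f zero ≡ 0ℤ × Lipschitz G f × Connected G f) (signWalks (suc k) 0ℤ ℕ.+ lazyWalks (suc k) 0ℤ)
    count-cycle = count-image (0ℤ ∷_) (λ _ _ e → ∷-injectiveʳ e) fwd bwd
                 (count-⊎ (count-signWalks k 0ℤ 0ℤ) (count-lazyWalks k 0ℤ 0ℤ)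
                   (λ x wc wd → signTrail⇒¬lazyTrail 0ℤ x 0ℤ (signWalk⇒trail 0ℤ x 0ℤ wc) (lazyWalk⇒trail 0ℤ x 0ℤ wd)))
      where
      fwd : ∀ x → SignWalk 0ℤ x 0ℤ ⊎ LazyWalk 0ℤ x 0ℤ → _
      fwd x (inj₁ w) = refl , noFlat⇒lipschitz 0ℤ x nz , CycleStates.fewFlats⇒connected G W (cycleVertex-start k) (cycleVertex-end k) (0ℤ ∷ x) (inj₁ nz)
        where nz = signTrail⇒noFlat 0ℤ x (signWalk⇒trail 0ℤ x 0ℤ w)
      fwd x (inj₂ w) = refl , oneFlat⇒lipschitz 0ℤ x oz , CycleStates.fewFlats⇒connected G W (cycleVertex-start k) (cycleVertex-end k) (0ℤ ∷ x) (inj₂ oz)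
        where oz = lazyTrail⇒oneFlat 0ℤ x (lazyWalk⇒trail 0ℤ x 0ℤ w)
      bwd : ∀ f → _ → ∃ λ x → (SignWalk 0ℤ x 0ℤ ⊎ LazyWalk 0ℤ x 0ℤ) × f ≡ 0ℤ ∷ x
      bwd (.0ℤ ∷ x) (refl , ok , sc) with CycleStates.connected⇒fewFlats G W (cycleVertex-start k) (cycleVertex-end k) (0ℤ ∷ x) ok sc
      ... | inj₁ nz = x , inj₁ (trail⇒signWalk 0ℤ x 0ℤ (noFlat⇒signTrail 0ℤ x nz)) , refl
      ... | inj₂ oz = x , inj₂ (trail⇒lazyWalk 0ℤ x 0ℤ (oneFlat⇒lazyTrail 0ℤ x oz)) , refl

    cycle-dichotomy : ∀ f → Lipschitz G f → Connected G f ⊎ Disconnected G f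
    cycle-dichotomy f ok = CycleStates.dichotomy G W (cycleVertex-start k) (cycleVertex-end k) f ok

module GluedCounting where

  open import Defs
  open Counting
  open Tightness
  open Gluings
  open GluedStates
  open GraphGluings
  open import Data.Nat as ℕ using (ℕ; zero; suc; _*_)
  open import Data.Integer using (ℤ; 0ℤ)
  open import Data.Fin using (zero; suc)
  open import Data.Vec using (Vec; lookup)
  open import Data.Vec.Properties using (lookup∘tabulate)
  open import Data.Product using (_×_; _,_; ∃; proj₁; proj₂)
  open import Data.Sum using (_⊎_; inj₁; inj₂)
  open import Data.Empty using (⊥)
  open import Relation.Binary.PropositionalEquality

  ConnectedAt : ∀ {N} (E : Edges (2 ℕ.+ N)) (d : ℤ) (f : Vec ℤ (2 ℕ.+ N)) → Set
  ConnectedAt {N} E d f = lookup f zero ≡ 0ℤ × lookup f (suc zero) ≡ d × Lipschitz (graph (suc N) E) f × Connected (graph (suc N) E) f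

  SplitAt : ∀ {N} (E : Edges (2 ℕ.+ N)) (d : ℤ) (f : Vec ℤ (2 ℕ.+ N)) → Set
  SplitAt {N} E d f = lookup f zero ≡ 0ℤ × lookup f (suc zero) ≡ d × Lipschitz (graph (suc N) E) f × Split E f

  TrichotomyOn : ∀ {N} (E : Edges (2 ℕ.+ N)) → Set
  TrichotomyOn {N} E = ∀ f → Lipschitz (graph (suc N) E) f → Connected (graph (suc N) E) f ⊎ Split E f ⊎ Stranded E f

  module GlueCounts₂ (a b : ℕ) (E1 : Edges (2 ℕ.+ a)) (E2 : Edges (2 ℕ.+ b)) (d : ℤ)
    {cˡ sˡ cʳ sʳ : ℕ}
    (connectedˡ : HasCountIn (Vec ℤ (2 ℕ.+ a)) (ConnectedAt E1 d) cˡ) (splitˡ : HasCountIn (Vec ℤ (2 ℕ.+ a)) (SplitAt E1 d) sˡ)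
    (connectedʳ : HasCountIn (Vec ℤ (2 ℕ.+ b)) (ConnectedAt E2 d) cʳ) (splitʳ : HasCountIn (Vec ℤ (2 ℕ.+ b)) (SplitAt E2 d) sʳ)
    (trichotomyˡ : TrichotomyOn E1) (trichotomyʳ : TrichotomyOn E2) where
    open Glue₂ a b
    GB = gluing E1 E2
    open GluingTheory GB
    E = glue2 a b E1 E2
    module TW = TwoTerminalGlue GB refl refl glueSets

    restrict-combine′ : ∀ f1 f2 → lookup f1 zero ≡ lookup f2 zero → lookup f1 (suc zero) ≡ lookup f2 (suc zero) →
               restrictˡ (combine f1 f2) ≡ f1 × restrictʳ (combine f1 f2) ≡ f2
    restrict-combine′ f1 f2 e0 e1 =
      vec-ext _ _ (λ u → trans (lookup∘tabulate (λ u → lookup (combine f1 f2) (inl₂ u)) u) (combine-inl f1 f2 u)) ,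
      vec-ext _ _ (λ u → trans (lookup∘tabulate (λ u → lookup (combine f1 f2) (inr₂ u)) u) (combine-inr f1 f2 e0 e1 u))

    Terminals : Vec ℤ (2 ℕ.+ a) × Vec ℤ (2 ℕ.+ b) → Set
    Terminals (f1 , f2) = lookup f1 zero ≡ 0ℤ × lookup f1 (suc zero) ≡ d × lookup f2 zero ≡ 0ℤ × lookup f2 (suc zero) ≡ d

    restrict-combine : ∀ z → Terminals z → restrictˡ (combine (proj₁ z) (proj₂ z)) ≡ proj₁ z × restrictʳ (combine (proj₁ z) (proj₂ z)) ≡ proj₂ z
    restrict-combine (f1 , f2) (a0 , a1 , b0 , b1) = restrict-combine′ f1 f2 (trans a0 (sym b0)) (trans a1 (sym b1))

    combine² : Vec ℤ (2 ℕ.+ a) × Vec ℤ (2 ℕ.+ b) → Vec ℤ (2 ℕ.+ a ℕ.+ b)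
    combine² (f1 , f2) = combine f1 f2

    combine²-injective : ∀ {z z'} → Terminals z → Terminals z' → combine² z ≡ combine² z' → z ≡ z'
    combine²-injective {z1 , z2} {z1' , z2'} h h' e =
      cong₂ _,_ (trans (sym (proj₁ (restrict-combine (z1 , z2) h))) (trans (cong restrictˡ e) (proj₁ (restrict-combine (z1' , z2') h'))))
                (trans (sym (proj₂ (restrict-combine (z1 , z2) h))) (trans (cong restrictʳ e) (proj₂ (restrict-combine (z1' , z2') h'))))

    restrictˡ-terminal₀ : ∀ f → lookup (restrictˡ f) zero ≡ lookup f zero
    restrictˡ-terminal₀ f = lookup∘tabulate (λ u → lookup f (inl₂ u)) zero
    restrictˡ-terminal₁ : ∀ f → lookup (restrictˡ f) (suc zero) ≡ lookup f (suc zero)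
    restrictˡ-terminal₁ f = lookup∘tabulate (λ u → lookup f (inl₂ u)) (suc zero)
    restrictʳ-terminal₀ : ∀ f → lookup (restrictʳ f) zero ≡ lookup f zero
    restrictʳ-terminal₀ f = lookup∘tabulate (λ u → lookup f (inr₂ u)) zero
    restrictʳ-terminal₁ : ∀ f → lookup (restrictʳ f) (suc zero) ≡ lookup f (suc zero)
    restrictʳ-terminal₁ f = lookup∘tabulate (λ u → lookup f (inr₂ u)) (suc zero)

    terminal₀-glue : ∀ f {f1} → restrictˡ f ≡ f1 → lookup f1 zero ≡ 0ℤ → lookup f zero ≡ 0ℤ
    terminal₀-glue f e p = trans (sym (restrictˡ-terminal₀ f)) (trans (cong (λ v → lookup v zero) e) p)
    terminal₁-glue : ∀ f {f1} → restrictˡ f ≡ f1 → lookup f1 (suc zero) ≡ d → lookup f (suc zero) ≡ d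
    terminal₁-glue f e p = trans (sym (restrictˡ-terminal₁ f)) (trans (cong (λ v → lookup v (suc zero)) e) p)

    connectedAt-glue : ∀ f {f1 f2} → restrictˡ f ≡ f1 → restrictʳ f ≡ f2 → lookup f1 zero ≡ 0ℤ → lookup f1 (suc zero) ≡ d →
           Lipschitz Gˡ f1 → Lipschitz Gʳ f2 → TW.ConnectedCases f → ConnectedAt E d f
    connectedAt-glue f e1 e2 p0 p1 pok qok g = terminal₀-glue f e1 p0 , terminal₁-glue f e1 p1 ,
      lipschitz-glue f (subst (Lipschitz Gˡ) (sym e1) pok) (subst (Lipschitz Gʳ) (sym e2) qok) , TW.connectedCases⇒connected f g

    combine-restrict : ∀ f → Terminals (restrictˡ f , restrictʳ f) → f ≡ combine² (restrictˡ f , restrictʳ f)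
    combine-restrict f h = restrict-injective f (combine² (restrictˡ f , restrictʳ f)) (sym (proj₁ (restrict-combine (restrictˡ f , restrictʳ f) h))) (sym (proj₂ (restrict-combine (restrictˡ f , restrictʳ f) h)))

    module RestrictTerminals (f : Vec ℤ (2 ℕ.+ a ℕ.+ b)) (q0 : lookup f zero ≡ 0ℤ) (q1 : lookup f (suc zero) ≡ d)
                 (ok : Lipschitz G f) where
      ok1 = proj₁ (lipschitz-restrict f ok)
      ok2 = proj₂ (lipschitz-restrict f ok)
      a0 = trans (restrictˡ-terminal₀ f) q0
      a1 = trans (restrictˡ-terminal₁ f) q1
      b0 = trans (restrictʳ-terminal₀ f) q0
      b1 = trans (restrictʳ-terminal₁ f) q1

    trichotomy : TrichotomyOn E
    trichotomy f ok = TW.trichotomy-glue f (trichotomyˡ (restrictˡ f) (proj₁ (lipschitz-restrict f ok))) (trichotomyʳ (restrictʳ f) (proj₂ (lipschitz-restrict f ok)))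

    connectedAt⇒¬splitAt : ∀ {N} (H : Edges (2 ℕ.+ N)) h → ConnectedAt H d h → SplitAt H d h → ⊥
    connectedAt⇒¬splitAt H h (_ , _ , _ , sc) (_ , _ , _ , sd) = connected⇒¬split H h sc sd

    ConnectedParts : Vec ℤ (2 ℕ.+ a) × Vec ℤ (2 ℕ.+ b) → Set
    ConnectedParts z = ((ConnectedAt E1 d (proj₁ z) × ConnectedAt E2 d (proj₂ z)) ⊎ (ConnectedAt E1 d (proj₁ z) × SplitAt E2 d (proj₂ z))) ⊎ (SplitAt E1 d (proj₁ z) × ConnectedAt E2 d (proj₂ z))
    SplitParts : Vec ℤ (2 ℕ.+ a) × Vec ℤ (2 ℕ.+ b) → Set
    SplitParts z = SplitAt E1 d (proj₁ z) × SplitAt E2 d (proj₂ z)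

    count-connected : HasCountIn (Vec ℤ (2 ℕ.+ a ℕ.+ b)) (ConnectedAt E d) (cˡ * cʳ ℕ.+ cˡ * sʳ ℕ.+ sˡ * cʳ)
    count-connected = count-image {P = ConnectedParts} combine² (λ {x} {y} p q → combine²-injective {x} {y} (terminals {x} p) (terminals {y} q)) fwd bwd
           (count-⊎ (count-⊎ (count-× connectedˡ connectedʳ) (count-× connectedˡ splitʳ)
                        (λ f (_ , p) (_ , q) → connectedAt⇒¬splitAt E2 (proj₂ f) p q))
                     (count-× splitˡ connectedʳ)
                     (λ { f (inj₁ (p , _)) (q , _) → connectedAt⇒¬splitAt E1 (proj₁ f) p q ; f (inj₂ (p , _)) (q , _) → connectedAt⇒¬splitAt E1 (proj₁ f) p q }))
      where
      terminals : ∀ {z} → ConnectedParts z → Terminals z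
      terminals (inj₁ (inj₁ ((p0 , p1 , _) , (q0 , q1 , _)))) = p0 , p1 , q0 , q1
      terminals (inj₁ (inj₂ ((p0 , p1 , _) , (q0 , q1 , _)))) = p0 , p1 , q0 , q1
      terminals (inj₂ ((p0 , p1 , _) , (q0 , q1 , _))) = p0 , p1 , q0 , q1
      fwd : ∀ z → ConnectedParts z → ConnectedAt E d (combine² z)
      fwd (f1 , f2) pq with restrict-combine (f1 , f2) (terminals {f1 , f2} pq)
      fwd (f1 , f2) (inj₁ (inj₁ ((p0 , p1 , pok , ps) , (q0 , q1 , qok , qs)))) | e1 , e2 =
        connectedAt-glue (combine f1 f2) e1 e2 p0 p1 pok qok (inj₁ (subst (Connected Gˡ) (sym e1) ps , subst (Connected Gʳ) (sym e2) qs))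
      fwd (f1 , f2) (inj₁ (inj₂ ((p0 , p1 , pok , ps) , (q0 , q1 , qok , qs)))) | e1 , e2 =
        connectedAt-glue (combine f1 f2) e1 e2 p0 p1 pok qok (inj₂ (inj₁ (subst (Connected Gˡ) (sym e1) ps , subst (Split E2) (sym e2) qs)))
      fwd (f1 , f2) (inj₂ ((p0 , p1 , pok , ps) , (q0 , q1 , qok , qs))) | e1 , e2 =
        connectedAt-glue (combine f1 f2) e1 e2 p0 p1 pok qok (inj₂ (inj₂ (subst (Split E1) (sym e1) ps , subst (Connected Gʳ) (sym e2) qs)))
      bwd : ∀ f → ConnectedAt E d f → ∃ λ z → ConnectedParts z × f ≡ combine² z
      bwd f (q0 , q1 , ok , sc) with TW.connected-cases f (trichotomyˡ (restrictˡ f) ok1) (trichotomyʳ (restrictʳ f) ok2) sc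
        where ok1 = proj₁ (lipschitz-restrict f ok)
              ok2 = proj₂ (lipschitz-restrict f ok)
      ... | inj₁ (s1 , s2) = (restrictˡ f , restrictʳ f) , inj₁ (inj₁ ((a0 , a1 , ok1 , s1) , (b0 , b1 , ok2 , s2))) , combine-restrict f (a0 , a1 , b0 , b1)
        where open RestrictTerminals f q0 q1 ok
      ... | inj₂ (inj₁ (s1 , s2)) = (restrictˡ f , restrictʳ f) , inj₁ (inj₂ ((a0 , a1 , ok1 , s1) , (b0 , b1 , ok2 , s2))) , combine-restrict f (a0 , a1 , b0 , b1)
        where open RestrictTerminals f q0 q1 ok
      ... | inj₂ (inj₂ (s1 , s2)) = (restrictˡ f , restrictʳ f) , inj₂ ((a0 , a1 , ok1 , s1) , (b0 , b1 , ok2 , s2)) , combine-restrict f (a0 , a1 , b0 , b1)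
        where open RestrictTerminals f q0 q1 ok

    count-split : HasCountIn (Vec ℤ (2 ℕ.+ a ℕ.+ b)) (SplitAt E d) (sˡ * sʳ)
    count-split = count-image {P = SplitParts} combine² (λ {x} {y} p q → combine²-injective {x} {y} (terminals {x} p) (terminals {y} q)) fwd bwd (count-× splitˡ splitʳ)
      where
      terminals : ∀ {z} → SplitParts z → Terminals z
      terminals ((p0 , p1 , _) , (q0 , q1 , _)) = p0 , p1 , q0 , q1
      fwd : ∀ z → SplitParts z → SplitAt E d (combine² z)
      fwd (f1 , f2) pq with restrict-combine (f1 , f2) (terminals {f1 , f2} pq)
      fwd (f1 , f2) ((p0 , p1 , pok , ps) , (q0 , q1 , qok , qs)) | e1 , e2 =
        terminal₀-glue (combine f1 f2) e1 p0 , terminal₁-glue (combine f1 f2) e1 p1 , lipschitz-glue (combine f1 f2) (subst (Lipschitz Gˡ) (sym e1) pok) (subst (Lipschitz Gʳ) (sym e2) qok) ,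
        TW.split-glue (combine f1 f2) (subst (Split E1) (sym e1) ps) (subst (Split E2) (sym e2) qs)
      bwd : ∀ f → SplitAt E d f → ∃ λ z → SplitParts z × f ≡ combine² z
      bwd f (q0 , q1 , ok , sd) with TW.split⇒split×split f (trichotomyˡ (restrictˡ f) ok1) (trichotomyʳ (restrictʳ f) ok2) sd
        where ok1 = proj₁ (lipschitz-restrict f ok)
              ok2 = proj₂ (lipschitz-restrict f ok)
      ... | s1 , s2 = (restrictˡ f , restrictʳ f) , ((a0 , a1 , ok1 , s1) , (b0 , b1 , ok2 , s2)) , combine-restrict f (a0 , a1 , b0 , b1)
        where open RestrictTerminals f q0 q1 ok

module ThetaCounting where

  open import Defs
  open Counting
  open Tightness
  open WalkCounting using (signWalks; lazyWalks)
  open PieceCounting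
  open GluedCounting
  open import Data.Nat as ℕ using (ℕ; zero; suc; _*_; _∸_)
  open import Data.Integer using (ℤ; 0ℤ)
  open import Data.Fin using (Fin; zero; suc)
  open import Data.Vec using (Vec; []; _∷_; lookup)
  open import Data.Bool using (Bool; true; false)
  open import Data.List using (List; []; _∷_)
  open import Data.List.Membership.Propositional using (_∈_)
  open import Data.List.Relation.Unary.Unique.Propositional using (Unique)
  open import Data.Product using (_×_; _,_; proj₁; proj₂)
  open import Data.Sum using (_⊎_; inj₁; inj₂)
  open import Data.Empty using (⊥; ⊥-elim)
  open import Relation.Binary.PropositionalEquality
  open import Relation.Binary.Construct.Closure.ReflexiveTransitive using (Star; ε; _◅_)

  -- Glued at both terminals, the union is connected iff one part is connected and the other connected
  -- or split, and it is split iff both parts are split.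
  connectedCount : List ℕ → ℤ → ℕ
  splitCount : List ℕ → ℤ → ℕ
  connectedCount [] d = 0
  connectedCount (m ∷ ms) d = signWalks (suc (m ∸ 1)) d * connectedCount ms d ℕ.+ signWalks (suc (m ∸ 1)) d * splitCount ms d ℕ.+ lazyWalks (suc (m ∸ 1)) d * connectedCount ms d
  splitCount [] d = 1
  splitCount (m ∷ ms) d = lazyWalks (suc (m ∸ 1)) d * splitCount ms d

  module TwoPoints where
    G0 = graph 1 []
    noT : ∀ (f : Vec ℤ 2) {u v} → Tight G0 f u v → ⊥
    noT f (inj₁ () , _)
    noT f (inj₂ () , _)
    sd : ∀ f → Split {0} [] f
    sd f = reach , S , refl , refl , (λ u v t _ → ⊥-elim (noT f t))
      where
      reach : ∀ v → Star (Tight G0 f) zero v ⊎ Star (Tight G0 f) (suc zero) v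
      reach zero = inj₁ ε
      reach (suc zero) = inj₂ ε
      S : Fin 2 → Bool
      S zero = true
      S (suc zero) = false
    noSC : ∀ f → Connected G0 f → ⊥
    noSC f sc with sc (suc zero)
    ... | t ◅ _ = noT f t
    ok : ∀ f → Lipschitz G0 f
    ok f u v ()

  count-CB-at : ∀ ms d → HasCountIn (Vec ℤ (2 ℕ.+ cbSize ms)) (ConnectedAt (cbEdges ms) d) (connectedCount ms d) ×
                   HasCountIn (Vec ℤ (2 ℕ.+ cbSize ms)) (SplitAt (cbEdges ms) d) (splitCount ms d) × TrichotomyOn (cbEdges ms)
  count-CB-at [] d =
    count-none (λ f (_ , _ , _ , sc) → TwoPoints.noSC f sc) ,
    count-resp (λ { f refl → refl , refl , TwoPoints.ok f , TwoPoints.sd f }) (λ { (x ∷ y ∷ []) (refl , refl , _) → refl }) (count-singleton (0ℤ ∷ d ∷ [])) ,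
    (λ f _ → inj₂ (inj₁ (TwoPoints.sd f)))
  count-CB-at (m ∷ ms) d = GlueCounts₂.count-connected a b E1 E2 d connectedˡ splitˡ connectedʳ splitʳ trichotomyˡ trichotomyʳ ,
                     GlueCounts₂.count-split a b E1 E2 d connectedˡ splitˡ connectedʳ splitʳ trichotomyˡ trichotomyʳ ,
                     GlueCounts₂.trichotomy a b E1 E2 d connectedˡ splitˡ connectedʳ splitʳ trichotomyˡ trichotomyʳ
    where
    a = m ∸ 1
    b = cbSize ms
    E1 = pathE a
    E2 = cbEdges ms
    connectedˡ = PathCounts.count-path-connected a d
    splitˡ = PathCounts.count-path-split a d
    rec = count-CB-at ms d
    connectedʳ = proj₁ rec
    splitʳ = proj₁ (proj₂ rec)
    trichotomyˡ = PathCounts.path-trichotomy a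
    trichotomyʳ = proj₂ (proj₂ rec)

  count-zero⇒¬ : ∀ {A : Set} {P : A → Set} → HasCountIn A P 0 → ∀ f → P f → ⊥
  count-zero⇒¬ ([] , _ , _ , _ , c) f p with c f p
  ... | ()

  -- N(CB) splits according to the value d = f(1) at the second terminal.
  count-CB : ∀ ms (R : List ℤ) → Unique R → (∀ d → connectedCount ms d ≢ 0 → d ∈ R) →
            N≡ (CB ms) (sumOver (connectedCount ms) R)
  count-CB ms R u cov =
    count-resp (λ { f (d , _ , (e0 , _ , ok , sc)) → e0 , ok , sc })
           (λ f (e0 , ok , sc) → lookup f (suc zero) , cov _ (nz f e0 ok sc) , (e0 , refl , ok , sc))
           (count-⋃ (λ d f → ConnectedAt (cbEdges ms) d f) (connectedCount ms) R u (λ d → proj₁ (count-CB-at ms d))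
              (λ { i j f (_ , e , _) (_ , e' , _) → trans (sym e) e' }))
    where
    nz : ∀ f → lookup f zero ≡ 0ℤ → Lipschitz (CB ms) f → Connected (CB ms) f → connectedCount ms (lookup f (suc zero)) ≢ 0
    nz f e0 ok sc z = count-zero⇒¬ (subst (HasCountIn _ _) z (proj₁ (count-CB-at ms (lookup f (suc zero))))) f (e0 , refl , ok , sc)

module WedgeCounting where

  open import Defs
  open Counting
  open Tightness
  open Gluings
  open GluedStates
  open GraphGluings
  open WalkCounting using (signWalks; lazyWalks)
  open PieceCounting
  open import Data.Nat as ℕ using (ℕ; zero; suc; _*_; _∸_)
  open import Data.Integer using (ℤ; 0ℤ)
  open import Data.Fin using (zero; suc)
  open import Data.Vec using (Vec; []; _∷_; lookup)
  open import Data.Vec.Properties using (lookup∘tabulate)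
  open import Data.List using (List; []; _∷_)
  open import Data.Product using (_×_; _,_; ∃; proj₁; proj₂)
  open import Data.Sum using (_⊎_; inj₁)
  open import Relation.Binary.PropositionalEquality
  open import Relation.Binary.Construct.Closure.ReflexiveTransitive using (ε)

  Rooted : ∀ {N} (E : Edges (suc N)) (f : Vec ℤ (suc N)) → Set
  Rooted {N} E f = lookup f zero ≡ 0ℤ × Lipschitz (graph N E) f × Connected (graph N E) f

  DichotomyOn : ∀ {N} (E : Edges (suc N)) → Set
  DichotomyOn {N} E = ∀ f → Lipschitz (graph N E) f → Connected (graph N E) f ⊎ Disconnected (graph N E) f

  wedgeN : List ℕ → ℕ
  wedgeN [] = 1
  wedgeN (c ∷ cs) = (signWalks (suc (c ∸ 1)) 0ℤ ℕ.+ lazyWalks (suc (c ∸ 1)) 0ℤ) * wedgeN cs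

  -- Glued at one vertex, a function is admissible iff both restrictions are, so the counts multiply.
  module GlueCounts₁ (a b : ℕ) (E1 : Edges (suc a)) (E2 : Edges (suc b)) {nˡ nʳ : ℕ}
    (rootedˡ : HasCountIn (Vec ℤ (suc a)) (Rooted E1) nˡ) (rootedʳ : HasCountIn (Vec ℤ (suc b)) (Rooted E2) nʳ)
    (dichotomyˡ : DichotomyOn E1) (dichotomyʳ : DichotomyOn E2) where
    open Glue₁ a b
    GB = gluing E1 E2
    open GluingTheory GB
    E = glue1 a b E1 E2

    restrict-combine : ∀ f1 f2 → lookup f1 zero ≡ lookup f2 zero → restrictˡ (combine f1 f2) ≡ f1 × restrictʳ (combine f1 f2) ≡ f2
    restrict-combine f1 f2 e0 =
      vec-ext _ _ (λ u → trans (lookup∘tabulate (λ u → lookup (combine f1 f2) (inl₁ u)) u) (combine-inl f1 f2 u)) ,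
      vec-ext _ _ (λ u → trans (lookup∘tabulate (λ u → lookup (combine f1 f2) (inr₁ u)) u) (combine-inr f1 f2 e0 u))

    RootedParts : Vec ℤ (suc a) × Vec ℤ (suc b) → Set
    RootedParts z = Rooted E1 (proj₁ z) × Rooted E2 (proj₂ z)

    combine² : Vec ℤ (suc a) × Vec ℤ (suc b) → Vec ℤ (suc a ℕ.+ b)
    combine² (f1 , f2) = combine f1 f2

    roots-agree : ∀ {z} → RootedParts z → lookup (proj₁ z) zero ≡ lookup (proj₂ z) zero
    roots-agree ((p0 , _) , (q0 , _)) = trans p0 (sym q0)

    combine²-injective : ∀ {z z'} → RootedParts z → RootedParts z' → combine² z ≡ combine² z' → z ≡ z'
    combine²-injective {z1 , z2} {z1' , z2'} p p' e =
      cong₂ _,_ (trans (sym (proj₁ (restrict-combine z1 z2 (roots-agree {z1 , z2} p)))) (trans (cong restrictˡ e) (proj₁ (restrict-combine z1' z2' (roots-agree {z1' , z2'} p')))))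
                (trans (sym (proj₂ (restrict-combine z1 z2 (roots-agree {z1 , z2} p)))) (trans (cong restrictʳ e) (proj₂ (restrict-combine z1' z2' (roots-agree {z1' , z2'} p')))))

    count-glue : HasCountIn (Vec ℤ (suc a ℕ.+ b)) (Rooted E) (nˡ * nʳ)
    count-glue = count-image {P = RootedParts} combine² (λ {x} {y} p q → combine²-injective {x} {y} p q) fwd bwd (count-× rootedˡ rootedʳ)
      where
      fwd : ∀ z → RootedParts z → Rooted E (combine² z)
      fwd (f1 , f2) ((p0 , pok , ps) , (q0 , qok , qs)) with restrict-combine f1 f2 (trans p0 (sym q0))
      ... | e1 , e2 = trans (sym (lookup∘tabulate (λ u → lookup (combine f1 f2) (inl₁ u)) zero)) (trans (cong (λ v → lookup v zero) e1) p0) ,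
                      lipschitz-glue (combine f1 f2) (subst (Lipschitz (graph a E1)) (sym e1) pok) (subst (Lipschitz (graph b E2)) (sym e2) qok) ,
                      connected-glue (combine f1 f2) (subst (Connected (graph a E1)) (sym e1) ps) (subst (Connected (graph b E2)) (sym e2) qs)
      bwd : ∀ f → Rooted E f → ∃ λ z → RootedParts z × f ≡ combine² z
      bwd f (q0 , ok , sc) with OneRootGlue.connected-parts GB glueSets f (dichotomyˡ (restrictˡ f) ok1) (dichotomyʳ (restrictʳ f) ok2) sc
        where ok1 = proj₁ (lipschitz-restrict f ok)
              ok2 = proj₂ (lipschitz-restrict f ok)
      ... | s1 , s2 = (restrictˡ f , restrictʳ f) , ((a0 , ok1 , s1) , (b0 , ok2 , s2)) ,
                      restrict-injective f (combine² (restrictˡ f , restrictʳ f)) (sym (proj₁ r)) (sym (proj₂ r))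
        where ok1 = proj₁ (lipschitz-restrict f ok)
              ok2 = proj₂ (lipschitz-restrict f ok)
              a0 = trans (lookup∘tabulate (λ u → lookup f (inl₁ u)) zero) q0
              b0 = trans (lookup∘tabulate (λ u → lookup f (inr₁ u)) zero) q0
              r = restrict-combine (restrictˡ f) (restrictʳ f) (trans a0 (sym b0))

    dichotomy : DichotomyOn E
    dichotomy f ok = OneRootGlue.dichotomy-glue GB glueSets f (dichotomyˡ (restrictˡ f) (proj₁ (lipschitz-restrict f ok))) (dichotomyʳ (restrictʳ f) (proj₂ (lipschitz-restrict f ok)))

  count-wedge-dichotomy : ∀ cs → HasCountIn (Vec ℤ (suc (wedgeSize cs))) (Rooted (wedgeEdges cs)) (wedgeN cs) × DichotomyOn (wedgeEdges cs)
  count-wedge-dichotomy [] = count-resp (λ { f refl → refl , (λ u v ()) , (λ { zero → ε }) }) (λ { (x ∷ []) (refl , _) → refl }) (count-singleton (0ℤ ∷ [])) ,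
            (λ f _ → inj₁ (λ { zero → ε }))
  count-wedge-dichotomy (c ∷ cs) = GlueCounts₁.count-glue (c ∸ 1) (wedgeSize cs) (cycE (c ∸ 1)) (wedgeEdges cs) (CycleCounts.count-cycle (c ∸ 1)) (proj₁ (count-wedge-dichotomy cs))
                     (CycleCounts.cycle-dichotomy (c ∸ 1)) (proj₂ (count-wedge-dichotomy cs)) ,
                  GlueCounts₁.dichotomy (c ∸ 1) (wedgeSize cs) (cycE (c ∸ 1)) (wedgeEdges cs) (CycleCounts.count-cycle (c ∸ 1)) (proj₁ (count-wedge-dichotomy cs))
                     (CycleCounts.cycle-dichotomy (c ∸ 1)) (proj₂ (count-wedge-dichotomy cs))

  count-wedge : ∀ cs → N≡ (WedgeC cs) (wedgeN cs)
  count-wedge cs = proj₁ (count-wedge-dichotomy cs)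

module SignWalkFormula where

  open import Defs using (Odd)
  open WalkCounting using (signWalks; lazyWalks)
  open import Data.Nat as ℕ using (ℕ; zero; suc; _≤_; z≤n; s≤s; _*_)
  open import Data.Nat.Properties as NP using (+-suc; +-comm)
  open import Data.Nat.Divisibility using (_∣_; _∣?_; ∣m+n∣m⇒∣n; ∣m∣n⇒∣m+n; ∣-refl; ∣⇒≤; divides)
  open import Data.Nat.Combinatorics using (_C_; nCk+nC[k+1]≡[n+1]C[k+1])
  open import Data.Integer using (ℤ; +_; 0ℤ; 1ℤ) renaming (_+_ to _+ℤ_; _-_ to _-ℤ_)
  import Data.Integer.Properties as ZP
  open import Data.Integer.Solver using (module +-*-Solver)
  open import Data.Bool using (Bool; true; false; not)
  open import Data.Bool.Properties using (not-involutive)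
  open import Data.Product using (_×_; _,_; ∃)
  open import Data.Empty using (⊥; ⊥-elim)
  open import Relation.Nullary using (yes; no; does)
  open import Relation.Nullary.Decidable using (dec-true; dec-false)
  open import Relation.Binary.PropositionalEquality

  isEven : ℕ → Bool
  isEven zero = true
  isEven (suc n) = not (isEven n)

  isEven-double+ : ∀ i n → isEven (i ℕ.+ i ℕ.+ n) ≡ isEven n
  isEven-double+ zero n = refl
  isEven-double+ (suc i) n rewrite +-suc i i = trans (not-involutive (isEven (i ℕ.+ i ℕ.+ n))) (isEven-double+ i n)

  even⇒isEven : ∀ x → 2 ∣ x → isEven x ≡ true
  even⇒isEven zero _ = refl
  even⇒isEven (suc zero) d with ∣⇒≤ d
  ... | s≤s ()
  even⇒isEven (suc (suc n)) d rewrite even⇒isEven n (∣m+n∣m⇒∣n d ∣-refl) = refl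

  isEven⇒even : ∀ x → isEven x ≡ true → 2 ∣ x
  isEven⇒even zero _ = divides 0 refl
  isEven⇒even (suc zero) ()
  isEven⇒even (suc (suc n)) e = ∣m∣n⇒∣m+n ∣-refl (isEven⇒even n (trans (sym (not-involutive (isEven n))) e))

  odd⇒¬isEven : ∀ {x} → Odd x → isEven x ≡ false
  odd⇒¬isEven {x} o with isEven x in eq
  ... | false = refl
  ... | true with even⇒isEven (suc x) o
  ... | e rewrite eq with e
  ... | ()

  does-2∣?≡isEven : ∀ x → does (2 ∣? x) ≡ isEven x
  does-2∣?≡isEven x with isEven x in eq
  ... | true = dec-true (2 ∣? x) (isEven⇒even x eq)
  ... | false = dec-false (2 ∣? x) (λ d → case (trans (sym (even⇒isEven x d)) eq))
    where case : true ≡ false → ⊥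
          case ()

  -- the endpoint 2i - n of a ±1 walk of length n with i up-steps
  disp : ℕ → ℕ → ℤ
  disp n i = (+ i +ℤ + i) -ℤ + n

  module DispAlgebra where
    open +-*-Solver
    pred-step : ∀ d I N → d -ℤ 1ℤ ≡ (I +ℤ I) -ℤ N → d ≡ ((1ℤ +ℤ I) +ℤ (1ℤ +ℤ I)) -ℤ (1ℤ +ℤ N)
    pred-step d I N e = trans (a d) (trans (cong (_+ℤ 1ℤ) e) (b I N))
      where
      a : ∀ d → d ≡ (d -ℤ 1ℤ) +ℤ 1ℤ
      a = solve 1 (λ d → d := (d :- con 1ℤ) :+ con 1ℤ) refl
      b : ∀ I N → ((I +ℤ I) -ℤ N) +ℤ 1ℤ ≡ ((1ℤ +ℤ I) +ℤ (1ℤ +ℤ I)) -ℤ (1ℤ +ℤ N)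
      b = solve 2 (λ I N → ((I :+ I) :- N) :+ con 1ℤ := ((con 1ℤ :+ I) :+ (con 1ℤ :+ I)) :- (con 1ℤ :+ N)) refl
    suc-step : ∀ d I N → d +ℤ 1ℤ ≡ (I +ℤ I) -ℤ N → d ≡ (I +ℤ I) -ℤ (1ℤ +ℤ N)
    suc-step d I N e = trans (a d) (trans (cong (_-ℤ 1ℤ) e) (b I N))
      where
      a : ∀ d → d ≡ (d +ℤ 1ℤ) -ℤ 1ℤ
      a = solve 1 (λ d → d := (d :+ con 1ℤ) :- con 1ℤ) refl
      b : ∀ I N → ((I +ℤ I) -ℤ N) -ℤ 1ℤ ≡ (I +ℤ I) -ℤ (1ℤ +ℤ N)
      b = solve 2 (λ I N → ((I :+ I) :- N) :- con 1ℤ := (I :+ I) :- (con 1ℤ :+ N)) refl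
    cross-add : ∀ A B Cc D → (A +ℤ A) -ℤ B ≡ (Cc +ℤ Cc) -ℤ D → (A +ℤ A) +ℤ D ≡ (Cc +ℤ Cc) +ℤ B
    cross-add A B Cc D e = trans (a A B D) (trans (cong (_+ℤ (B +ℤ D)) e) (sym (a' Cc D B)))
      where
      a : ∀ A B D → (A +ℤ A) +ℤ D ≡ ((A +ℤ A) -ℤ B) +ℤ (B +ℤ D)
      a = solve 3 (λ A B D → (A :+ A) :+ D := ((A :+ A) :- B) :+ (B :+ D)) refl
      a' : ∀ Cc D B → (Cc +ℤ Cc) +ℤ B ≡ ((Cc +ℤ Cc) -ℤ D) +ℤ (B +ℤ D)
      a' = solve 3 (λ Cc D B → (Cc :+ Cc) :+ B := ((Cc :+ Cc) :- D) :+ (B :+ D)) refl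
    suc-suc-pred : ∀ I N → ((1ℤ +ℤ I) +ℤ (1ℤ +ℤ I)) -ℤ (1ℤ +ℤ N) -ℤ 1ℤ ≡ (I +ℤ I) -ℤ N
    suc-suc-pred = solve 2 (λ I N → ((con 1ℤ :+ I) :+ (con 1ℤ :+ I)) :- (con 1ℤ :+ N) :- con 1ℤ := (I :+ I) :- N) refl
    pred-suc : ∀ I N → ((I +ℤ I) -ℤ (1ℤ +ℤ N)) +ℤ 1ℤ ≡ (I +ℤ I) -ℤ N
    pred-suc = solve 2 (λ I N → ((I :+ I) :- (con 1ℤ :+ N)) :+ con 1ℤ := (I :+ I) :- N) refl
    zero-pred : ∀ N → ((0ℤ +ℤ 0ℤ) -ℤ (1ℤ +ℤ N)) -ℤ 1ℤ ≡ (0ℤ +ℤ 0ℤ) -ℤ (1ℤ +ℤ (1ℤ +ℤ N))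
    zero-pred = solve 1 (λ N → ((con 0ℤ :+ con 0ℤ) :- (con 1ℤ :+ N)) :- con 1ℤ := (con 0ℤ :+ con 0ℤ) :- (con 1ℤ :+ (con 1ℤ :+ N))) refl

  +suc : ∀ n → + suc n ≡ 1ℤ +ℤ + n
  +suc n = ZP.pos-+ 1 n

  disp-≡ : ∀ a b c e → disp b a ≡ disp e c → a ℕ.+ a ℕ.+ e ≡ c ℕ.+ c ℕ.+ b
  disp-≡ a b c e h = ZP.+-injective (trans (trans (ZP.pos-+ (a ℕ.+ a) e) (cong (_+ℤ + e) (ZP.pos-+ a a)))
                    (trans (DispAlgebra.cross-add (+ a) (+ b) (+ c) (+ e) h) (sym (trans (ZP.pos-+ (c ℕ.+ c) b) (cong (_+ℤ + b) (ZP.pos-+ c c))))))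

  disp-suc-suc : ∀ n i → disp (suc n) (suc i) ≡ ((1ℤ +ℤ + i) +ℤ (1ℤ +ℤ + i)) -ℤ (1ℤ +ℤ + n)
  disp-suc-suc n i rewrite +suc i | +suc n = refl
  disp-suc : ∀ n i → disp (suc n) i ≡ (+ i +ℤ + i) -ℤ (1ℤ +ℤ + n)
  disp-suc n i rewrite +suc n = refl

  signWalks-support : ∀ n d → signWalks n d ≢ 0 → ∃ λ i → i ≤ n × d ≡ disp n i
  signWalks-support zero d nz with d ZP.≟ 0ℤ
  ... | yes e = 0 , z≤n , e
  ... | no _ = ⊥-elim (nz refl)
  signWalks-support (suc n) d nz with signWalks n (d -ℤ 1ℤ) ℕ.≟ 0
  ... | no nz1 with signWalks-support n (d -ℤ 1ℤ) nz1
  ... | i , i≤n , e = suc i , s≤s i≤n , trans (DispAlgebra.pred-step d (+ i) (+ n) e) (sym (disp-suc-suc n i))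
  signWalks-support (suc n) d nz | yes z1 with signWalks n (d +ℤ 1ℤ) ℕ.≟ 0
  ... | yes z2 = ⊥-elim (nz (trans (cong₂ ℕ._+_ z1 z2) refl))
  ... | no nz2 with signWalks-support n (d +ℤ 1ℤ) nz2
  ... | i , i≤n , e = i , NP.m≤n⇒m≤1+n i≤n , trans (DispAlgebra.suc-step d (+ i) (+ n) e) (sym (disp-suc n i))

  signWalks-parity : ∀ n s j → isEven n ≢ isEven s → signWalks n (disp s j) ≡ 0
  signWalks-parity n s j ne with signWalks n (disp s j) ℕ.≟ 0
  ... | yes z = z
  ... | no nz with signWalks-support n (disp s j) nz
  ... | i , _ , e = ⊥-elim (ne (trans (sym (isEven-double+ j n)) (trans (cong isEven (disp-≡ j s i n e)) (isEven-double+ i s))))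

  signWalks-sameParity : ∀ n n' d → signWalks n d ≢ 0 → signWalks n' d ≢ 0 → isEven n ≡ isEven n'
  signWalks-sameParity n n' d nz nz' with signWalks-support n d nz | signWalks-support n' d nz'
  ... | i , _ , e | i' , _ , e' = trans (sym (isEven-double+ i' n)) (trans (cong isEven (sym (disp-≡ i n i' n' (trans (sym e) e')))) (isEven-double+ i n'))

  signWalks-binomial : ∀ n i → signWalks n (disp n i) ≡ n C i
  signWalks-binomial zero zero = refl
  signWalks-binomial zero (suc i) = refl
  signWalks-binomial (suc n) zero =
    trans (cong₂ ℕ._+_ z (trans (cong (signWalks n) (trans (cong (_+ℤ 1ℤ) (disp-suc n 0)) (DispAlgebra.pred-suc (+ 0) (+ n)))) (signWalks-binomial n 0))) (trans (nC0 n) (sym (nC0 (suc n))))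
    where
    z : signWalks n (disp (suc n) 0 -ℤ 1ℤ) ≡ 0
    z with signWalks n (disp (suc n) 0 -ℤ 1ℤ) ℕ.≟ 0
    ... | yes e = e
    ... | no nz with signWalks-support n _ nz
    ... | i , _ , e with disp-≡ i n 0 (suc (suc n)) (trans (sym e) (trans (cong (_-ℤ 1ℤ) (disp-suc n 0)) (trans (DispAlgebra.zero-pred (+ n)) (sym (trans (disp-suc (suc n) 0) (cong (λ t → (0ℤ +ℤ 0ℤ) -ℤ (1ℤ +ℤ t)) (+suc n)))))))
    ... | e2 = ⊥-elim (NP.<-irrefl refl (NP.≤-trans (s≤s (NP.n≤1+n n)) (NP.≤-trans (NP.m≤n+m (suc (suc n)) (i ℕ.+ i)) (NP.≤-reflexive e2))))
    nC0 : ∀ n → n C 0 ≡ 1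
    nC0 n = refl
  signWalks-binomial (suc n) (suc i) =
    trans (cong₂ ℕ._+_ (trans (cong (signWalks n) (trans (cong (_-ℤ 1ℤ) (disp-suc-suc n i)) (DispAlgebra.suc-suc-pred (+ i) (+ n)))) (signWalks-binomial n i))
                       (trans (cong (signWalks n) (trans (cong (_+ℤ 1ℤ) (disp-suc n (suc i))) (DispAlgebra.pred-suc (+ suc i) (+ n)))) (signWalks-binomial n (suc i))))
          (nCk+nC[k+1]≡[n+1]C[k+1] n i)

  lazyWalks≡ : ∀ n d → lazyWalks (suc n) d ≡ suc n * signWalks n d
  lazyWalks≡ zero d = sym (NP.+-identityʳ (signWalks 0 d))
  lazyWalks≡ (suc n) d rewrite lazyWalks≡ n (d -ℤ 1ℤ) | lazyWalks≡ n (d +ℤ 1ℤ) =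
    trans (cong (ℕ._+ signWalks (suc n) d) (sym (NP.*-distribˡ-+ (suc n) (signWalks n (d -ℤ 1ℤ)) (signWalks n (d +ℤ 1ℤ)))))
          (NP.+-comm (suc n * signWalks (suc n) d) (signWalks (suc n) d))

module FFormula where

  open import Defs
  open Counting using (sumOver)
  open WalkCounting using (signWalks; lazyWalks)
  open SignWalkFormula
  open import Data.Nat as ℕ using (ℕ; zero; suc; _≤_; _*_; _∸_; ⌊_/2⌋)
  open import Data.Nat.Properties as NP using (+-suc)
  open import Data.Nat.Properties using (≤-decTotalOrder)
  open import Data.Nat.ListAction using (sum; product)
  open import Data.Nat.ListAction.Properties using (product-↭)
  open import Data.Nat.Combinatorics using (_C_)
  open import Data.Integer using (+_) renaming (_+_ to _+ℤ_; _-_ to _-ℤ_)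
  import Data.Integer.Properties as ZP
  open import Data.Integer.Solver using (module +-*-Solver)
  open import Data.List using ([]; _∷_; map; upTo)
  open import Data.List.Properties using (map-cong)
  open import Data.List.Relation.Unary.All as All using (All; []; _∷_)
  open import Data.List.Relation.Unary.Linked using (Linked; []; [-]; _∷_)
  open import Data.List.Relation.Unary.Linked.Properties using (Linked⇒All)
  open import Data.List.Relation.Binary.Permutation.Propositional using (_↭_; ↭-sym)
  open import Data.List.Relation.Binary.Permutation.Propositional.Properties using (All-resp-↭)
  import Data.List.Relation.Binary.Permutation.Propositional.Properties as PermP
  open import Data.List.Sort.InsertionSort.Properties ≤-decTotalOrder using (sort-↭; sort-↗)
  open import Data.Bool using (true; false; not)
  open import Data.Bool.Properties using (not-involutive)
  open import Data.Product using (_×_; _,_; ∃)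
  open import Data.Empty using (⊥-elim)
  open import Relation.Binary.PropositionalEquality

  import Data.List.Sort.InsertionSort as SortM
  open SortM ≤-decTotalOrder using (sort)

  F-sort : ∀ x s rest → sort x ≡ s ∷ rest → F x ≡ F′ s rest
  F-sort x s rest e with sort x
  F-sort x s rest refl | .(s ∷ rest) = refl

  isEven⇒double : ∀ k s → isEven (k ℕ.+ s) ≡ isEven s → ∃ λ t → k ≡ t ℕ.+ t
  isEven⇒double zero s _ = 0 , refl
  isEven⇒double (suc zero) s e = ⊥-elim (nb (isEven s) e)
    where nb : ∀ b → not b ≢ b
          nb true ()
          nb false ()
  isEven⇒double (suc (suc k)) s e with isEven⇒double k s (trans (sym (not-involutive (isEven (k ℕ.+ s)))) e)
  ... | t , refl = suc t , cong suc (sym (+-suc t t))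

  module ShiftAlgebra where
    open +-*-Solver
    shift : ∀ J T S → (J +ℤ J) -ℤ S ≡ ((T +ℤ J) +ℤ (T +ℤ J)) -ℤ ((T +ℤ T) +ℤ S)
    shift = solve 3 (λ J T S → (J :+ J) :- S := ((T :+ J) :+ (T :+ J)) :- ((T :+ T) :+ S)) refl

  disp-shift : ∀ s t j → disp s j ≡ disp (t ℕ.+ t ℕ.+ s) (t ℕ.+ j)
  disp-shift s t j = trans (ShiftAlgebra.shift (+ j) (+ t) (+ s))
    (sym (cong₂ (λ a b → (a +ℤ a) -ℤ b) (ZP.pos-+ t j) (trans (ZP.pos-+ (t ℕ.+ t) s) (cong (_+ℤ + s) (ZP.pos-+ t t)))))

  signWalks-shift : ∀ s y j → s ≤ y → isEven y ≡ isEven s → signWalks y (disp s j) ≡ y C (⌊ (y ∸ s) /2⌋ ℕ.+ j)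
  signWalks-shift s y j le pe with isEven⇒double (y ∸ s) s (trans (cong isEven (NP.m∸n+n≡m le)) pe)
  ... | t , e = trans (cong (λ z → signWalks z (disp s j)) (sym yeq))
                 (trans (cong (signWalks (t ℕ.+ t ℕ.+ s)) (disp-shift s t j))
                 (trans (signWalks-binomial (t ℕ.+ t ℕ.+ s) (t ℕ.+ j))
                        (cong₂ _C_ yeq (cong (ℕ._+ j) (sym (trans (cong ⌊_/2⌋ e) (sym (NP.n≡⌊n+n/2⌋ t))))))))
    where yeq : t ℕ.+ t ℕ.+ s ≡ y
          yeq = trans (cong (ℕ._+ s) (sym e)) (NP.m∸n+n≡m le)

  product-cong : ∀ {A : Set} {f g : A → ℕ} {xs} → All (λ x → f x ≡ g x) xs → product (map f xs) ≡ product (map g xs)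
  product-cong [] = refl
  product-cong (e ∷ es) = cong₂ _*_ e (product-cong es)

  product-↭-map : ∀ {A : Set} (f : A → ℕ) {xs ys} → xs ↭ ys → product (map f xs) ≡ product (map f ys)
  product-↭-map f p = product-↭ (PermP.map⁺ f p)

  sort-head-min : ∀ x s rest → sort x ≡ s ∷ rest → All (s ≤_) rest
  sort-head-min x s rest e with subst (Linked _≤_) e (sort-↗ x)
  ... | [-] = []
  ... | (le ∷ lk) = Linked⇒All NP.≤-trans le lk

  sort-head-↭ : ∀ x s rest → sort x ≡ s ∷ rest → s ∷ rest ↭ x
  sort-head-↭ x s rest e = subst (_↭ x) e (sort-↭ x)

  F-walkSum : ∀ x b → All (λ y → isEven y ≡ b) x → ∀ s rest → sort x ≡ s ∷ rest →
       isEven s ≡ b × F x ≡ sumTo s (λ j → product (map (λ y → signWalks y (disp s j)) x))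
  F-walkSum x b ax s rest e = ps , trans (F-sort x s rest e) (cong sum (map-cong pt (upTo (suc s))))
    where
    all' : All (λ y → isEven y ≡ b) (s ∷ rest)
    all' = All-resp-↭ (↭-sym (sort-head-↭ x s rest e)) ax
    ps : isEven s ≡ b
    ps = All.head all'
    pt : ∀ j → (s C j) * product (map (λ xi → xi C (⌊ (xi ∸ s) /2⌋ ℕ.+ j)) rest) ≡ product (map (λ y → signWalks y (disp s j)) x)
    pt j = trans (cong₂ _*_ (sym (signWalks-binomial s j))
                   (sym (product-cong (All.zipWith (λ { (le , py) → signWalks-shift s _ j le (trans py (sym ps)) }) (sort-head-min x s rest e , All.tail all')))))
                 (product-↭-map (λ y → signWalks y (disp s j)) (sort-head-↭ x s rest e))

module ProductFormula where

  open import Defs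
  open Counting using (sumOver)
  open WalkCounting using (signWalks; lazyWalks)
  open ThetaCounting using (connectedCount; splitCount)
  open SignWalkFormula
  open FFormula
  open import Data.Nat as ℕ using (ℕ; suc; _≤_; _*_; _∸_)
  import Data.Nat.Properties as NP
  open import Data.Nat.ListAction using (sum; product)
  open import Data.Nat.Solver using (module +-*-Solver)
  open import Data.Integer using (ℤ; +_)
  open import Data.List using ([]; _∷_; map; upTo)
  open import Data.List.Relation.Unary.All using (All; []; _∷_)
  open import Data.List.Relation.Unary.Any as Any using (Any; here; there)
  open import Data.Bool using (Bool; true; false; not; if_then_else_)
  open import Data.Product using (_×_; _,_)
  open import Relation.Binary.PropositionalEquality

  pathCount : ℕ → ℤ → ℕ
  pathCount x d = signWalks (suc (x ∸ 1)) d ℕ.+ lazyWalks (suc (x ∸ 1)) d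

  pathSplitCount : ℕ → ℤ → ℕ
  pathSplitCount x d = lazyWalks (suc (x ∸ 1)) d

  module ℕSolver = +-*-Solver

  connected+split≡product : ∀ ms d → connectedCount ms d ℕ.+ splitCount ms d ≡ product (map (λ x → pathCount x d) ms)
  connected+split≡product [] d = refl
  connected+split≡product (m ∷ ms) d rewrite sym (connected+split≡product ms d) = expand (signWalks (suc (m ∸ 1)) d) (lazyWalks (suc (m ∸ 1)) d) (connectedCount ms d) (splitCount ms d)
    where
    open ℕSolver
    expand : ∀ a b c e → a * c ℕ.+ a * e ℕ.+ b * c ℕ.+ b * e ≡ (a ℕ.+ b) * (c ℕ.+ e)
    expand = solve 4 (λ a b c e → a :* c :+ a :* e :+ b :* c :+ b :* e := (a :+ b) :* (c :+ e)) refl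

  split≡product : ∀ ms d → splitCount ms d ≡ product (map (λ x → pathSplitCount x d) ms)
  split≡product [] d = refl
  split≡product (m ∷ ms) d = cong (pathSplitCount m d *_) (split≡product ms d)

  sameBool : Bool → Bool → Bool
  sameBool true true = true
  sameBool false false = true
  sameBool _ _ = false

  sameBool⇒≡ : ∀ {a b} → sameBool a b ≡ true → a ≡ b
  sameBool⇒≡ {true} {true} _ = refl
  sameBool⇒≡ {false} {false} _ = refl
  sameBool⇒≢ : ∀ {a b} → sameBool a b ≡ false → a ≢ b
  sameBool⇒≢ {true} {false} _ ()
  sameBool⇒≢ {false} {true} _ ()

  -- decParity false and decParity true are the entrywise maps defining mₑ and mₒ; parityFactor b x is
  -- x exactly when decParity b decrements x.
  decParity : Bool → ℕ → ℕ
  decParity b x = if sameBool (isEven x) b then x else x ∸ 1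
  parityFactor : Bool → ℕ → ℕ
  parityFactor b x = if sameBool (isEven x) b then 1 else x

  not-≢ : ∀ b → not b ≢ b
  not-≢ true ()
  not-≢ false ()

  pathCount-factor : ∀ b s j x → 1 ≤ x → isEven s ≡ b → pathCount x (disp s j) ≡ parityFactor b x * signWalks (decParity b x) (disp s j)
  pathCount-factor b s j (suc y) _ ps rewrite lazyWalks≡ y (disp s j) with sameBool (not (isEven y)) b in eq
  ... | true rewrite signWalks-parity y s j (λ e → not-≢ (isEven y) (trans (sameBool⇒≡ eq) (trans (sym ps) (sym e)))) =
    trans (cong (signWalks (suc y) (disp s j) ℕ.+_) (NP.*-zeroʳ y)) (trans (NP.+-identityʳ _) (sym (NP.+-identityʳ _)))
  ... | false rewrite signWalks-parity (suc y) s j (λ e → sameBool⇒≢ eq (trans e ps)) = refl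

  product-pathCount-split : ∀ b s j m → All (1 ≤_) m → isEven s ≡ b →
    product (map (λ x → pathCount x (disp s j)) m) ≡ product (map (parityFactor b) m) * product (map (λ y → signWalks y (disp s j)) (map (decParity b) m))
  product-pathCount-split b s j [] _ _ = refl
  product-pathCount-split b s j (x ∷ m) (p ∷ ps) e rewrite pathCount-factor b s j x p e | product-pathCount-split b s j m ps e =
    interchange (parityFactor b x) (signWalks (decParity b x) (disp s j)) (product (map (parityFactor b) m)) (product (map (λ y → signWalks y (disp s j)) (map (decParity b) m)))
    where
    open ℕSolver
    interchange : ∀ a c e g → a * c * (e * g) ≡ a * e * (c * g)
    interchange = solve 4 (λ a c e g → a :* c :* (e :* g) := a :* e :* (c :* g)) refl

  pathSplitCount-vanish : ∀ b s j x → 1 ≤ x → isEven x ≡ b → isEven s ≡ b → pathSplitCount x (disp s j) ≡ 0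
  pathSplitCount-vanish b s j (suc y) _ px ps rewrite lazyWalks≡ y (disp s j) | signWalks-parity y s j (λ e → not-≢ (isEven y) (trans px (trans (sym ps) (sym e)))) = NP.*-zeroʳ y

  product-zero : ∀ {A : Set} (f : A → ℕ) {xs} → Any (λ x → f x ≡ 0) xs → product (map f xs) ≡ 0
  product-zero f (here e) rewrite e = refl
  product-zero f {x ∷ xs} (there a) rewrite product-zero f a = NP.*-zeroʳ (f x)

  connectedCount-disp : ∀ b s j m → All (1 ≤_) m → isEven s ≡ b → Any (λ x → 1 ≤ x × isEven x ≡ b) m →
    connectedCount m (disp s j) ≡ product (map (parityFactor b) m) * product (map (λ y → signWalks y (disp s j)) (map (decParity b) m))
  connectedCount-disp b s j m a1 ps an =
    trans (sym (trans (cong (connectedCount m (disp s j) ℕ.+_) (trans (split≡product m (disp s j)) (product-zero (λ x → pathSplitCount x (disp s j)) (Any.map (λ { (p , px) → pathSplitCount-vanish b s j _ p px ps }) an))))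
                      (NP.+-identityʳ _)))
          (trans (connected+split≡product m (disp s j)) (product-pathCount-split b s j m a1 ps))

  sumL-map : ∀ {A B : Set} (c : B → ℕ) (h : A → B) xs → sumOver c (map h xs) ≡ sum (map (λ a → c (h a)) xs)
  sumL-map c h [] = refl
  sumL-map c h (x ∷ xs) = cong (c (h x) ℕ.+_) (sumL-map c h xs)

  sum-* : ∀ {A : Set} K (g : A → ℕ) xs → sum (map (λ a → K * g a) xs) ≡ K * sum (map g xs)
  sum-* K g [] = sym (NP.*-zeroʳ K)
  sum-* K g (x ∷ xs) rewrite sum-* K g xs = sym (NP.*-distribˡ-+ K (g x) (sum (map g xs)))

  sum-cong : ∀ {A : Set} {f g : A → ℕ} xs → (∀ a → f a ≡ g a) → sum (map f xs) ≡ sum (map g xs)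
  sum-cong [] h = refl
  sum-cong (x ∷ xs) h = cong₂ ℕ._+_ (h x) (sum-cong xs h)

  sum-connectedCount-range : ∀ b s m → All (1 ≤_) m → isEven s ≡ b → Any (λ x → 1 ≤ x × isEven x ≡ b) m →
    sumOver (connectedCount m) (map (disp s) (upTo (suc s))) ≡
    product (map (parityFactor b) m) * sumTo s (λ j → product (map (λ y → signWalks y (disp s j)) (map (decParity b) m)))
  sum-connectedCount-range b s m a1 ps an =
    trans (sumL-map (connectedCount m) (disp s) (upTo (suc s)))
    (trans (sum-cong (upTo (suc s)) (λ j → connectedCount-disp b s j m a1 ps an))
           (sum-* (product (map (parityFactor b) m)) (λ j → product (map (λ y → signWalks y (disp s j)) (map (decParity b) m))) (upTo (suc s))))

module ParityBookkeeping where

  open import Defs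
  open Counting
  open WalkCounting using (signWalks; lazyWalks)
  open ThetaCounting using (connectedCount; splitCount; count-CB)
  open WedgeCounting using (wedgeN; count-wedge)
  open SignWalkFormula
  open FFormula
  open ProductFormula
  open import Data.Nat as ℕ using (ℕ; suc; _≤_; _*_; _∸_)
  open import Data.Nat.Properties as NP using (≤-decTotalOrder)
  open import Data.Nat.ListAction using (product)
  open import Data.Nat.ListAction.Properties using (product-++)
  open import Data.Nat.Divisibility using (_∣?_)
  open import Data.Integer using (ℤ; +_)
  open import Data.List using (List; []; _∷_; _++_; map; upTo; length)
  open import Data.List.Properties using (map-cong; map-++)
  open import Data.List.Relation.Unary.All as All using (All; []; _∷_)
  open import Data.List.Membership.Propositional using (_∈_)
  open import Data.List.Membership.Propositional.Properties using (∈-map⁻)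
  open import Data.List.Relation.Unary.Unique.Propositional using (Unique)
  import Data.List.Relation.Unary.Unique.Propositional.Properties as UP
  open import Data.List.Relation.Binary.Permutation.Propositional using (_↭_)
  open import Data.List.Relation.Binary.Permutation.Propositional.Properties using (↭-length)
  open import Data.List.Sort.InsertionSort.Properties ≤-decTotalOrder using (sort-↭)
  open import Data.Bool using (true; false; not; if_then_else_)
  open import Data.Product using (_,_; ∃)
  open import Data.Empty using (⊥)
  open import Relation.Nullary using (does)
  open import Relation.Binary.PropositionalEquality

  import Data.List.Sort.InsertionSort as SortM
  open SortM ≤-decTotalOrder using (sort)

  decEven≡decParity : ∀ m → decEven m ≡ map (decParity false) m
  decEven≡decParity m = map-cong h m
    where h : ∀ x → (if does (2 ∣? x) then x ∸ 1 else x) ≡ decParity false x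
          h x rewrite does-2∣?≡isEven x with isEven x
          ... | true = refl
          ... | false = refl

  decOdd≡decParity : ∀ m → decOdd m ≡ map (decParity true) m
  decOdd≡decParity m = map-cong h m
    where h : ∀ x → (if does (2 ∣? x) then x else x ∸ 1) ≡ decParity true x
          h x rewrite does-2∣?≡isEven x with isEven x
          ... | true = refl
          ... | false = refl

  isEven-decParity : ∀ b x → 1 ≤ x → isEven (decParity b x) ≡ b
  isEven-decParity b (suc y) _ with sameBool (not (isEven y)) b in eq
  ... | true = sameBool⇒≡ eq
  ... | false = h (isEven y) b eq
    where h : ∀ a b → sameBool (not a) b ≡ false → a ≡ b
          h true true _ = refl
          h false false _ = refl

  all-isEven-decParity : ∀ b m → All (1 ≤_) m → All (λ y → isEven y ≡ b) (map (decParity b) m)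
  all-isEven-decParity b [] [] = []
  all-isEven-decParity b (x ∷ m) (p ∷ ps) = isEven-decParity b x p ∷ all-isEven-decParity b m ps

  sumOver-++ : ∀ {I : Set} (c : I → ℕ) xs ys → sumOver c (xs ++ ys) ≡ sumOver c xs ℕ.+ sumOver c ys
  sumOver-++ c [] ys = refl
  sumOver-++ c (x ∷ xs) ys rewrite sumOver-++ c xs ys = sym (NP.+-assoc (c x) (sumOver c xs) (sumOver c ys))

  product-ones : ∀ {A : Set} (f : A → ℕ) {xs} → All (λ x → f x ≡ 1) xs → product (map f xs) ≡ 1
  product-ones f [] = refl
  product-ones f (e ∷ es) rewrite e | product-ones f es = refl

  product-id : ∀ {xs : List ℕ} (g : ℕ → ℕ) → All (λ x → g x ≡ x) xs → product (map g xs) ≡ product xs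
  product-id g [] = refl
  product-id g (e ∷ es) rewrite e | product-id g es = refl

  product-parityFactor-even : ∀ m es os → m ↭ es ++ os → All Even es → All Odd os → product (map (parityFactor false) m) ≡ product es
  product-parityFactor-even m es os perm ev od =
    trans (product-↭-map (parityFactor false) perm)
    (trans (cong product (map-++ (parityFactor false) es os))
    (trans (product-++ (map (parityFactor false) es) (map (parityFactor false) os))
    (trans (cong₂ _*_ (product-id (parityFactor false) (All.map h1 ev)) (product-ones (parityFactor false) (All.map h2 od)))
           (NP.*-identityʳ _))))
    where h1 : ∀ {x} → Even x → parityFactor false x ≡ x
          h1 {x} e rewrite even⇒isEven _ e = refl
          h2 : ∀ {x} → Odd x → parityFactor false x ≡ 1
          h2 {x} o rewrite odd⇒¬isEven o = refl

  product-parityFactor-odd : ∀ m es os → m ↭ es ++ os → All Even es → All Odd os → product (map (parityFactor true) m) ≡ product os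
  product-parityFactor-odd m es os perm ev od =
    trans (product-↭-map (parityFactor true) perm)
    (trans (cong product (map-++ (parityFactor true) es os))
    (trans (product-++ (map (parityFactor true) es) (map (parityFactor true) os))
    (trans (cong₂ _*_ (product-ones (parityFactor true) (All.map h1 ev)) (product-id (parityFactor true) (All.map h2 od)))
           (NP.*-identityˡ _))))
    where h1 : ∀ {x} → Even x → parityFactor true x ≡ 1
          h1 {x} e rewrite even⇒isEven _ e = refl
          h2 : ∀ {x} → Odd x → parityFactor true x ≡ x
          h2 {x} o rewrite odd⇒¬isEven o = refl

  sort-nonEmpty : ∀ (x : List ℕ) → 1 ≤ length x → ∃ λ s → ∃ λ rest → sort x ≡ s ∷ rest
  sort-nonEmpty x le with sort x in eq
  ... | s ∷ rest = s , rest , refl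
  ... | [] with trans (sym (↭-length (sort-↭ x))) (cong length eq)
  ... | e rewrite e with le
  ... | ()

  double-injective : ∀ i i' → i ℕ.+ i ≡ i' ℕ.+ i' → i ≡ i'
  double-injective i i' e = trans (NP.n≡⌊n+n/2⌋ i) (trans (cong ℕ.⌊_/2⌋ e) (sym (NP.n≡⌊n+n/2⌋ i')))

  disp-injective : ∀ s {i i'} → disp s i ≡ disp s i' → i ≡ i'
  disp-injective s {i} {i'} e = double-injective i i' (NP.+-cancelʳ-≡ s (i ℕ.+ i) (i' ℕ.+ i') (disp-≡ i s i' s e))

  dispRange : ℕ → List ℤ
  dispRange s = map (disp s) (upTo (suc s))

  dispRange-unique : ∀ s → Unique (dispRange s)
  dispRange-unique s = UP.map⁺ (disp-injective s) (UP.upTo⁺ (suc s))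

  dispRange-disjoint : ∀ s s' → isEven s ≢ isEven s' → ∀ {d} → d ∈ dispRange s → d ∈ dispRange s' → ⊥
  dispRange-disjoint s s' ne {d} m m' with ∈-map⁻ (disp s) {xs = upTo (suc s)} m | ∈-map⁻ (disp s') {xs = upTo (suc s')} m'
  ... | i , _ , e1 | i' , _ , e2 = ne (trans (sym (isEven-double+ i' s)) (trans (cong isEven (sym (disp-≡ i s i' s' (trans (sym e1) e2)))) (isEven-double+ i s')))

  product≢0 : ∀ {A : Set} (f : A → ℕ) xs → product (map f xs) ≢ 0 → All (λ x → f x ≢ 0) xs
  product≢0 f [] _ = []
  product≢0 f (x ∷ xs) nz = (λ z → nz (trans (cong (_* product (map f xs)) z) refl)) ∷
                         product≢0 f xs (λ z → nz (trans (cong (f x *_) z) (NP.*-zeroʳ (f x))))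

module Support where

  open import Defs
  open Counting
  open WalkCounting using (signWalks; lazyWalks)
  open ThetaCounting using (connectedCount; splitCount; count-CB)
  open WedgeCounting using (wedgeN; count-wedge)
  open SignWalkFormula
  open FFormula
  open ProductFormula
  open ParityBookkeeping
  open import Data.Nat as ℕ using (ℕ; suc; _≤_; s≤s; _*_; _∸_)
  open import Data.Nat.Properties as NP using (≤-decTotalOrder)
  open import Data.Integer using (+_)
  open import Data.List using ([]; _∷_; _++_; map; length)
  open import Data.List.Relation.Unary.All as All using (All; []; _∷_)
  open import Data.List.Relation.Unary.Any using (here)
  open import Data.List.Membership.Propositional using (_∈_)
  open import Data.List.Membership.Propositional.Properties using (∈-map⁻; ∈-map⁺; ∈-++⁺ʳ; ∈-++⁺ˡ; ∈-upTo⁺)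
  open import Data.List.Relation.Binary.Permutation.Propositional.Properties using (∈-resp-↭)
  open import Data.Bool using (true; false; not)
  open import Data.Product using (_×_; _,_; ∃; proj₁; proj₂)
  open import Data.Sum using (_⊎_; inj₁; inj₂)
  open import Data.Empty using (⊥-elim)
  open import Relation.Binary.PropositionalEquality
  open import Relation.Nullary using (yes; no)

  import Data.List.Sort.InsertionSort as SortM
  open SortM ≤-decTotalOrder using (sort)

  pathCount≢0 : ∀ y d → pathCount (suc y) d ≢ 0 → signWalks (suc y) d ≢ 0 ⊎ signWalks y d ≢ 0
  pathCount≢0 y d nz with signWalks (suc y) d ℕ.≟ 0 | signWalks y d ℕ.≟ 0
  ... | no a | _ = inj₁ a
  ... | yes _ | no b = inj₂ b
  ... | yes a | yes b = ⊥-elim (nz (trans (cong₂ ℕ._+_ a (trans (lazyWalks≡ y d) (trans (cong (suc y *_) b) (NP.*-zeroʳ y)))) refl))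

  sameBool-refl : ∀ b → sameBool b b ≡ true
  sameBool-refl true = refl
  sameBool-refl false = refl

  sameBool-not : ∀ b → sameBool (not b) b ≡ false
  sameBool-not true = refl
  sameBool-not false = refl

  decParity-support : ∀ n0 d → signWalks n0 d ≢ 0 → ∀ x → 1 ≤ x → pathCount x d ≢ 0 → signWalks (decParity (isEven n0) x) d ≢ 0
  decParity-support n0 d nz0 (suc y) _ nzq with pathCount≢0 y d nzq
  ... | inj₁ nz rewrite sym (signWalks-sameParity (suc y) n0 d nz nz0) | sameBool-refl (isEven (suc y)) = nz
  ... | inj₂ nz rewrite sym (signWalks-sameParity y n0 d nz nz0) | sameBool-not (isEven y) = nz

  signWalks-support-range : ∀ s d → signWalks s d ≢ 0 → d ∈ dispRange s
  signWalks-support-range s d nz with signWalks-support s d nz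
  ... | i , i≤s , e = subst (_∈ dispRange s) (sym e) (∈-map⁺ (disp s) (∈-upTo⁺ (s≤s i≤s)))

  sort-head-∈ : ∀ b m s rest → sort (map (decParity b) m) ≡ s ∷ rest → ∃ λ x → x ∈ m × s ≡ decParity b x
  sort-head-∈ b m s rest e with ∈-map⁻ (decParity b) (∈-resp-↭ (sort-head-↭ (map (decParity b) m) s rest e) (here refl))
  ... | x , x∈ , eq = x , x∈ , eq

  -- A nonzero count at d needs every path to admit a walk ending at d; the parity of any one of them
  -- decides which of the two ranges contains d.
  connectedCount-support : ∀ m → All (1 ≤_) m → 1 ≤ length m → ∀ sF restF sT restT →
    sort (map (decParity false) m) ≡ sF ∷ restF → sort (map (decParity true) m) ≡ sT ∷ restT →
    ∀ d → connectedCount m d ≢ 0 → d ∈ dispRange sF ++ dispRange sT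
  connectedCount-support [] _ ()
  connectedCount-support m@(x0 ∷ _) a1 _ sF restF sT restT eF eT d nzC = inRange (isEven n0) refl
    where
    pathCounts≢0 : All (λ x → pathCount x d ≢ 0) m
    pathCounts≢0 = product≢0 (λ x → pathCount x d) m (λ z → nzC (NP.m+n≡0⇒m≡0 (connectedCount m d) (trans (connected+split≡product m d) z)))
    y0 : ℕ
    y0 = x0 ∸ 1
    x0≡suc : x0 ≡ suc y0
    x0≡suc = ≥1⇒suc x0 (All.head a1)
      where ≥1⇒suc : ∀ x → 1 ≤ x → x ≡ suc (x ∸ 1)
            ≥1⇒suc (suc _) _ = refl
    someWalk : ∃ λ n0 → signWalks n0 d ≢ 0
    someWalk with pathCount≢0 y0 d (subst (λ t → pathCount t d ≢ 0) x0≡suc (All.head pathCounts≢0))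
    ... | inj₁ a = suc y0 , a
    ... | inj₂ a = y0 , a
    n0 = proj₁ someWalk
    decParity-walk : ∀ x → x ∈ m → signWalks (decParity (isEven n0) x) d ≢ 0
    decParity-walk x x∈ = decParity-support n0 d (proj₂ someWalk) x (All.lookup a1 x∈) (All.lookup pathCounts≢0 x∈)
    inRange : ∀ b → isEven n0 ≡ b → d ∈ dispRange sF ++ dispRange sT
    inRange false e with sort-head-∈ false m sF restF eF
    ... | x , x∈ , se = ∈-++⁺ˡ (signWalks-support-range sF d (subst (λ t → signWalks t d ≢ 0) (sym se) (subst (λ b → signWalks (decParity b x) d ≢ 0) e (decParity-walk x x∈))))
    inRange true e with sort-head-∈ true m sT restT eT
    ... | x , x∈ , se = ∈-++⁺ʳ (dispRange sF) (signWalks-support-range sT d (subst (λ t → signWalks t d ≢ 0) (sym se) (subst (λ b → signWalks (decParity b x) d ≢ 0) e (decParity-walk x x∈))))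

module CBEvaluation where

  open import Defs
  open Counting
  open WalkCounting using (signWalks; lazyWalks)
  open ThetaCounting using (connectedCount; splitCount; count-CB)
  open WedgeCounting using (wedgeN; count-wedge)
  open SignWalkFormula
  open FFormula
  open ProductFormula
  open ParityBookkeeping
  open Support
  open import Data.Nat using (ℕ; suc; _+_; _*_; _∸_; _≤_; _<_; s≤s)
  open import Data.Nat.Properties as NP using (≤-decTotalOrder)
  open import Data.Nat.ListAction using (product)
  open import Data.Nat.ListAction.Properties using (product-++)
  open import Data.Integer using (0ℤ)
  open import Data.List using (List; []; _∷_; _++_; map; length; take; drop)
  open import Data.List.Properties using (map-++; map-cong-local; take++drop≡id; length-drop; length-map; length-++; ++-assoc; map-∘; map-id)
  open import Function using (_∘_)
  open import Data.List.Relation.Unary.All as All using (All; []; _∷_)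
  import Data.List.Relation.Unary.All.Properties as AllP
  open import Data.List.Relation.Unary.Any using (Any; here; there)
  open import Data.List.Relation.Unary.Linked using (Linked)
  open import Data.List.Membership.Propositional using (_∈_; lose)
  open import Data.List.Membership.Propositional.Properties using (∈-map⁺; ∈-++⁺ʳ; ∈-++⁺ˡ)
  import Data.List.Relation.Unary.Unique.Propositional.Properties as UP
  import Data.List.Properties
  open import Data.List.Relation.Binary.Permutation.Propositional using (_↭_; ↭-sym)
  open import Data.List.Relation.Binary.Permutation.Propositional.Properties using (∈-resp-↭; ↭-length)
  import Data.List.Relation.Binary.Permutation.Propositional.Properties as PermP
  open import Data.Bool using (true; false; not)
  open import Data.Bool.Properties using (not-injective)
  open import Data.Product using (_×_; _,_; ∃; proj₁; proj₂)
  open import Relation.Binary.PropositionalEquality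

  import Data.List.Sort.InsertionSort as SortM
  open SortM ≤-decTotalOrder using (sort)

  nonEmpty-∈ : ∀ {A : Set} (xs : List A) → 1 ≤ length xs → ∃ λ x → x ∈ xs
  nonEmpty-∈ (x ∷ xs) _ = x , here refl

  wedgeN≡product : ∀ cs → wedgeN cs ≡ product (map (λ c → pathCount c 0ℤ) cs)
  wedgeN≡product [] = refl
  wedgeN≡product (c ∷ cs) = cong (pathCount c 0ℤ *_) (wedgeN≡product cs)

  pathCount-even-0 : ∀ c → 1 ≤ c → isEven c ≡ true → pathCount c 0ℤ ≡ signWalks c 0ℤ
  pathCount-even-0 (suc y) _ even rewrite lazyWalks≡ y 0ℤ
                                        | signWalks-parity y 0 0 (λ e → not-≢ (isEven y) (trans even (sym e))) =
    trans (cong (signWalks (suc y) 0ℤ +_) (NP.*-zeroʳ y)) (NP.+-identityʳ _)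

  wedgeN-even : ∀ cs → All (λ c → 1 ≤ c × isEven c ≡ true) cs →
                wedgeN cs ≡ product (map (λ c → signWalks c 0ℤ) cs)
  wedgeN-even cs evens =
    trans (wedgeN≡product cs) (product-cong (All.map (λ (c≥1 , even) → pathCount-even-0 _ c≥1 even) evens))

  sort-head-zero : ∀ xs s rest → sort xs ≡ s ∷ rest → 0 ∈ xs → s ≡ 0
  sort-head-zero xs s rest e 0∈ with ∈-resp-↭ (↭-sym (sort-head-↭ xs s rest e)) 0∈
  ... | here s≡0 = sym s≡0
  ... | there 0∈rest = NP.n≤0⇒n≡0 (All.lookup (sort-head-min xs s rest e) 0∈rest)

  product-signWalks₀-decOdd : ∀ es os p → All Even es → All Odd (take p os) → All (_≡ 1) (drop p os) →
    let P = λ xs → product (map (λ y → signWalks y 0ℤ) xs) in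
    P (map (decParity true) (es ++ os)) ≡ P (es ++ map (_∸ 1) (take p os))
  product-signWalks₀-decOdd es os p ev od ones = begin
    P (map dT (es ++ os))
      ≡⟨ cong (λ t → P (map dT (es ++ t))) (sym (take++drop≡id p os)) ⟩
    P (map dT (es ++ take p os ++ drop p os))
      ≡⟨ cong (P ∘ map dT) (sym (++-assoc es (take p os) (drop p os))) ⟩
    P (map dT ((es ++ take p os) ++ drop p os))
      ≡⟨ cong P (map-++ dT (es ++ take p os) (drop p os)) ⟩
    P (map dT (es ++ take p os) ++ map dT (drop p os))
      ≡⟨ P-++ (map dT (es ++ take p os)) (map dT (drop p os)) ⟩
    P (map dT (es ++ take p os)) * P (map dT (drop p os))
      ≡⟨ cong₂ _*_ (cong P decOdd-front) dropOnes ⟩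
    P (es ++ map (_∸ 1) (take p os)) * 1
      ≡⟨ NP.*-identityʳ _ ⟩
    P (es ++ map (_∸ 1) (take p os)) ∎
    where
    open ≡-Reasoning
    dT = decParity true
    P : List ℕ → ℕ
    P xs = product (map (λ y → signWalks y 0ℤ) xs)
    P-++ : ∀ xs ys → P (xs ++ ys) ≡ P xs * P ys
    P-++ xs ys = trans (cong product (map-++ _ xs ys)) (product-++ (map _ xs) (map _ ys))
    decOdd-front : map dT (es ++ take p os) ≡ es ++ map (_∸ 1) (take p os)
    decOdd-front = trans (map-++ dT es (take p os))
      (cong₂ _++_ (trans (map-cong-local {f = dT} {g = λ e → e} (All.map (λ {e} e-even → decParity-even {e} (even⇒isEven _ e-even)) ev)) (map-id es))
                  (map-cong-local {f = dT} {g = _∸ 1} (All.map (λ {o} o-odd → decParity-odd {o} (odd⇒¬isEven o-odd)) od)))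
      where
      decParity-even : ∀ {e} → isEven e ≡ true → dT e ≡ e
      decParity-even e-even rewrite e-even = refl
      decParity-odd : ∀ {o} → isEven o ≡ false → dT o ≡ o ∸ 1
      decParity-odd o-odd rewrite o-odd = refl
    dropOnes : P (map dT (drop p os)) ≡ 1
    dropOnes = trans (cong product (sym (map-∘ (drop p os))))
                     (product-ones (λ y → signWalks (dT y) 0ℤ) (All.map (λ { refl → refl }) ones))

  module ParityDecomposition
    (m es os : List ℕ) (perm : m ↭ es ++ os) (positive : All (1 ≤_) m)
    (ev : All Even es) (lenE : 1 ≤ length es) (od : All Odd os) (lenO : 1 ≤ length os) where

    private
      inM : ∀ {x} → x ∈ es ++ os → x ∈ m
      inM x∈ = ∈-resp-↭ (↭-sym perm) x∈

      lenM : 1 ≤ length m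
      lenM = subst (1 ≤_) (sym (trans (↭-length perm) (length-++ es)))
                   (NP.≤-trans lenE (NP.m≤m+n (length es) (length os)))

      lenDec : ∀ b → 1 ≤ length (map (decParity b) m)
      lenDec b = subst (1 ≤_) (sym (length-map (decParity b) m)) lenM

      anyOfParity : ∀ b → Any (λ x → 1 ≤ x × isEven x ≡ b) m
      anyOfParity false = let (o , o∈) = nonEmpty-∈ os lenO in
        lose (inM (∈-++⁺ʳ es o∈)) (All.lookup positive (inM (∈-++⁺ʳ es o∈)) , odd⇒¬isEven (All.lookup od o∈))
      anyOfParity true = let (e , e∈) = nonEmpty-∈ es lenE in
        lose (inM (∈-++⁺ˡ e∈)) (All.lookup positive (inM (∈-++⁺ˡ e∈)) , even⇒isEven _ (All.lookup ev e∈))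

    -- sₑ and sₒ are the minima x_s in the definitions of F(m_e) and F(m_o).
    sₑ sₒ : ℕ
    sₑ = proj₁ (sort-nonEmpty (map (decParity false) m) (lenDec false))
    sₒ = proj₁ (sort-nonEmpty (map (decParity true) m) (lenDec true))

    private
      sortₑ = proj₂ (proj₂ (sort-nonEmpty (map (decParity false) m) (lenDec false)))
      sortₒ = proj₂ (proj₂ (sort-nonEmpty (map (decParity true) m) (lenDec true)))
      walkSumₑ = F-walkSum (map (decParity false) m) false (all-isEven-decParity false m positive) sₑ _ sortₑ
      walkSumₒ = F-walkSum (map (decParity true) m) true (all-isEven-decParity true m positive) sₒ _ sortₒ

      part≡ : ∀ b s → isEven s ≡ b →
              sumOver (connectedCount m) (dispRange s) ≡
              product (map (parityFactor b) m) * sumTo s (λ j → product (map (λ y → signWalks y (disp s j)) (map (decParity b) m)))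
      part≡ b s s-parity = sum-connectedCount-range b s m positive s-parity (anyOfParity b)

    evenPart oddPart : ℕ
    evenPart = sumOver (connectedCount m) (dispRange sₑ)
    oddPart = sumOver (connectedCount m) (dispRange sₒ)

    count-CB-parts : N≡ (CB m) (evenPart + oddPart)
    count-CB-parts = count-≡ (sumOver-++ (connectedCount m) (dispRange sₑ) (dispRange sₒ))
      (count-CB m (dispRange sₑ ++ dispRange sₒ) unique
         (connectedCount-support m positive lenM sₑ _ sₒ _ sortₑ sortₒ))
      where
      parities : isEven sₑ ≢ isEven sₒ
      parities e with trans (sym (proj₁ walkSumₑ)) (trans e (proj₁ walkSumₒ))
      ... | ()
      unique = UP.++⁺ (dispRange-unique sₑ) (dispRange-unique sₒ) (λ (a , b) → dispRange-disjoint sₑ sₒ parities a b)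

    evenPart≡ : evenPart ≡ product es * F (decEven m)
    evenPart≡ = trans (part≡ false sₑ (proj₁ walkSumₑ))
      (cong₂ _*_ (product-parityFactor-even m es os perm ev od)
                 (trans (sym (proj₂ walkSumₑ)) (cong F (sym (decEven≡decParity m)))))

    oddPart≡F : oddPart ≡ product os * F (decOdd m)
    oddPart≡F = trans (part≡ true sₒ (proj₁ walkSumₒ))
      (cong₂ _*_ (product-parityFactor-odd m es os perm ev od)
                 (trans (sym (proj₂ walkSumₒ)) (cong F (sym (decOdd≡decParity m)))))

    -- When o_ℓ = 1, m_o contains 0, so x_s = 0 and F(m_o) collapses to a single product of central binomials.
    oddPart≡wedge : ∀ p → p < length os → All (λ x → 1 < x) (take p os) → All (λ x → x ≡ 1) (drop p os) →
                    oddPart ≡ product os * wedgeN (es ++ map (λ o → o ∸ 1) (take p os))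
    oddPart≡wedge p p<l big ones = trans (part≡ true sₒ (proj₁ walkSumₒ))
      (cong₂ _*_ (product-parityFactor-odd m es os perm ev od) (begin
        sumTo sₒ (λ j → product (map (λ y → signWalks y (disp sₒ j)) (map (decParity true) m)))
          ≡⟨ cong (λ s → sumTo s (λ j → product (map (λ y → signWalks y (disp s j)) (map (decParity true) m)))) sₒ≡0 ⟩
        product (map (λ y → signWalks y 0ℤ) (map (decParity true) m)) + 0
          ≡⟨ NP.+-identityʳ _ ⟩
        product (map (λ y → signWalks y 0ℤ) (map (decParity true) m))
          ≡⟨ product-↭-map (λ y → signWalks y 0ℤ) (PermP.map⁺ (decParity true) perm) ⟩
        product (map (λ y → signWalks y 0ℤ) (map (decParity true) (es ++ os)))
          ≡⟨ product-signWalks₀-decOdd es os p ev oddTake ones ⟩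
        product (map (λ c → signWalks c 0ℤ) wl)
          ≡⟨ sym (wedgeN-even wl evenCycles) ⟩
        wedgeN wl ∎))
      where
      open ≡-Reasoning
      wl = es ++ map (λ o → o ∸ 1) (take p os)
      oddTake : All Odd (take p os)
      oddTake = AllP.take⁺ p od
      sₒ≡0 : sₒ ≡ 0
      sₒ≡0 = sort-head-zero (map (decParity true) m) sₒ _ sortₒ
        (let (o , o∈) = nonEmpty-∈ (drop p os) (subst (1 ≤_) (sym (length-drop p os)) (NP.m<n⇒0<n∸m p<l))
             o∈os = subst (o ∈_) (take++drop≡id p os) (∈-++⁺ʳ (take p os) o∈)
         in subst (_∈ map (decParity true) m) (cong (decParity true) (All.lookup ones o∈))
                  (∈-map⁺ (decParity true) (inM (∈-++⁺ʳ es o∈os))))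
      evenCycles : All (λ c → 1 ≤ c × isEven c ≡ true) wl
      evenCycles = AllP.++⁺
        (All.tabulate (λ e∈ → All.lookup positive (inM (∈-++⁺ˡ e∈)) , even⇒isEven _ (All.lookup ev e∈)))
        (AllP.map⁺ (All.zipWith (λ { {suc y} (s≤s y≥1 , o) → y≥1 , not-injective (odd⇒¬isEven o) }) (big , oddTake)))


open import Defs
open import Data.Nat using (ℕ; _+_; _*_; _∸_; _≤_; _<_; _≥_)
open import Data.List using (List; _++_; map; length; take; drop)
open import Data.Nat.ListAction using (product)
open import Data.List.Relation.Unary.All using (All)
open import Data.List.Relation.Binary.Permutation.Propositional using (_↭_)
open import Data.List.Relation.Unary.Linked using (Linked)
open import Data.Product using (_×_; ∃; _,_)
open import Relation.Binary.PropositionalEquality using (_≡_; cong₂)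
open Counting using (count-≡)
open WedgeCounting using (wedgeN; count-wedge)

proposition4p7 :
    (m es os : List ℕ) →
    m ↭ es ++ os →
    All (λ x → 1 ≤ x) m →
    All Even es → Linked _≥_ es → 1 ≤ length es →
    All Odd os → Linked _≥_ os → 1 ≤ length os →
    (All (λ x → 2 ≤ x) m →
       N≡ (CB m) (product es * F (decEven m) + product os * F (decOdd m)))
    ×
    ((p : ℕ) → p < length os →
       All (λ x → 1 < x) (take p os) → All (λ x → x ≡ 1) (drop p os) →
       ∃ λ c → N≡ (WedgeC (es ++ map (λ o → o ∸ 1) (take p os))) c
             × N≡ (CB m) (product es * F (decEven m) + product os * c))
proposition4p7 m es os perm positive ev _ lenE od _ lenO =
  (λ _ → count-≡ (cong₂ _+_ evenPart≡ oddPart≡F) count-CB-parts) ,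
  λ p p<l big ones → let wl = es ++ map (λ o → o ∸ 1) (take p os) in
    wedgeN wl , count-wedge wl , count-≡ (cong₂ _+_ evenPart≡ (oddPart≡wedge p p<l big ones)) count-CB-parts
  where open CBEvaluation.ParityDecomposition m es os perm positive ev lenE od lenO
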